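{- Let $G$ be a cubic graph that has a 3-decomposition and contains an induced 4-cycle with vertices $u_1,u_2,u_4,u_3$ in this cyclic order (edges $u_1u_2,u_2u_4,u_4u_3,u_3u_1$). For $i=1,\dots,4$ let $w_i$ be the neighbour of $u_i$ not on this cycle (the $w_i$ need not be distinct). Let $H$ be obtained from $G$ by deleting $u_1,\dots,u_4$, adding new vertices $a_1,\dots,a_6$ with edges $a_1a_2,a_1a_5,a_2a_6,a_5a_3,a_5a_4,a_6a_3,a_6a_4$ (a twin-house), and adding the edges $a_iw_i$ for $i=1,\dots,4$. Then $H$ has a 3-decomposition.
   Context: All graphs are finite and simple. A 3-decomposition of a graph $G$ is a triple $(T,C,M)$ of subgraphs such that every edge of $G$ lies in exactly one of them, $T$ is a spanning tree of $G$, $C$ is a (possibly empty) 2-regular graph, and $M$ is a (possibly empty) matching. -}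

module Defs where

open import Data.Nat using (ℕ; _≤_)
open import Data.Fin using (Fin; zero; suc; _≟_)
open import Data.Bool using (Bool; T; not; _∨_)
open import Data.List using (List; []; _∷_; _++_; length)
open import Data.List.Membership.Propositional using (_∈_)
open import Data.List.Relation.Unary.Unique.Propositional using (Unique)
open import Data.List.Relation.Unary.Linked using (Linked)
open import Data.Product using (Σ; _×_; _,_)
open import Data.Sum using (_⊎_)
open import Relation.Nullary using (¬_)
open import Relation.Nullary.Decidable using (⌊_⌋)
open import Relation.Binary.PropositionalEquality using (_≡_; _≢_)
open import Relation.Binary.Construct.Closure.ReflexiveTransitive using (Star)

-- A (finite, simple) graph is given by its vertex type and an adjacency
-- relation; edge sets of subgraphs are also adjacency relations.
Adj : Set → Set₁
Adj V = V → V → Set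

record IsSimple {V : Set} (E : Adj V) : Set where
  field
    sym     : ∀ {x y} → E x y → E y x
    irrefl  : ∀ {x} → ¬ E x x

Degree : {V : Set} → Adj V → V → ℕ → Set
Degree {V} E v k =
  Σ (List V) λ l → length l ≡ k × Unique l × (∀ w → (E v w → w ∈ l) × (w ∈ l → E v w))

Cubic : {V : Set} → Adj V → Set
Cubic E = ∀ v → Degree E v 3

SubgraphOf : {V : Set} → Adj V → Adj V → Set
SubgraphOf S E = (∀ {x y} → S x y → E x y) × (∀ {x y} → S x y → S y x)

HasCycle : {V : Set} → Adj V → Set
HasCycle {V} E = Σ V λ x → Σ (List V) λ xs →
  2 ≤ length xs × Unique (x ∷ xs) × Linked E (x ∷ xs ++ x ∷ [])

SpanningTree : {V : Set} → Adj V → Adj V → Set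
SpanningTree E T = SubgraphOf T E × (∀ x y → Star T x y) × ¬ HasCycle T

TwoRegular : {V : Set} → Adj V → Adj V → Set
TwoRegular E C = SubgraphOf C E × (∀ v → Degree C v 0 ⊎ Degree C v 2)

IsMatching : {V : Set} → Adj V → Adj V → Set
IsMatching E M = SubgraphOf M E × (∀ v → Degree M v 0 ⊎ Degree M v 1)

ExactlyOne : Set → Set → Set → Set
ExactlyOne A B C = (A × ¬ B × ¬ C) ⊎ (¬ A × B × ¬ C) ⊎ (¬ A × ¬ B × C)

ThreeDecomposition : {V : Set} → Adj V → Adj V → Adj V → Adj V → Set
ThreeDecomposition E T C M =
  SpanningTree E T × TwoRegular E C × IsMatching E M ×
  (∀ x y → E x y → ExactlyOne (T x y) (C x y) (M x y))

HasThreeDecomposition : {V : Set} → Adj V → Set₁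
HasThreeDecomposition {V} E =
  Σ (Adj V) λ T → Σ (Adj V) λ C → Σ (Adj V) λ M → ThreeDecomposition E T C M

-- induced 4-cycle with vertices u1,u2,u4,u3 in this cyclic order
InducedC4 : {n : ℕ} → Adj (Fin n) → (u1 u2 u3 u4 : Fin n) → Set
InducedC4 E u1 u2 u3 u4 =
  (u1 ≢ u2 × u1 ≢ u3 × u1 ≢ u4 × u2 ≢ u3 × u2 ≢ u4 × u3 ≢ u4) ×
  (E u1 u2 × E u2 u4 × E u4 u3 × E u3 u1) ×
  (¬ E u1 u4 × ¬ E u2 u3)

OffCycle : {n : ℕ} → (u1 u2 u3 u4 w : Fin n) → Set
OffCycle u1 u2 u3 u4 w = w ≢ u1 × w ≢ u2 × w ≢ u3 × w ≢ u4

notCyc : {n : ℕ} → (u1 u2 u3 u4 v : Fin n) → Bool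
notCyc u1 u2 u3 u4 v = not (⌊ v ≟ u1 ⌋ ∨ ⌊ v ≟ u2 ⌋ ∨ ⌊ v ≟ u3 ⌋ ∨ ⌊ v ≟ u4 ⌋)

-- vertices of H: the vertices of G other than u1..u4, plus a1..a6
-- (a_i is represented by the element i-1 of Fin 6)
HV : (n : ℕ) → (u1 u2 u3 u4 : Fin n) → Set
HV n u1 u2 u3 u4 = (Σ (Fin n) λ v → T (notCyc u1 u2 u3 u4 v)) ⊎ Fin 6

a1 a2 a3 a4 a5 a6 : Fin 6
a1 = zero
a2 = suc zero
a3 = suc (suc zero)
a4 = suc (suc (suc zero))
a5 = suc (suc (suc (suc zero)))
a6 = suc (suc (suc (suc (suc zero))))

-- the twin-house edges a1a2, a1a5, a2a6, a5a3, a5a4, a6a3, a6a4 (one orientation)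
data House : Fin 6 → Fin 6 → Set where
  e12 : House a1 a2
  e15 : House a1 a5
  e26 : House a2 a6
  e53 : House a5 a3
  e54 : House a5 a4
  e63 : House a6 a3
  e64 : House a6 a4

data Attach {n : ℕ} (w1 w2 w3 w4 : Fin n) (x : Fin n) : Fin 6 → Set where
  at1 : x ≡ w1 → Attach w1 w2 w3 w4 x a1
  at2 : x ≡ w2 → Attach w1 w2 w3 w4 x a2
  at3 : x ≡ w3 → Attach w1 w2 w3 w4 x a3
  at4 : x ≡ w4 → Attach w1 w2 w3 w4 x a4

HE : {n : ℕ} → Adj (Fin n) → (u1 u2 u3 u4 w1 w2 w3 w4 : Fin n) → Adj (HV n u1 u2 u3 u4)
HE E u1 u2 u3 u4 w1 w2 w3 w4 (_⊎_.inj₁ (x , _)) (_⊎_.inj₁ (y , _)) = E x y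
HE E u1 u2 u3 u4 w1 w2 w3 w4 (_⊎_.inj₁ (x , _)) (_⊎_.inj₂ j) = Attach w1 w2 w3 w4 x j
HE E u1 u2 u3 u4 w1 w2 w3 w4 (_⊎_.inj₂ i) (_⊎_.inj₁ (y , _)) = Attach w1 w2 w3 w4 y i
HE E u1 u2 u3 u4 w1 w2 w3 w4 (_⊎_.inj₂ i) (_⊎_.inj₂ j) = House i j ⊎ House j i

-- Fix a 3-decomposition (T, C, M) of G and record the part containing each of the eight
-- edges at the 4-cycle: the four cycle edges and the four edges uᵢwᵢ.  Since C is 2-regular,
-- M is a matching and T is connected, only the patterns TTT, TTM and TCC (in some order) occur
-- at a uᵢ.  For each such configuration we assign parts to the eleven gadget edges of H (the
-- seven house edges and the aᵢwᵢ), keep T, C and M outside the gadget, and count C- and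
-- M-degrees at a₁, …, a₆.  The new T is a spanning tree of H because contracting aᵢ onto uᵢ
-- and a₅, a₆ onto two cycle vertices maps it onto T without creating cycles; in a few
-- configurations this tree is then modified by edge exchanges.  The remaining configurations
-- cannot occur: there T would contain the 4-cycle, or could not leave a set of cycle vertices.

module Submission where

open import Data.Nat using (ℕ; zero; suc; _≤_; z≤n; s≤s) renaming (_≟_ to _≟ℕ_)
open import Data.Nat.Properties using (+-comm; suc-injective; m≤n⇒m≤1+n)
open import Data.Fin using (Fin; zero; suc; _≟_)
open import Data.Fin.Properties using (all?)
open import Data.Bool using (Bool; true; false; T; not; _∨_; _∧_; if_then_else_; T?)
open import Data.Bool.Properties using (T-irrelevant)
open import Data.Unit using (tt)
open import Data.Empty using (⊥; ⊥-elim)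
open import Data.Maybe using (Maybe; just; nothing; is-just)
open import Data.Maybe.Properties using (just-injective; ≡-dec)
open import Data.Product using (Σ; _×_; _,_; proj₁; proj₂)
open import Data.Sum using (_⊎_; inj₁; inj₂)
open import Data.Sum.Properties using (inj₂-injective)
open import Data.List using (List; []; _∷_; _++_; length; map)
open import Data.List.Properties using (++-assoc; ++-identityʳ; length-++)
open import Data.List.Membership.Propositional using (_∈_)
open import Data.List.Membership.Propositional.Properties using (∈-∃++; ∈-++⁻; ∈-++⁺ʳ)
open import Data.List.Relation.Unary.Any using (Any; here; there; any?)
open import Data.List.Relation.Unary.All using (All; []; _∷_)
open import Data.List.Relation.Unary.All.Properties using (∷ʳ⁺; ¬Any⇒All¬; All¬⇒¬Any)
open import Data.List.Relation.Unary.AllPairs using ([]; _∷_)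
open import Data.List.Relation.Unary.Unique.Propositional using (Unique)
open import Data.List.Relation.Unary.Unique.Propositional.Properties using (++⁺)
open import Data.List.Relation.Unary.Linked using (Linked; []; [-]; _∷_)
open import Relation.Nullary using (¬_; Dec; yes; no)
open import Relation.Nullary.Decidable using (⌊_⌋; toWitness; fromWitness; map′)
open import Relation.Binary.Definitions using (DecidableEquality; Symmetric)
open import Relation.Binary.PropositionalEquality using (_≡_; _≢_; refl; sym; trans; cong; cong₂; subst; subst₂)
open import Relation.Binary.Construct.Closure.ReflexiveTransitive as Star
  using (Star; ε; _◅_; _◅◅_; gmap; kleisliStar; _⋆)
open import Defs

SameEdge : {V : Set} → V → V → V → V → Set
SameEdge p q a b = (a ≡ p × b ≡ q) ⊎ (a ≡ q × b ≡ p)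

WithoutEdge : {V : Set} → Adj V → V → V → Adj V
WithoutEdge R p q a b = R a b × ¬ SameEdge p q a b

uniqueSuffix : {V : Set} (pre : List V) {suf : List V} → Unique (pre ++ suf) → Unique suf
uniqueSuffix [] u = u
uniqueSuffix (x ∷ pre) (_ ∷ u) = uniqueSuffix pre u

linkedSuffix : {V : Set} {R : Adj V} (pre : List V) {suf : List V} → Linked R (pre ++ suf) → Linked R suf
linkedSuffix [] l = l
linkedSuffix (x ∷ []) {[]} l = []
linkedSuffix (x ∷ []) {y ∷ suf} (r ∷ l) = l
linkedSuffix (x ∷ y ∷ pre) (r ∷ l) = linkedSuffix (y ∷ pre) l

linkedMap : {V : Set} {R S : Adj V} → (∀ {a b} → R a b → S a b) → ∀ {l} → Linked R l → Linked S l
linkedMap f [] = []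
linkedMap f [-] = [-]
linkedMap f (r ∷ l) = f r ∷ linkedMap f l

linkedSnoc : {V : Set} {R : Adj V} (xs : List V) {p q : V} → Linked R (xs ++ p ∷ []) → R p q →
  Linked R (xs ++ p ∷ q ∷ [])
linkedSnoc [] [-] r = r ∷ [-]
linkedSnoc (x ∷ []) (r0 ∷ [-]) r = r0 ∷ r ∷ [-]
linkedSnoc (x ∷ y ∷ xs) (r0 ∷ l) r = r0 ∷ linkedSnoc (y ∷ xs) l r

linkedSplit : {V : Set} {R : Adj V} (xs : List V) {z : V} {ys : List V} → Linked R (xs ++ z ∷ ys) →
  Linked R (xs ++ z ∷ []) × Linked R (z ∷ ys)
linkedSplit [] l = [-] , l
linkedSplit (x ∷ []) (r ∷ l) = (r ∷ [-]) , l
linkedSplit (x ∷ y ∷ xs) (r ∷ l) with linkedSplit (y ∷ xs) l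
... | a , b = (r ∷ a) , b

linkedJoin : {V : Set} {R : Adj V} (xs : List V) {z : V} {ys : List V} → Linked R (xs ++ z ∷ []) → Linked R (z ∷ ys) →
  Linked R (xs ++ z ∷ ys)
linkedJoin [] l1 l2 = l2
linkedJoin (x ∷ []) (r ∷ [-]) l2 = r ∷ l2
linkedJoin (x ∷ y ∷ xs) (r ∷ l1) l2 = r ∷ linkedJoin (y ∷ xs) l1 l2

uniqueRot1 : {V : Set} {x : V} {xs : List V} → Unique (x ∷ xs) → Unique (xs ++ x ∷ [])
uniqueRot1 {xs = []} (_ ∷ u) = [] ∷ []
uniqueRot1 {x = x} {xs = y ∷ xs} ((x≢y ∷ x∉) ∷ (y∉ ∷ u)) =
  ∷ʳ⁺ y∉ (λ e → x≢y (sym e)) ∷ uniqueRot1 {x = x} {xs = xs} (x∉ ∷ u)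

uniqueSwap : {V : Set} (p : List V) {q : List V} → Unique (p ++ q) → Unique (q ++ p)
uniqueSwap [] {q} u = subst Unique (sym (++-identityʳ q)) u
uniqueSwap (x ∷ p) {q} u =
  subst Unique (++-assoc q (x ∷ []) p)
    (uniqueSwap p {q ++ x ∷ []} (subst Unique (++-assoc p q (x ∷ [])) (uniqueRot1 {x = x} {xs = p ++ q} u)))

module LoopErasure {V : Set} (_≟_ : DecidableEquality V) {R : Adj V} where

  loopErase : {a b : V} → a ≢ b → Star R a b →
    Σ (List V) λ l → Unique (a ∷ l ++ b ∷ []) × Linked R (a ∷ l ++ b ∷ [])
  loopErase a≢b ε = ⊥-elim (a≢b refl)
  loopErase {a} {b} a≢b (_◅_ {j = c} r rs) with c ≟ b
  ... | yes refl = [] , (((a≢b ∷ []) ∷ ([] ∷ [])) , (r ∷ [-]))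
  ... | no c≢b with loopErase c≢b rs
  ...   | l , u , lk with any? (a ≟_) (c ∷ l)
  ...     | no nm = c ∷ l , (∷ʳ⁺ (¬Any⇒All¬ (c ∷ l) nm) a≢b ∷ u) , (r ∷ lk)
  ...     | yes m with ∈-∃++ m
  ...       | pre , suf , e =
            suf , uniqueSuffix pre (subst Unique eq u) , linkedSuffix pre (subst (Linked R) eq lk)
    where
    eq : c ∷ l ++ b ∷ [] ≡ pre ++ a ∷ suf ++ b ∷ []
    eq = trans (cong (_++ b ∷ []) e) (++-assoc pre (a ∷ suf) (b ∷ []))

module Detour {V : Set} (_≟_ : DecidableEquality V) {R : Adj V} where

  detour⇒cycle : {x y : V} → R x y → x ≢ y → Star (WithoutEdge R x y) y x → HasCycle R
  detour⇒cycle {x} {y} rxy x≢y path with LoopErasure.loopErase _≟_ {WithoutEdge R x y} (λ e → x≢y (sym e)) path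
  ... | [] , u , (r ∷ [-]) = ⊥-elim (proj₂ r (inj₂ (refl , refl)))
  ... | (z ∷ l) , u , lk =
    y , (z ∷ l ++ x ∷ []) , len , u , subst (Linked R) (sym (++-assoc (y ∷ z ∷ l) (x ∷ []) (y ∷ [])))
      (linkedSnoc (y ∷ z ∷ l) (linkedMap proj₁ lk) rxy)
    where
    len : 2 ≤ length (z ∷ l ++ x ∷ [])
    len = s≤s (subst (1 ≤_) (sym (trans (length-++ l) (+-comm (length l) 1))) (s≤s z≤n))

CycleAt : {V : Set} → Adj V → V → List V → Set
CycleAt R x0 xs = 2 ≤ length xs × Unique (x0 ∷ xs) × Linked R (x0 ∷ xs ++ x0 ∷ [])

length-++-comm : {V : Set} (p q : List V) → length (p ++ q) ≡ length (q ++ p)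
length-++-comm p q = trans (length-++ p) (trans (+-comm (length p) (length q)) (sym (length-++ q)))

rotateCycle : {V : Set} {R : Adj V} {x0 : V} {xs : List V} (pre : List V) {q : V} {qs : List V} →
  x0 ∷ xs ≡ pre ++ q ∷ qs → CycleAt R x0 xs → CycleAt R q (qs ++ pre)
rotateCycle {R = R} {x0} {xs} [] {q} {qs} refl (len , u , lk) =
  subst (λ l → CycleAt R q l) (sym (++-identityʳ qs)) (len , u , lk)
rotateCycle {R = R} {x0} {xs} (p0 ∷ pre) {q} {qs} refl (len , u , lk) = len2 , u2 , lk2
  where
  len2 : 2 ≤ length (qs ++ p0 ∷ pre)
  len2 = subst (2 ≤_) (suc-injective (length-++-comm (p0 ∷ pre) (q ∷ qs))) len
  u2 : Unique (q ∷ qs ++ p0 ∷ pre)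
  u2 = uniqueSwap (p0 ∷ pre) u
  lkA : Linked R ((p0 ∷ pre) ++ q ∷ qs ++ p0 ∷ [])
  lkA = subst (Linked R) (++-assoc (p0 ∷ pre) (q ∷ qs) (p0 ∷ [])) lk
  sp : Linked R ((p0 ∷ pre) ++ q ∷ []) × Linked R (q ∷ qs ++ p0 ∷ [])
  sp = linkedSplit (p0 ∷ pre) lkA
  lk2 : Linked R (q ∷ (qs ++ p0 ∷ pre) ++ q ∷ [])
  lk2 = subst (Linked R) (sym (cong (q ∷_) (++-assoc qs (p0 ∷ pre) (q ∷ []))))
          (linkedJoin (q ∷ qs) (proj₂ sp) (proj₁ sp))

module FindEdge {V : Set} {R : Adj V} (P : V → V → Set) (P? : (a b : V) → Dec (P a b)) where

  RnP : Adj V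
  RnP a b = R a b × ¬ P a b

  Found : Set
  Found = Σ V λ y0 → Σ V λ y1 → Σ (List V) λ ys → CycleAt R y0 (y1 ∷ ys) × P y0 y1

  search : (x0 : V) (xs : List V) → CycleAt R x0 xs → (pre rest : List V) → x0 ∷ xs ≡ pre ++ rest →
    Linked R (rest ++ x0 ∷ []) → Linked RnP (rest ++ x0 ∷ []) ⊎ Found
  search x0 xs c pre [] e lk = inj₁ [-]
  search x0 xs c pre (a ∷ []) e (r ∷ [-]) with P? a x0
  ... | no np = inj₁ ((r , np) ∷ [-])
  search x0 .[] c [] (a ∷ []) refl (r ∷ [-]) | yes p with proj₁ c
  ... | ()
  search x0 xs c (z ∷ pre1) (a ∷ []) e (r ∷ [-]) | yes p with e
  ... | refl = inj₂ (a , z , pre1 , rotateCycle (z ∷ pre1) e c , p)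
  search x0 xs c pre (a ∷ b ∷ rest) e (r ∷ lk) with P? a b
  ... | yes p = inj₂ (a , b , rest ++ pre , rotateCycle pre e c , p)
  ... | no np with search x0 xs c (pre ++ a ∷ []) (b ∷ rest)
                     (trans e (sym (++-assoc pre (a ∷ []) (b ∷ rest)))) lk
  ...   | inj₁ l = inj₁ ((r , np) ∷ l)
  ...   | inj₂ f = inj₂ f

  findEdge : (x0 : V) (xs : List V) → CycleAt R x0 xs → Linked RnP (x0 ∷ xs ++ x0 ∷ []) ⊎ Found
  findEdge x0 xs c = search x0 xs c [] (x0 ∷ xs) refl (proj₂ (proj₂ c))

module CycleDetour {V : Set} {R : Adj V} where

  Avoids : V → V → V → Set
  Avoids a b z = z ≢ a × z ≢ b

  avoidingPath : {a b t : V} (v : V) (ys : List V) → Avoids a b v → All (Avoids a b) ys →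
    Linked R (v ∷ ys ++ t ∷ []) → Star (WithoutEdge R a b) v t
  avoidingPath v [] nv [] (r ∷ [-]) = (r , bad) ◅ ε
    where
    bad : ¬ SameEdge _ _ _ _
    bad (inj₁ (e , _)) = proj₁ nv e
    bad (inj₂ (e , _)) = proj₂ nv e
  avoidingPath v (y ∷ ys) nv (ny ∷ nys) (r ∷ lk) = (r , bad) ◅ avoidingPath y ys ny nys lk
    where
    bad : ¬ SameEdge _ _ _ _
    bad (inj₁ (e , _)) = proj₁ nv e
    bad (inj₂ (e , _)) = proj₂ nv e

  avoidBoth : {a b : V} {ys : List V} → All (λ z → ¬ a ≡ z) ys → All (λ z → ¬ b ≡ z) ys → All (Avoids a b) ys
  avoidBoth [] [] = []
  avoidBoth (p ∷ ps) (q ∷ qs) = ((λ e → p (sym e)) , (λ e → q (sym e))) ∷ avoidBoth ps qs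

  cycle⇒detour : {y0 y1 : V} {ys : List V} → CycleAt R y0 (y1 ∷ ys) → Star (WithoutEdge R y0 y1) y1 y0
  cycle⇒detour {y0} {y1} {[]} (s≤s () , u , lk)
  cycle⇒detour {y0} {y1} {z ∷ ys} (len , ((n01 ∷ n0s) ∷ (n1s ∷ u)) , (r0 ∷ r1 ∷ lk)) with avoidBoth n0s n1s
  ... | nz ∷ nzs = (r1 , bad) ◅ avoidingPath z ys nz nzs lk
    where
    bad : ¬ SameEdge y0 y1 y1 z
    bad (inj₁ (_ , e)) = proj₂ nz e
    bad (inj₂ (_ , e)) = proj₁ nz e

-- Contraction and edge exchange

TwoCollapsed : {VH VG : Set} → Adj VH → (VH → VG) → VH → Set
TwoCollapsed R ψ v = Σ _ λ p → Σ _ λ q → p ≢ q × (R v p × ψ v ≡ ψ p) × (R v q × ψ v ≡ ψ q)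

-- If ψ maps every R-edge to an S-edge or to a single vertex, injectively on the edges it does
-- not collapse (h1, h2), and at most one vertex has two collapsed edges (h3), then every cycle
-- of R has a non-collapsed edge whose image has a detour in S.
module Contraction {VH VG : Set} (_≟G_ : DecidableEquality VG) {R : Adj VH} {S : Adj VG} (symR : Symmetric R) (ψ : VH → VG)
  (h1 : ∀ {p q} → R p q → ψ p ≢ ψ q → S (ψ p) (ψ q))
  (h2 : ∀ {p q p1 q1} → R p q → R p1 q1 → ψ p ≢ ψ q → ψ p ≡ ψ p1 → ψ q ≡ ψ q1 → p ≡ p1 × q ≡ q1)
  (h3 : ∀ {v v1} → TwoCollapsed R ψ v → TwoCollapsed R ψ v1 → v ≡ v1)
  where

  P : VH → VH → Set
  P a b = ψ a ≢ ψ b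

  P? : (a b : VH) → Dec (P a b)
  P? a b with ψ a ≟G ψ b
  ... | yes e = no (λ ne → ne e)
  ... | no ne = yes ne

  open FindEdge {R = R} P P?

  collapsed : {a b : VH} → ¬ P a b → ψ a ≡ ψ b
  collapsed {a} {b} nn with ψ a ≟G ψ b
  ... | yes e = e
  ... | no ne = ⊥-elim (nn ne)

  mapStep : {y0 y1 : VH} → R y0 y1 → ψ y0 ≢ ψ y1 → ∀ {c d} → WithoutEdge R y0 y1 c d → Star (WithoutEdge S (ψ y0) (ψ y1)) (ψ c) (ψ d)
  mapStep {y0} {y1} r01 n01 {c} {d} (rcd , ne) with ψ c ≟G ψ d
  ... | yes e = subst (Star _ (ψ c)) e ε
  ... | no ncd = (h1 rcd ncd , bad) ◅ ε
    where
    bad : ¬ SameEdge (ψ y0) (ψ y1) (ψ c) (ψ d)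
    bad (inj₁ (e1 , e2)) with h2 rcd r01 ncd e1 e2
    ... | refl , refl = ne (inj₁ (refl , refl))
    bad (inj₂ (e1 , e2)) with h2 rcd (symR r01) ncd e1 e2
    ... | refl , refl = ne (inj₂ (refl , refl))

  acyclic : ¬ HasCycle S → ¬ HasCycle R
  acyclic noS (x0 , xs , len , u , lk) with findEdge x0 xs (len , u , lk)
  acyclic noS (x0 , (x1 ∷ x2 ∷ rest) , len , ((n01 ∷ n02 ∷ n0r) ∷ ((n12 ∷ n1r) ∷ u)) , lk)
    | inj₁ (k01 ∷ k12 ∷ k2n) = n12 (h3 d1 (d2 rest n1r k2n))
    where
    d1 : TwoCollapsed R ψ x1
    d1 = x0 , x2 , n02 , (symR (proj₁ k01) , sym (collapsed (proj₂ k01))) , (proj₁ k12 , collapsed (proj₂ k12))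
    d2 : (rest : List VH) → All (λ z → ¬ x1 ≡ z) rest → Linked RnP (x2 ∷ rest ++ x0 ∷ []) → TwoCollapsed R ψ x2
    d2 [] [] (k ∷ [-]) = x1 , x0 , (λ e → n01 (sym e)) , (symR (proj₁ k12) , sym (collapsed (proj₂ k12))) , (proj₁ k , collapsed (proj₂ k))
    d2 (x3 ∷ rest) (n13 ∷ _) (k ∷ _) = x1 , x3 , n13 , (symR (proj₁ k12) , sym (collapsed (proj₂ k12))) , (proj₁ k , collapsed (proj₂ k))
  acyclic noS (x0 , [] , () , u , lk) | inj₁ _
  acyclic noS (x0 , (_ ∷ []) , s≤s () , u , lk) | inj₁ _
  acyclic noS (x0 , xs , len , u , lk) | inj₂ (y0 , y1 , ys , cyc , n01) with cyc
  ... | (_ , _ , (r01 ∷ _)) =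
    noS (Detour.detour⇒cycle _≟G_ (h1 r01 n01) n01 (kleisliStar ψ (mapStep r01 n01) (CycleDetour.cycle⇒detour cyc)))

  connected : (φ : VG → VH) → (∀ {a b} → S a b → Star R (φ a) (φ b)) → (∀ v → Σ VG λ x → Star R v (φ x)) →
    (∀ x y → Star S x y) → ∀ v w → Star R v w
  connected φ c1 c2 cS v w with c2 v | c2 w
  ... | x , pv | y , pw = pv ◅◅ (kleisliStar φ c1 (cS x y) ◅◅ Star.reverse symR pw)

-- R₂ arises from R₀ by replacing the edge pq by xy, and R₁ is their common part.  As x and y
-- are joined to p and q in R₁, a cycle of R₂ passes through xy and yields a detour of pq in R₀.
module EdgeExchange {V : Set} (_≟_ : DecidableEquality V) {R0 R1 R2 : Adj V} (s1 : Symmetric R1) (s2 : Symmetric R2) {p q x y : V}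
  (i1 : ∀ {a b} → R1 a b → R0 a b) (i2 : ∀ {a b} → R1 a b → ¬ SameEdge p q a b)
  (ii : ∀ {a b} → R0 a b → R1 a b ⊎ SameEdge p q a b)
  (iii : ∀ {a b} → R1 a b → R2 a b) (fx : R2 x y)
  (iv : ∀ {a b} → R2 a b → R1 a b ⊎ SameEdge x y a b)
  (r0pq : R0 p q) (p≢q : p ≢ q) (pathx : Star R1 x p) (pathy : Star R1 y q)
  where

  P : V → V → Set
  P = SameEdge x y

  P? : (a b : V) → Dec (P a b)
  P? a b with a ≟ x | b ≟ y | a ≟ y | b ≟ x
  ... | yes e1 | yes e2 | _ | _ = yes (inj₁ (e1 , e2))
  ... | _ | _ | yes e1 | yes e2 = yes (inj₂ (e1 , e2))
  ... | no n1 | _ | no n3 | _ = no λ { (inj₁ (e1 , _)) → n1 e1 ; (inj₂ (e1 , _)) → n3 e1 }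
  ... | no n1 | _ | _ | no n4 = no λ { (inj₁ (e1 , _)) → n1 e1 ; (inj₂ (_ , e2)) → n4 e2 }
  ... | _ | no n2 | no n3 | _ = no λ { (inj₁ (_ , e2)) → n2 e2 ; (inj₂ (e1 , _)) → n3 e1 }
  ... | _ | no n2 | _ | no n4 = no λ { (inj₁ (_ , e2)) → n2 e2 ; (inj₂ (_ , e2)) → n4 e2 }

  open FindEdge {R = R2} P P?

  pq-path : Star R2 p q
  pq-path = Star.map iii (Star.reverse s1 pathx) ◅◅ (fx ◅ Star.map iii pathy)

  connected : (∀ a b → Star R0 a b) → ∀ a b → Star R2 a b
  connected c a b = (step ⋆) (c a b)
    where
    step : ∀ {a b} → R0 a b → Star R2 a b
    step r with ii r
    ... | inj₁ r1 = iii r1 ◅ ε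
    ... | inj₂ (inj₁ (refl , refl)) = pq-path
    ... | inj₂ (inj₂ (refl , refl)) = Star.reverse s2 pq-path

  toR1 : ∀ {a b} → RnP a b → R1 a b
  toR1 (r , np) with iv r
  ... | inj₁ r1 = r1
  ... | inj₂ e = ⊥-elim (np e)

  toMinus : ∀ {a b} → R1 a b → WithoutEdge R0 p q a b
  toMinus r = i1 r , i2 r

  walkR1 : {y0 y1 : V} → SameEdge x y y0 y1 → ∀ {c d} → WithoutEdge R2 y0 y1 c d → R1 c d
  walkR1 exy (r , ne) with iv r
  ... | inj₁ r1 = r1
  walkR1 (inj₁ (refl , refl)) (r , ne) | inj₂ e = ⊥-elim (ne e)
  walkR1 (inj₂ (refl , refl)) (r , ne) | inj₂ (inj₁ (e1 , e2)) = ⊥-elim (ne (inj₂ (e1 , e2)))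
  walkR1 (inj₂ (refl , refl)) (r , ne) | inj₂ (inj₂ (e1 , e2)) = ⊥-elim (ne (inj₁ (e1 , e2)))

  acyclic : ¬ HasCycle R0 → ¬ HasCycle R2
  acyclic no0 (x0 , xs , len , u , lk) with findEdge x0 xs (len , u , lk)
  ... | inj₁ l = no0 (x0 , xs , len , u , linkedMap (λ r → i1 (toR1 r)) l)
  ... | inj₂ (y0 , y1 , ys , cyc , e) = no0 (Detour.detour⇒cycle _≟_ r0pq p≢q (Star.map toMinus qp))
    where
    w : Star R1 y1 y0
    w = Star.map (walkR1 e) (CycleDetour.cycle⇒detour cyc)
    qpw : SameEdge x y y0 y1 → Star R1 y1 y0 → Star R1 q p
    qpw (inj₁ (refl , refl)) w1 = Star.reverse s1 pathy ◅◅ (w1 ◅◅ pathx)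
    qpw (inj₂ (refl , refl)) w1 = Star.reverse s1 pathy ◅◅ (Star.reverse s1 w1 ◅◅ pathx)
    qp : Star R1 q p
    qp = qpw e w

Restrict : {V : Set} → Adj V → (V → Set) → Adj V
Restrict R S c d = R c d × S c × S d

firstExit : {V : Set} {R : Adj V} (S : V → Set) (S? : ∀ v → Dec (S v)) {x y : V} → S x → ¬ S y → Star R x y →
  Σ V λ a → Σ V λ b → R a b × S a × ¬ S b × Star (Restrict R S) x a
firstExit S S? sx ny ε = ⊥-elim (ny sx)
firstExit S S? {x} sx ny (_◅_ {j = z} r rs) with S? z
... | no nz = x , z , r , sx , nz , ε
... | yes sz with firstExit S S? sz ny rs
...   | a , b , rab , sa , nb , p = a , b , rab , sa , nb , ((r , sx , sz) ◅ p)

data Part : Set where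
  inT inC inM : Part

partOf : {A B D : Set} → ExactlyOne A B D → Part
partOf (inj₁ _) = inT
partOf (inj₂ (inj₁ _)) = inC
partOf (inj₂ (inj₂ _)) = inM

module _ {A B D : Set} where
  partOf-T : (x : ExactlyOne A B D) → A → partOf x ≡ inT
  partOf-T (inj₁ _) a = refl
  partOf-T (inj₂ (inj₁ (na , _))) a = ⊥-elim (na a)
  partOf-T (inj₂ (inj₂ (na , _))) a = ⊥-elim (na a)
  partOf-C : (x : ExactlyOne A B D) → B → partOf x ≡ inC
  partOf-C (inj₁ (_ , nb , _)) b = ⊥-elim (nb b)
  partOf-C (inj₂ (inj₁ _)) b = refl
  partOf-C (inj₂ (inj₂ (_ , nb , _))) b = ⊥-elim (nb b)
  partOf-M : (x : ExactlyOne A B D) → D → partOf x ≡ inM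
  partOf-M (inj₁ (_ , _ , nd)) d = ⊥-elim (nd d)
  partOf-M (inj₂ (inj₁ (_ , _ , nd))) d = ⊥-elim (nd d)
  partOf-M (inj₂ (inj₂ _)) d = refl
  partOf-T⁻ : (x : ExactlyOne A B D) → partOf x ≡ inT → A
  partOf-T⁻ (inj₁ (a , _)) _ = a
  partOf-T⁻ (inj₂ (inj₁ _)) ()
  partOf-T⁻ (inj₂ (inj₂ _)) ()
  partOf-C⁻ : (x : ExactlyOne A B D) → partOf x ≡ inC → B
  partOf-C⁻ (inj₁ _) ()
  partOf-C⁻ (inj₂ (inj₁ (_ , b , _))) _ = b
  partOf-C⁻ (inj₂ (inj₂ _)) ()
  partOf-M⁻ : (x : ExactlyOne A B D) → partOf x ≡ inM → D
  partOf-M⁻ (inj₁ _) ()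
  partOf-M⁻ (inj₂ (inj₁ _)) ()
  partOf-M⁻ (inj₂ (inj₂ (_ , _ , d))) _ = d

In3 : {V : Set} → V → V → V → V → Set
In3 b p q r = b ≡ p ⊎ b ≡ q ⊎ b ≡ r

mem3 : {V : Set} {b p q r : V} → b ∈ (p ∷ q ∷ r ∷ []) → In3 b p q r
mem3 (here e) = inj₁ e
mem3 (there (here e)) = inj₂ (inj₁ e)
mem3 (there (there (here e))) = inj₂ (inj₂ e)

module Cover {V : Set} (_≟V_ : DecidableEquality V) where
  cover : {x y z p q r : V} → In3 x p q r → In3 y p q r → In3 z p q r → x ≢ y → x ≢ z → y ≢ z → In3 p x y z
  cover {x} {y} {z} {p} ix iy iz nxy nxz nyz with p ≟V x | p ≟V y | p ≟V z
  ... | yes e | _ | _ = inj₁ e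
  ... | no _ | yes e | _ = inj₂ (inj₁ e)
  ... | no _ | no _ | yes e = inj₂ (inj₂ e)
  ... | no n1 | no n2 | no n3 = ⊥-elim (go ix iy iz)
    where
    go : In3 x p _ _ → In3 y p _ _ → In3 z p _ _ → ⊥
    go (inj₁ e) _ _ = n1 (sym e)
    go _ (inj₁ e) _ = n2 (sym e)
    go _ _ (inj₁ e) = n3 (sym e)
    go (inj₂ (inj₁ refl)) (inj₂ (inj₁ refl)) _ = nxy refl
    go (inj₂ (inj₂ refl)) (inj₂ (inj₂ refl)) _ = nxy refl
    go (inj₂ (inj₁ refl)) _ (inj₂ (inj₁ refl)) = nxz refl
    go (inj₂ (inj₂ refl)) _ (inj₂ (inj₂ refl)) = nxz refl
    go _ (inj₂ (inj₁ refl)) (inj₂ (inj₁ refl)) = nyz refl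
    go _ (inj₂ (inj₂ refl)) (inj₂ (inj₂ refl)) = nyz refl

  rotIn : {x p q r : V} → In3 x p q r → In3 x q r p
  rotIn (inj₁ e) = inj₂ (inj₂ e)
  rotIn (inj₂ (inj₁ e)) = inj₁ e
  rotIn (inj₂ (inj₂ e)) = inj₂ (inj₁ e)

  trans3 : {b p q r x y z : V} → In3 b p q r → In3 p x y z → In3 q x y z → In3 r x y z → In3 b x y z
  trans3 (inj₁ refl) ip _ _ = ip
  trans3 (inj₂ (inj₁ refl)) _ iq _ = iq
  trans3 (inj₂ (inj₂ refl)) _ _ ir = ir

  classify3 : {b x y z : V} (l : List V) → length l ≡ 3 → x ∈ l → y ∈ l → z ∈ l → x ≢ y → x ≢ z → y ≢ z →
    b ∈ l → In3 b x y z
  classify3 (p ∷ q ∷ r ∷ []) refl mx my mz nxy nxz nyz mb =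
    trans3 (mem3 mb) (cover ix iy iz nxy nxz nyz) (cover (rotIn ix) (rotIn iy) (rotIn iz) nxy nxz nyz)
      (cover (rotIn (rotIn ix)) (rotIn (rotIn iy)) (rotIn (rotIn iz)) nxy nxz nyz)
    where
    ix = mem3 mx
    iy = mem3 my
    iz = mem3 mz

degree0-no-edge : {V : Set} {R : Adj V} {v b : V} → Degree R v 0 → R v b → ⊥
degree0-no-edge ([] , refl , u , ch) r with proj₁ (ch _) r
... | ()

degree1-unique : {V : Set} {R : Adj V} {v b b1 : V} → Degree R v 1 → R v b → R v b1 → b ≡ b1
degree1-unique ((p ∷ []) , refl , u , ch) r r1 with proj₁ (ch _) r | proj₁ (ch _) r1
... | here refl | here refl = refl

degree2-not-one : {V : Set} {R : Adj V} {v x : V} → Degree R v 2 → (∀ b → R v b → b ≡ x) → ⊥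
degree2-not-one ((p ∷ q ∷ []) , refl , ((npq ∷ []) ∷ _) , ch) one =
  npq (trans (one p (proj₂ (ch p) (here refl))) (sym (one q (proj₂ (ch q) (there (here refl))))))

degree2-not-three : {V : Set} {R : Adj V} {v x y z : V} → Degree R v 2 → R v x → R v y → R v z → x ≢ y → x ≢ z → y ≢ z → ⊥
degree2-not-three ((p ∷ q ∷ []) , refl , u , ch) rx ry rz nxy nxz nyz
  with proj₁ (ch _) rx | proj₁ (ch _) ry | proj₁ (ch _) rz
... | here refl | here refl | _ = nxy refl
... | there (here refl) | there (here refl) | _ = nxy refl
... | here refl | _ | here refl = nxz refl
... | there (here refl) | _ | there (here refl) = nxz refl
... | _ | here refl | here refl = nyz refl
... | _ | there (here refl) | there (here refl) = nyz refl

pattern A1 = zero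
pattern A2 = suc zero
pattern A3 = suc (suc zero)
pattern A4 = suc (suc (suc zero))
pattern A5 = suc (suc (suc (suc zero)))
pattern A6 = suc (suc (suc (suc (suc zero))))

-- I0, …, I3 index u₁, …, u₄ and w₁, …, w₄.
pattern I0 = zero
pattern I1 = suc zero
pattern I2 = suc (suc zero)
pattern I3 = suc (suc (suc zero))

data HEdge : Set where
  h12 h15 h26 h53 h54 h63 h64 : HEdge

data GEdge : Set where
  house : HEdge → GEdge
  pendant : Fin 4 → GEdge

Selection : Set
Selection = GEdge → Bool

aOf : Fin 4 → Fin 6
aOf I0 = A1
aOf I1 = A2
aOf I2 = A3
aOf I3 = A4

pendantIndex : Fin 6 → Maybe (Fin 4)
pendantIndex A1 = just I0
pendantIndex A2 = just I1
pendantIndex A3 = just I2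
pendantIndex A4 = just I3
pendantIndex A5 = nothing
pendantIndex A6 = nothing

pendantIndex-aOf⁻ : (j : Fin 6) {i : Fin 4} → pendantIndex j ≡ just i → j ≡ aOf i
pendantIndex-aOf⁻ A1 refl = refl
pendantIndex-aOf⁻ A2 refl = refl
pendantIndex-aOf⁻ A3 refl = refl
pendantIndex-aOf⁻ A4 refl = refl
pendantIndex-aOf⁻ A5 ()
pendantIndex-aOf⁻ A6 ()

pendantIndex-aOf : (i : Fin 4) → pendantIndex (aOf i) ≡ just i
pendantIndex-aOf I0 = refl
pendantIndex-aOf I1 = refl
pendantIndex-aOf I2 = refl
pendantIndex-aOf I3 = refl

aOf-injective : (i j : Fin 4) → aOf i ≡ aOf j → i ≡ j
aOf-injective i j e = just-injective (trans (sym (pendantIndex-aOf i)) (trans (cong pendantIndex e) (pendantIndex-aOf j)))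

houseEnds : HEdge → Fin 6 × Fin 6
houseEnds h12 = A1 , A2
houseEnds h15 = A1 , A5
houseEnds h26 = A2 , A6
houseEnds h53 = A5 , A3
houseEnds h54 = A5 , A4
houseEnds h63 = A6 , A3
houseEnds h64 = A6 , A4

houseEdge : Fin 6 → Fin 6 → Maybe HEdge
houseEdge A1 A2 = just h12
houseEdge A1 A5 = just h15
houseEdge A2 A1 = just h12
houseEdge A2 A6 = just h26
houseEdge A3 A5 = just h53
houseEdge A3 A6 = just h63
houseEdge A4 A5 = just h54
houseEdge A4 A6 = just h64
houseEdge A5 A1 = just h15
houseEdge A5 A3 = just h53
houseEdge A5 A4 = just h54
houseEdge A6 A2 = just h26
houseEdge A6 A3 = just h63
houseEdge A6 A4 = just h64
houseEdge _ _ = nothing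

hidx : HEdge → ℕ
hidx h12 = 0
hidx h15 = 1
hidx h26 = 2
hidx h53 = 3
hidx h54 = 4
hidx h63 = 5
hidx h64 = 6

hedgeOfIdx : ℕ → HEdge
hedgeOfIdx 0 = h12
hedgeOfIdx 1 = h15
hedgeOfIdx 2 = h26
hedgeOfIdx 3 = h53
hedgeOfIdx 4 = h54
hedgeOfIdx 5 = h63
hedgeOfIdx _ = h64

hedgeOfIdx-hidx : (e : HEdge) → hedgeOfIdx (hidx e) ≡ e
hedgeOfIdx-hidx h12 = refl
hedgeOfIdx-hidx h15 = refl
hedgeOfIdx-hidx h26 = refl
hedgeOfIdx-hidx h53 = refl
hedgeOfIdx-hidx h54 = refl
hedgeOfIdx-hidx h63 = refl
hedgeOfIdx-hidx h64 = refl

hidx-injective : (e f : HEdge) → hidx e ≡ hidx f → e ≡ f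
hidx-injective e f eq = trans (sym (hedgeOfIdx-hidx e)) (trans (cong hedgeOfIdx eq) (hedgeOfIdx-hidx f))

_≟ʰ_ : DecidableEquality HEdge
e ≟ʰ f = map′ (hidx-injective e f) (cong hidx) (hidx e ≟ℕ hidx f)

houseEdge-sym : (i j : Fin 6) → houseEdge i j ≡ houseEdge j i
houseEdge-sym = toWitness {a? = all? λ i → all? λ j → ≡-dec _≟ʰ_ (houseEdge i j) (houseEdge j i)} tt

houseEdge-ends : (i j : Fin 6) {e : HEdge} → houseEdge i j ≡ just e →
  (i ≡ proj₁ (houseEnds e) × j ≡ proj₂ (houseEnds e)) ⊎ (i ≡ proj₂ (houseEnds e) × j ≡ proj₁ (houseEnds e))
houseEdge-ends A1 A1 ()
houseEdge-ends A1 A2 refl = inj₁ (refl , refl)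
houseEdge-ends A1 A3 ()
houseEdge-ends A1 A4 ()
houseEdge-ends A1 A5 refl = inj₁ (refl , refl)
houseEdge-ends A1 A6 ()
houseEdge-ends A2 A1 refl = inj₂ (refl , refl)
houseEdge-ends A2 A2 ()
houseEdge-ends A2 A3 ()
houseEdge-ends A2 A4 ()
houseEdge-ends A2 A5 ()
houseEdge-ends A2 A6 refl = inj₁ (refl , refl)
houseEdge-ends A3 A1 ()
houseEdge-ends A3 A2 ()
houseEdge-ends A3 A3 ()
houseEdge-ends A3 A4 ()
houseEdge-ends A3 A5 refl = inj₂ (refl , refl)
houseEdge-ends A3 A6 refl = inj₂ (refl , refl)
houseEdge-ends A4 A1 ()
houseEdge-ends A4 A2 ()
houseEdge-ends A4 A3 ()
houseEdge-ends A4 A4 ()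
houseEdge-ends A4 A5 refl = inj₂ (refl , refl)
houseEdge-ends A4 A6 refl = inj₂ (refl , refl)
houseEdge-ends A5 A1 refl = inj₂ (refl , refl)
houseEdge-ends A5 A2 ()
houseEdge-ends A5 A3 refl = inj₁ (refl , refl)
houseEdge-ends A5 A4 refl = inj₁ (refl , refl)
houseEdge-ends A5 A5 ()
houseEdge-ends A5 A6 ()
houseEdge-ends A6 A1 ()
houseEdge-ends A6 A2 refl = inj₂ (refl , refl)
houseEdge-ends A6 A3 refl = inj₁ (refl , refl)
houseEdge-ends A6 A4 refl = inj₁ (refl , refl)
houseEdge-ends A6 A5 ()
houseEdge-ends A6 A6 ()

houseEdge-houseEnds : (e : HEdge) → houseEdge (proj₁ (houseEnds e)) (proj₂ (houseEnds e)) ≡ just e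
houseEdge-houseEnds h12 = refl
houseEdge-houseEnds h15 = refl
houseEdge-houseEnds h26 = refl
houseEdge-houseEnds h53 = refl
houseEdge-houseEnds h54 = refl
houseEdge-houseEnds h63 = refl
houseEdge-houseEnds h64 = refl

houseEdge-houseEnds′ : (e : HEdge) → houseEdge (proj₂ (houseEnds e)) (proj₁ (houseEnds e)) ≡ just e
houseEdge-houseEnds′ e = trans (houseEdge-sym (proj₂ (houseEnds e)) (proj₁ (houseEnds e))) (houseEdge-houseEnds e)

houseEnds-House : (e : HEdge) → House (proj₁ (houseEnds e)) (proj₂ (houseEnds e))
houseEnds-House h12 = e12
houseEnds-House h15 = e15
houseEnds-House h26 = e26
houseEnds-House h53 = e53
houseEnds-House h54 = e54
houseEnds-House h63 = e63
houseEnds-House h64 = e64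

houseEdge-House : (i j : Fin 6) {e : HEdge} → houseEdge i j ≡ just e → House i j ⊎ House j i
houseEdge-House i j {e} eq with houseEdge-ends i j eq
... | inj₁ (refl , refl) = inj₁ (houseEnds-House e)
... | inj₂ (refl , refl) = inj₂ (houseEnds-House e)

House-houseEdge : {i j : Fin 6} → House i j → Σ HEdge λ e → houseEdge i j ≡ just e
House-houseEdge e12 = h12 , refl
House-houseEdge e15 = h15 , refl
House-houseEdge e26 = h26 , refl
House-houseEdge e53 = h53 , refl
House-houseEdge e54 = h54 , refl
House-houseEdge e63 = h63 , refl
House-houseEdge e64 = h64 , refl

House±-houseEdge : {i j : Fin 6} → House i j ⊎ House j i → Σ HEdge λ e → houseEdge i j ≡ just e
House±-houseEdge {i} {j} (inj₁ h) = House-houseEdge h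
House±-houseEdge {i} {j} (inj₂ h) with House-houseEdge h
... | e , eq = e , trans (houseEdge-sym i j) eq

houseEnds-distinct : (e : HEdge) → proj₁ (houseEnds e) ≢ proj₂ (houseEnds e)
houseEnds-distinct h12 ()
houseEnds-distinct h15 ()
houseEnds-distinct h26 ()
houseEnds-distinct h53 ()
houseEnds-distinct h54 ()
houseEnds-distinct h63 ()
houseEnds-distinct h64 ()

-- The neighbours of uᵢ: pA and pB on the 4-cycle, and pW = wᵢ.
data Pos : Set where
  pA pB pW : Pos

allowedTriple : Part → Part → Part → Bool
allowedTriple inT inT inT = true
allowedTriple inT inT inM = true
allowedTriple inT inM inT = true
allowedTriple inM inT inT = true
allowedTriple inT inC inC = true
allowedTriple inC inT inC = true
allowedTriple inC inC inT = true
allowedTriple _ _ _ = false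

data SIdx : Set where
  S0 S1 S2 : SIdx

eq4 : Fin 4 → Fin 4 → Bool
eq4 i j = ⌊ i ≟ j ⌋
eq6 : Fin 6 → Fin 6 → Bool
eq6 i j = ⌊ i ≟ j ⌋

eq4S : {i j : Fin 4} → T (eq4 i j) → i ≡ j
eq4S {i} {j} t = toWitness t
eq4C : {i j : Fin 4} → i ≡ j → T (eq4 i j)
eq4C e = fromWitness e
eq6S : {i j : Fin 6} → T (eq6 i j) → i ≡ j
eq6S {i} {j} t = toWitness t

∧S1 : {a b : Bool} → T (a ∧ b) → T a
∧S1 {true} _ = tt
∧S2 : {a b : Bool} → T (a ∧ b) → T b
∧S2 {true} t = t
andT : {x y : Bool} → T x → T y → T (x ∧ y)
andT {true} {true} _ _ = tt
∨S : {a b : Bool} → T (a ∨ b) → T a ⊎ T b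
∨S {true} t = inj₁ tt
∨S {false} t = inj₂ t
notS : {a : Bool} → T (not a) → T a → ⊥
notS {true} () _

fins4 : List (Fin 4)
fins4 = I0 ∷ I1 ∷ I2 ∷ I3 ∷ []
fins6 : List (Fin 6)
fins6 = A1 ∷ A2 ∷ A3 ∷ A4 ∷ A5 ∷ A6 ∷ []
hedges : List HEdge
hedges = h12 ∷ h15 ∷ h26 ∷ h53 ∷ h54 ∷ h63 ∷ h64 ∷ []
bools : List Bool
bools = true ∷ false ∷ []

allL : {A : Set} → List A → (A → Bool) → Bool
allL [] P = true
allL (x ∷ xs) P = P x ∧ allL xs P
anyL : {A : Set} → List A → (A → Bool) → Bool
anyL [] P = false
anyL (x ∷ xs) P = P x ∨ anyL xs P

allLS : {A : Set} (l : List A) {P : A → Bool} → T (allL l P) → {x : A} → x ∈ l → T (P x)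
allLS (y ∷ l) t (here refl) = ∧S1 t
allLS (y ∷ l) {P} t (there m) = allLS l (∧S2 {P y} t) m
anyLS : {A : Set} (l : List A) {P : A → Bool} → T (anyL l P) → Σ A λ x → T (P x)
anyLS (y ∷ l) {P} t with ∨S {P y} t
... | inj₁ a = y , a
... | inj₂ b = anyLS l b

fin4∈ : (i : Fin 4) → i ∈ fins4
fin4∈ I0 = here refl
fin4∈ I1 = there (here refl)
fin4∈ I2 = there (there (here refl))
fin4∈ I3 = there (there (there (here refl)))
fin6∈ : (i : Fin 6) → i ∈ fins6
fin6∈ A1 = here refl
fin6∈ A2 = there (here refl)
fin6∈ A3 = there (there (here refl))
fin6∈ A4 = there (there (there (here refl)))
fin6∈ A5 = there (there (there (there (here refl))))
fin6∈ A6 = there (there (there (there (there (here refl)))))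
hedge∈ : (e : HEdge) → e ∈ hedges
hedge∈ h12 = here refl
hedge∈ h15 = there (here refl)
hedge∈ h26 = there (there (here refl))
hedge∈ h53 = there (there (there (here refl)))
hedge∈ h54 = there (there (there (there (here refl))))
hedge∈ h63 = there (there (there (there (there (here refl)))))
hedge∈ h64 = there (there (there (there (there (there (here refl))))))
bool∈ : (b : Bool) → b ∈ bools
bool∈ true = here refl
bool∈ false = there (here refl)

all4 : (Fin 4 → Bool) → Bool
all4 = allL fins4
all6 : (Fin 6 → Bool) → Bool
all6 = allL fins6
all4S : {P : Fin 4 → Bool} → T (all4 P) → ∀ i → T (P i)
all4S {P} t i = allLS fins4 {P} t (fin4∈ i)
all6S : {P : Fin 6 → Bool} → T (all6 P) → ∀ i → T (P i)
all6S {P} t i = allLS fins6 {P} t (fin6∈ i)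

module Reduction (n : ℕ) (E : Adj (Fin n)) (simple : IsSimple E) (cubic : Cubic E)
  (Tr C M : Adj (Fin n)) (dec3 : ThreeDecomposition E Tr C M)
  (u1 u2 u3 u4 w1 w2 w3 w4 : Fin n) (ic : InducedC4 E u1 u2 u3 u4)
  (eu1 : E u1 w1) (eu2 : E u2 w2) (eu3 : E u3 w3) (eu4 : E u4 w4)
  (o1 : OffCycle u1 u2 u3 u4 w1) (o2 : OffCycle u1 u2 u3 u4 w2)
  (o3 : OffCycle u1 u2 u3 u4 w3) (o4 : OffCycle u1 u2 u3 u4 w4) where

  stT = proj₁ dec3
  subT = proj₁ stT
  connT = proj₁ (proj₂ stT)
  acycT = proj₂ (proj₂ stT)
  subC = proj₁ (proj₁ (proj₂ dec3))
  degC = proj₂ (proj₁ (proj₂ dec3))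
  subM = proj₁ (proj₁ (proj₂ (proj₂ dec3)))
  degM = proj₂ (proj₁ (proj₂ (proj₂ dec3)))
  exact = proj₂ (proj₂ (proj₂ dec3))

  d12 = proj₁ (proj₁ ic)
  d13 = proj₁ (proj₂ (proj₁ ic))
  d14 = proj₁ (proj₂ (proj₂ (proj₁ ic)))
  d23 = proj₁ (proj₂ (proj₂ (proj₂ (proj₁ ic))))
  d24 = proj₁ (proj₂ (proj₂ (proj₂ (proj₂ (proj₁ ic)))))
  d34 = proj₂ (proj₂ (proj₂ (proj₂ (proj₂ (proj₁ ic)))))
  q12 = proj₁ (proj₁ (proj₂ ic))
  q24 = proj₁ (proj₂ (proj₁ (proj₂ ic)))
  q43 = proj₁ (proj₂ (proj₂ (proj₁ (proj₂ ic))))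
  q31 = proj₂ (proj₂ (proj₂ (proj₁ (proj₂ ic))))

  symE : ∀ {x y} → E x y → E y x
  symE = IsSimple.sym simple

  u : Fin 4 → Fin n
  u I0 = u1
  u I1 = u2
  u I2 = u3
  u I3 = u4

  w : Fin 4 → Fin n
  w I0 = w1
  w I1 = w2
  w I2 = w3
  w I3 = w4

  off : (i : Fin 4) → OffCycle u1 u2 u3 u4 (w i)
  off I0 = o1
  off I1 = o2
  off I2 = o3
  off I3 = o4

  u-injective : (i j : Fin 4) → u i ≡ u j → i ≡ j
  u-injective I0 I0 e = refl
  u-injective I0 I1 e = ⊥-elim (d12 e)
  u-injective I0 I2 e = ⊥-elim (d13 e)
  u-injective I0 I3 e = ⊥-elim (d14 e)
  u-injective I1 I0 e = ⊥-elim (d12 (sym e))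
  u-injective I1 I1 e = refl
  u-injective I1 I2 e = ⊥-elim (d23 e)
  u-injective I1 I3 e = ⊥-elim (d24 e)
  u-injective I2 I0 e = ⊥-elim (d13 (sym e))
  u-injective I2 I1 e = ⊥-elim (d23 (sym e))
  u-injective I2 I2 e = refl
  u-injective I2 I3 e = ⊥-elim (d34 e)
  u-injective I3 I0 e = ⊥-elim (d14 (sym e))
  u-injective I3 I1 e = ⊥-elim (d24 (sym e))
  u-injective I3 I2 e = ⊥-elim (d34 (sym e))
  u-injective I3 I3 e = refl

  Out : Fin n → Set
  Out x = T (notCyc u1 u2 u3 u4 x)

  offNot : {x : Fin n} → OffCycle u1 u2 u3 u4 x → (j : Fin 4) → x ≢ u j
  offNot (n1 , _ , _ , _) I0 = n1
  offNot (_ , n2 , _ , _) I1 = n2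
  offNot (_ , _ , n3 , _) I2 = n3
  offNot (_ , _ , _ , n4) I3 = n4

  outOf : {x : Fin n} → OffCycle u1 u2 u3 u4 x → Out x
  outOf {x} (n1 , n2 , n3 , n4) with x ≟ u1 | x ≟ u2 | x ≟ u3 | x ≟ u4
  ... | yes e | _ | _ | _ = n1 e
  ... | no _ | yes e | _ | _ = n2 e
  ... | no _ | no _ | yes e | _ = n3 e
  ... | no _ | no _ | no _ | yes e = n4 e
  ... | no _ | no _ | no _ | no _ = tt

  offOf : {x : Fin n} → Out x → OffCycle u1 u2 u3 u4 x
  offOf {x} o with x ≟ u1 | x ≟ u2 | x ≟ u3 | x ≟ u4
  offOf {x} () | yes e | _ | _ | _
  offOf {x} () | no _ | yes e | _ | _
  offOf {x} () | no _ | no _ | yes e | _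
  offOf {x} () | no _ | no _ | no _ | yes e
  offOf {x} o | no n1 | no n2 | no n3 | no n4 = n1 , n2 , n3 , n4

  outNot : {x : Fin n} → Out x → (j : Fin 4) → x ≢ u j
  outNot o = offNot (offOf o)

  wOut : (i : Fin 4) → Out (w i)
  wOut i = outOf (off i)

  data Location (x : Fin n) : Set where
    outside : Out x → Location x
    onCycle : (i : Fin 4) → x ≡ u i → Location x

  locate : (x : Fin n) → Location x
  locate x with x ≟ u1 | x ≟ u2 | x ≟ u3 | x ≟ u4
  ... | yes e | _ | _ | _ = onCycle I0 e
  ... | no _ | yes e | _ | _ = onCycle I1 e
  ... | no _ | no _ | yes e | _ = onCycle I2 e
  ... | no _ | no _ | no _ | yes e = onCycle I3 e
  ... | no n1 | no n2 | no n3 | no n4 = outside (outOf (n1 , n2 , n3 , n4))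

  nbr : Fin 4 → Pos → Fin n
  nbr I0 pA = u2
  nbr I0 pB = u3
  nbr I1 pA = u1
  nbr I1 pB = u4
  nbr I2 pA = u4
  nbr I2 pB = u1
  nbr I3 pA = u2
  nbr I3 pB = u3
  nbr I0 pW = w1
  nbr I1 pW = w2
  nbr I2 pW = w3
  nbr I3 pW = w4

  nbr-edge : (i : Fin 4) (p : Pos) → E (u i) (nbr i p)
  nbr-edge I0 pA = q12
  nbr-edge I0 pB = symE q31
  nbr-edge I1 pA = symE q12
  nbr-edge I1 pB = q24
  nbr-edge I2 pA = symE q43
  nbr-edge I2 pB = q31
  nbr-edge I3 pA = symE q24
  nbr-edge I3 pB = q43
  nbr-edge I0 pW = eu1
  nbr-edge I1 pW = eu2
  nbr-edge I2 pW = eu3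
  nbr-edge I3 pW = eu4

  nbr-distinct : (i : Fin 4) → nbr i pA ≢ nbr i pB × nbr i pA ≢ nbr i pW × nbr i pB ≢ nbr i pW
  nbr-distinct I0 = d23 , (λ e → offNot o1 I1 (sym e)) , (λ e → offNot o1 I2 (sym e))
  nbr-distinct I1 = d14 , (λ e → offNot o2 I0 (sym e)) , (λ e → offNot o2 I3 (sym e))
  nbr-distinct I2 = (λ e → d14 (sym e)) , (λ e → offNot o3 I3 (sym e)) , (λ e → offNot o3 I0 (sym e))
  nbr-distinct I3 = d23 , (λ e → offNot o4 I1 (sym e)) , (λ e → offNot o4 I2 (sym e))

  open Cover (_≟_ {n})

  nbr-complete : (i : Fin 4) {b : Fin n} → E (u i) b → Σ Pos λ p → b ≡ nbr i p
  nbr-complete i {b} eb with cubic (u i)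
  ... | l , len , uq , ch with classify3 l len (proj₁ (ch _) (nbr-edge i pA)) (proj₁ (ch _) (nbr-edge i pB)) (proj₁ (ch _) (nbr-edge i pW))
                               (proj₁ (nbr-distinct i)) (proj₁ (proj₂ (nbr-distinct i))) (proj₂ (proj₂ (nbr-distinct i))) (proj₁ (ch _) eb)
  ...   | inj₁ e = pA , e
  ...   | inj₂ (inj₁ e) = pB , e
  ...   | inj₂ (inj₂ e) = pW , e

  nbr-injective : (i : Fin 4) {p q : Pos} → nbr i p ≡ nbr i q → p ≡ q
  nbr-injective i {pA} {pA} e = refl
  nbr-injective i {pA} {pB} e = ⊥-elim (proj₁ (nbr-distinct i) e)
  nbr-injective i {pA} {pW} e = ⊥-elim (proj₁ (proj₂ (nbr-distinct i)) e)
  nbr-injective i {pB} {pA} e = ⊥-elim (proj₁ (nbr-distinct i) (sym e))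
  nbr-injective i {pB} {pB} e = refl
  nbr-injective i {pB} {pW} e = ⊥-elim (proj₂ (proj₂ (nbr-distinct i)) e)
  nbr-injective i {pW} {pA} e = ⊥-elim (proj₁ (proj₂ (nbr-distinct i)) (sym e))
  nbr-injective i {pW} {pB} e = ⊥-elim (proj₂ (proj₂ (nbr-distinct i)) (sym e))
  nbr-injective i {pW} {pW} e = refl

  partAt : (i : Fin 4) → Pos → Part
  partAt i p = partOf (exact _ _ (nbr-edge i p))

  symT : ∀ {x y} → Tr x y → Tr y x
  symT = proj₂ subT
  symC : ∀ {x y} → C x y → C y x
  symC = proj₂ subC
  symM : ∀ {x y} → M x y → M y x
  symM = proj₂ subM

  partOf-flip : {a b a1 b1 : Fin n} (e : E a b) (e1 : E a1 b1) → (a1 ≡ a × b1 ≡ b) ⊎ (a1 ≡ b × b1 ≡ a) →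
    partOf (exact a b e) ≡ partOf (exact a1 b1 e1)
  partOf-flip {a} {b} e e1 o with exact a b e
  ... | inj₁ (r , _ , _) = sym (partOf-T (exact _ _ e1) (orT o))
    where
    orT : _ → Tr _ _
    orT (inj₁ (refl , refl)) = r
    orT (inj₂ (refl , refl)) = symT r
  ... | inj₂ (inj₁ (_ , r , _)) = sym (partOf-C (exact _ _ e1) (orC o))
    where
    orC : _ → C _ _
    orC (inj₁ (refl , refl)) = r
    orC (inj₂ (refl , refl)) = symC r
  ... | inj₂ (inj₂ (_ , _ , r)) = sym (partOf-M (exact _ _ e1) (orM o))
    where
    orM : _ → M _ _
    orM (inj₁ (refl , refl)) = r
    orM (inj₂ (refl , refl)) = symM r

  classT : (i : Fin 4) {b : Fin n} → Tr (u i) b → Σ Pos λ p → b ≡ nbr i p × partAt i p ≡ inT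
  classT i r with nbr-complete i (proj₁ subT r)
  ... | p , refl = p , refl , partOf-T (exact _ _ (nbr-edge i p)) r
  classC : (i : Fin 4) {b : Fin n} → C (u i) b → Σ Pos λ p → b ≡ nbr i p × partAt i p ≡ inC
  classC i r with nbr-complete i (proj₁ subC r)
  ... | p , refl = p , refl , partOf-C (exact _ _ (nbr-edge i p)) r

  introT : (i : Fin 4) (p : Pos) → partAt i p ≡ inT → Tr (u i) (nbr i p)
  introT i p e = partOf-T⁻ (exact _ _ (nbr-edge i p)) e
  introC : (i : Fin 4) (p : Pos) → partAt i p ≡ inC → C (u i) (nbr i p)
  introC i p e = partOf-C⁻ (exact _ _ (nbr-edge i p)) e
  introM : (i : Fin 4) (p : Pos) → partAt i p ≡ inM → M (u i) (nbr i p)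
  introM i p e = partOf-M⁻ (exact _ _ (nbr-edge i p)) e

  u≢w : (i : Fin 4) → u i ≢ w i
  u≢w i e = offNot (off i) i (sym e)

  C-degree≢1 : (i : Fin 4) (p : Pos) → partAt i p ≡ inC → (∀ q → partAt i q ≡ inC → q ≡ p) → ⊥
  C-degree≢1 i p e only with degC (u i)
  ... | inj₁ d0 = degree0-no-edge {R = C} d0 (introC i p e)
  ... | inj₂ d2 = degree2-not-one {R = C} d2 f
    where
    f : ∀ b → C (u i) b → b ≡ nbr i p
    f b r with classC i r
    ... | q , refl , eq with only q eq
    ...   | refl = refl

  C-degree≢3 : (i : Fin 4) → partAt i pA ≡ inC → partAt i pB ≡ inC → partAt i pW ≡ inC → ⊥
  C-degree≢3 i ea eb ew with degC (u i)
  ... | inj₁ d0 = degree0-no-edge {R = C} d0 (introC i pA ea)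
  ... | inj₂ d2 = degree2-not-three {R = C} d2 (introC i pA ea) (introC i pB eb) (introC i pW ew)
                   (proj₁ (nbr-distinct i)) (proj₁ (proj₂ (nbr-distinct i))) (proj₂ (proj₂ (nbr-distinct i)))

  M-degree≢2 : (i : Fin 4) (p q : Pos) → p ≢ q → partAt i p ≡ inM → partAt i q ≡ inM → ⊥
  M-degree≢2 i p q npq ep eq with degM (u i)
  ... | inj₁ d0 = degree0-no-edge {R = M} d0 (introM i p ep)
  ... | inj₂ d1 = npq (nbr-injective i (degree1-unique {R = M} d1 (introM i p ep) (introM i q eq)))

  T-degree≢0 : (i : Fin 4) → (∀ q → partAt i q ≡ inT → ⊥) → ⊥
  T-degree≢0 i none = go (connT (u i) (w i)) refl refl
    where
    go : ∀ {a b} → Star Tr a b → a ≡ u i → b ≡ w i → ⊥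
    go ε refl e = u≢w i e
    go (r ◅ _) refl _ with classT i r
    ... | q , _ , e = none q e

  samePart : Part → Part → Bool
  samePart inT inT = true
  samePart inC inC = true
  samePart inM inM = true
  samePart _ _ = false

  clash : {q y z : Part} → q ≡ y → q ≡ z → samePart y z ≡ false → ⊥
  clash {y = inT} refl refl ()
  clash {y = inC} refl refl ()
  clash {y = inM} refl refl ()

  allowedTriple-cases : (i : Fin 4) (a b c : Part) → partAt i pA ≡ a → partAt i pB ≡ b → partAt i pW ≡ c → allowedTriple a b c ≡ true
  allowedTriple-cases i inT inT inT ea eb ew = refl
  allowedTriple-cases i inT inT inC ea eb ew = ⊥-elim (C-degree≢1 i pW ew (λ { pA e → ⊥-elim (clash ea e refl) ; pB e → ⊥-elim (clash eb e refl) ; pW e → refl }))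
  allowedTriple-cases i inT inT inM ea eb ew = refl
  allowedTriple-cases i inT inC inT ea eb ew = ⊥-elim (C-degree≢1 i pB eb (λ { pA e → ⊥-elim (clash ea e refl) ; pB e → refl ; pW e → ⊥-elim (clash ew e refl) }))
  allowedTriple-cases i inT inC inC ea eb ew = refl
  allowedTriple-cases i inT inC inM ea eb ew = ⊥-elim (C-degree≢1 i pB eb (λ { pA e → ⊥-elim (clash ea e refl) ; pB e → refl ; pW e → ⊥-elim (clash ew e refl) }))
  allowedTriple-cases i inT inM inT ea eb ew = refl
  allowedTriple-cases i inT inM inC ea eb ew = ⊥-elim (C-degree≢1 i pW ew (λ { pA e → ⊥-elim (clash ea e refl) ; pB e → ⊥-elim (clash eb e refl) ; pW e → refl }))
  allowedTriple-cases i inT inM inM ea eb ew = ⊥-elim (M-degree≢2 i pB pW (λ ()) eb ew)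
  allowedTriple-cases i inC inT inT ea eb ew = ⊥-elim (C-degree≢1 i pA ea (λ { pA e → refl ; pB e → ⊥-elim (clash eb e refl) ; pW e → ⊥-elim (clash ew e refl) }))
  allowedTriple-cases i inC inT inC ea eb ew = refl
  allowedTriple-cases i inC inT inM ea eb ew = ⊥-elim (C-degree≢1 i pA ea (λ { pA e → refl ; pB e → ⊥-elim (clash eb e refl) ; pW e → ⊥-elim (clash ew e refl) }))
  allowedTriple-cases i inC inC inT ea eb ew = refl
  allowedTriple-cases i inC inC inC ea eb ew = ⊥-elim (C-degree≢3 i ea eb ew)
  allowedTriple-cases i inC inC inM ea eb ew = ⊥-elim (T-degree≢0 i (λ { pA e → clash ea e refl ; pB e → clash eb e refl ; pW e → clash ew e refl }))
  allowedTriple-cases i inC inM inT ea eb ew = ⊥-elim (C-degree≢1 i pA ea (λ { pA e → refl ; pB e → ⊥-elim (clash eb e refl) ; pW e → ⊥-elim (clash ew e refl) }))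
  allowedTriple-cases i inC inM inC ea eb ew = ⊥-elim (T-degree≢0 i (λ { pA e → clash ea e refl ; pB e → clash eb e refl ; pW e → clash ew e refl }))
  allowedTriple-cases i inC inM inM ea eb ew = ⊥-elim (C-degree≢1 i pA ea (λ { pA e → refl ; pB e → ⊥-elim (clash eb e refl) ; pW e → ⊥-elim (clash ew e refl) }))
  allowedTriple-cases i inM inT inT ea eb ew = refl
  allowedTriple-cases i inM inT inC ea eb ew = ⊥-elim (C-degree≢1 i pW ew (λ { pA e → ⊥-elim (clash ea e refl) ; pB e → ⊥-elim (clash eb e refl) ; pW e → refl }))
  allowedTriple-cases i inM inT inM ea eb ew = ⊥-elim (M-degree≢2 i pA pW (λ ()) ea ew)
  allowedTriple-cases i inM inC inT ea eb ew = ⊥-elim (C-degree≢1 i pB eb (λ { pA e → ⊥-elim (clash ea e refl) ; pB e → refl ; pW e → ⊥-elim (clash ew e refl) }))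
  allowedTriple-cases i inM inC inC ea eb ew = ⊥-elim (T-degree≢0 i (λ { pA e → clash ea e refl ; pB e → clash eb e refl ; pW e → clash ew e refl }))
  allowedTriple-cases i inM inC inM ea eb ew = ⊥-elim (C-degree≢1 i pB eb (λ { pA e → ⊥-elim (clash ea e refl) ; pB e → refl ; pW e → ⊥-elim (clash ew e refl) }))
  allowedTriple-cases i inM inM inT ea eb ew = ⊥-elim (M-degree≢2 i pA pB (λ ()) ea eb)
  allowedTriple-cases i inM inM inC ea eb ew = ⊥-elim (C-degree≢1 i pW ew (λ { pA e → ⊥-elim (clash ea e refl) ; pB e → ⊥-elim (clash eb e refl) ; pW e → refl }))
  allowedTriple-cases i inM inM inM ea eb ew = ⊥-elim (M-degree≢2 i pA pB (λ ()) ea eb)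

  allowedAt : (i : Fin 4) → allowedTriple (partAt i pA) (partAt i pB) (partAt i pW) ≡ true
  allowedAt i = allowedTriple-cases i _ _ _ refl refl refl

  HVert : Set
  HVert = HV n u1 u2 u3 u4

  HAdj : Adj HVert
  HAdj = HE E u1 u2 u3 u4 w1 w2 w3 w4

  W : Fin 4 → HVert
  W i = inj₁ (w i , wOut i)

  injEq : {x y : Fin n} {p : Out x} {q : Out y} → x ≡ y → _≡_ {A = HVert} (inj₁ (x , p)) (inj₁ (y , q))
  injEq {x} {p = p} {q} refl = cong (λ z → inj₁ (x , z)) (T-irrelevant p q)

  decHV : DecidableEquality HVert
  decHV (inj₁ (x , p)) (inj₁ (y , q)) with x ≟ y
  ... | yes e = yes (injEq e)
  ... | no ne = no λ { refl → ne refl }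
  decHV (inj₁ _) (inj₂ _) = no λ ()
  decHV (inj₂ _) (inj₁ _) = no λ ()
  decHV (inj₂ i) (inj₂ j) with i ≟ j
  ... | yes refl = yes refl
  ... | no ne = no λ { refl → ne refl }

  PendantIn : Selection → Fin n → Maybe (Fin 4) → Set
  PendantIn tb x nothing = ⊥
  PendantIn tb x (just i) = x ≡ w i × T (tb (pendant i))

  HouseIn : Selection → Maybe HEdge → Set
  HouseIn tb nothing = ⊥
  HouseIn tb (just e) = T (tb (house e))

  liftRel : Adj (Fin n) → Selection → Adj HVert
  liftRel B tb (inj₁ (x , _)) (inj₁ (y , _)) = B x y
  liftRel B tb (inj₁ (x , _)) (inj₂ j) = PendantIn tb x (pendantIndex j)
  liftRel B tb (inj₂ i) (inj₁ (y , _)) = PendantIn tb y (pendantIndex i)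
  liftRel B tb (inj₂ i) (inj₂ j) = HouseIn tb (houseEdge i j)

  liftRel-sym : {B : Adj (Fin n)} {tb : Selection} → Symmetric B → Symmetric (liftRel B tb)
  liftRel-sym {tb = tb} s {inj₁ _} {inj₁ _} r = s r
  liftRel-sym {tb = tb} s {inj₁ _} {inj₂ _} r = r
  liftRel-sym {tb = tb} s {inj₂ _} {inj₁ _} r = r
  liftRel-sym {tb = tb} s {inj₂ i} {inj₂ j} r = subst (HouseIn tb) (houseEdge-sym i j) r

  attachIntro : {x : Fin n} (j : Fin 6) {i : Fin 4} → pendantIndex j ≡ just i → x ≡ w i → Attach w1 w2 w3 w4 x j
  attachIntro A1 refl refl = at1 refl
  attachIntro A2 refl refl = at2 refl
  attachIntro A3 refl refl = at3 refl
  attachIntro A4 refl refl = at4 refl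
  attachIntro A5 () _
  attachIntro A6 () _

  attachInv : {x : Fin n} {j : Fin 6} → Attach w1 w2 w3 w4 x j → Σ (Fin 4) λ i → pendantIndex j ≡ just i × x ≡ w i
  attachInv (at1 e) = I0 , refl , e
  attachInv (at2 e) = I1 , refl , e
  attachInv (at3 e) = I2 , refl , e
  attachInv (at4 e) = I3 , refl , e

  prmAttach : {tb : Selection} {x : Fin n} (j : Fin 6) → PendantIn tb x (pendantIndex j) → Attach w1 w2 w3 w4 x j
  prmAttach {tb} {x} j pr with pendantIndex j in eq
  prmAttach {tb} {x} j () | nothing
  prmAttach {tb} {x} j (e , _) | just i = attachIntro j eq e

  liftRel-sub : {B : Adj (Fin n)} {tb : Selection} → (∀ {x y} → B x y → E x y) → ∀ {a b} → liftRel B tb a b → HAdj a b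
  liftRel-sub s {inj₁ _} {inj₁ _} r = s r
  liftRel-sub s {inj₁ _} {inj₂ j} r = prmAttach j r
  liftRel-sub s {inj₂ i} {inj₁ _} r = prmAttach i r
  liftRel-sub {tb = tb} s {inj₂ i} {inj₂ j} r with houseEdge i j in eq
  liftRel-sub {tb = tb} s {inj₂ i} {inj₂ j} () | nothing
  liftRel-sub {tb = tb} s {inj₂ i} {inj₂ j} r | just e = houseEdge-House i j eq

  isTB isCB isMB : Part → Bool
  isTB inT = true
  isTB _ = false
  isCB inC = true
  isCB _ = false
  isMB inM = true
  isMB _ = false

  selectT selectC selectM : (GEdge → Part) → Selection
  selectT typ e = isTB (typ e)
  selectC typ e = isCB (typ e)
  selectM typ e = isMB (typ e)

  exTy : (t : Part) → ExactlyOne (T (isTB t)) (T (isCB t)) (T (isMB t))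
  exTy inT = inj₁ (tt , (λ ()) , (λ ()))
  exTy inC = inj₂ (inj₁ ((λ ()) , tt , (λ ())))
  exTy inM = inj₂ (inj₂ ((λ ()) , (λ ()) , tt))

  exPR : (typ : GEdge → Part) {x : Fin n} {i : Fin 4} (mi : Maybe (Fin 4)) → mi ≡ just i → x ≡ w i →
    ExactlyOne (PendantIn (selectT typ) x mi) (PendantIn (selectC typ) x mi) (PendantIn (selectM typ) x mi)
  exPR typ {i = i} (just _) refl ex with typ (pendant i) | exTy (typ (pendant i))
  ... | _ | inj₁ (a , nb , nc) = inj₁ ((ex , a) , (λ z → nb (proj₂ z)) , (λ z → nc (proj₂ z)))
  ... | _ | inj₂ (inj₁ (na , b , nc)) = inj₂ (inj₁ ((λ z → na (proj₂ z)) , (ex , b) , (λ z → nc (proj₂ z))))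
  ... | _ | inj₂ (inj₂ (na , nb , c)) = inj₂ (inj₂ ((λ z → na (proj₂ z)) , (λ z → nb (proj₂ z)) , (ex , c)))

  exHB : (typ : GEdge → Part) {e : HEdge} (me : Maybe HEdge) → me ≡ just e →
    ExactlyOne (HouseIn (selectT typ) me) (HouseIn (selectC typ) me) (HouseIn (selectM typ) me)
  exHB typ {e} (just _) refl = exTy (typ (house e))

  exact-lift : (typ : GEdge → Part) → ∀ a b → HAdj a b →
    ExactlyOne (liftRel Tr (selectT typ) a b) (liftRel C (selectC typ) a b) (liftRel M (selectM typ) a b)
  exact-lift typ (inj₁ (x , _)) (inj₁ (y , _)) e = exact x y e
  exact-lift typ (inj₁ (x , _)) (inj₂ j) at with attachInv at
  ... | i , eq , ex = exPR typ (pendantIndex j) eq ex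
  exact-lift typ (inj₂ j) (inj₁ (x , _)) at with attachInv at
  ... | i , eq , ex = exPR typ (pendantIndex j) eq ex
  exact-lift typ (inj₂ i) (inj₂ j) h with House±-houseEdge h
  ... | e , eq = exHB typ (houseEdge i j) eq

  selectNbrs : Selection → List (GEdge × HVert) → List HVert
  selectNbrs tb [] = []
  selectNbrs tb ((e , v) ∷ l) = if tb e then v ∷ selectNbrs tb l else selectNbrs tb l

  SelectedAt : Selection → HVert → GEdge × HVert → Set
  SelectedAt tb v ev = proj₂ ev ≡ v × T (tb (proj₁ ev))

  selectNbrs⁺ : (tb : Selection) (l : List (GEdge × HVert)) {v : HVert} → Any (SelectedAt tb v) l → v ∈ selectNbrs tb l
  selectNbrs⁺ tb ((e , v) ∷ l) (here (refl , t)) with tb e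
  selectNbrs⁺ tb ((e , v) ∷ l) (here (refl , ())) | false
  ... | true = here refl
  selectNbrs⁺ tb ((e , v) ∷ l) (there a) with tb e
  ... | false = selectNbrs⁺ tb l a
  ... | true = there (selectNbrs⁺ tb l a)

  selectNbrs⁻ : (tb : Selection) (l : List (GEdge × HVert)) {v : HVert} → v ∈ selectNbrs tb l → Any (SelectedAt tb v) l
  selectNbrs⁻ tb ((e , v) ∷ l) m with tb e in eq
  ... | false = there (selectNbrs⁻ tb l m)
  selectNbrs⁻ tb ((e , v) ∷ l) (here refl) | true = here (refl , subst T (sym eq) tt)
  selectNbrs⁻ tb ((e , v) ∷ l) (there m) | true = there (selectNbrs⁻ tb l m)

  selectNbrs-All : (tb : Selection) {P : HVert → Set} (l : List (GEdge × HVert)) → All P (map proj₂ l) → All P (selectNbrs tb l)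
  selectNbrs-All tb [] [] = []
  selectNbrs-All tb ((e , v) ∷ l) (p ∷ ps) with tb e
  ... | false = selectNbrs-All tb l ps
  ... | true = p ∷ selectNbrs-All tb l ps

  selectNbrs-unique : (tb : Selection) (l : List (GEdge × HVert)) → Unique (map proj₂ l) → Unique (selectNbrs tb l)
  selectNbrs-unique tb [] [] = []
  selectNbrs-unique tb ((e , v) ∷ l) (p ∷ u) with tb e
  ... | false = selectNbrs-unique tb l u
  ... | true = selectNbrs-All tb l p ∷ selectNbrs-unique tb l u

  incidences : Fin 6 → List (GEdge × HVert)
  incidences A1 = (house h12 , inj₂ A2) ∷ (house h15 , inj₂ A5) ∷ (pendant I0 , W I0) ∷ []
  incidences A2 = (house h12 , inj₂ A1) ∷ (house h26 , inj₂ A6) ∷ (pendant I1 , W I1) ∷ []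
  incidences A3 = (house h53 , inj₂ A5) ∷ (house h63 , inj₂ A6) ∷ (pendant I2 , W I2) ∷ []
  incidences A4 = (house h54 , inj₂ A5) ∷ (house h64 , inj₂ A6) ∷ (pendant I3 , W I3) ∷ []
  incidences A5 = (house h15 , inj₂ A1) ∷ (house h53 , inj₂ A3) ∷ (house h54 , inj₂ A4) ∷ []
  incidences A6 = (house h26 , inj₂ A2) ∷ (house h63 , inj₂ A3) ∷ (house h64 , inj₂ A4) ∷ []

  incidences-complete : (tb : Selection) {B : Adj (Fin n)} (j : Fin 6) (v : HVert) → liftRel B tb (inj₂ j) v → Any (SelectedAt tb v) (incidences j)
  incidences-complete tb A1 (inj₁ (x , px)) (ex , t) = there (there (here (injEq (sym ex) , t)))
  incidences-complete tb A1 (inj₂ A1) ()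
  incidences-complete tb A1 (inj₂ A2) t = here (refl , t)
  incidences-complete tb A1 (inj₂ A3) ()
  incidences-complete tb A1 (inj₂ A4) ()
  incidences-complete tb A1 (inj₂ A5) t = there (here (refl , t))
  incidences-complete tb A1 (inj₂ A6) ()
  incidences-complete tb A2 (inj₁ (x , px)) (ex , t) = there (there (here (injEq (sym ex) , t)))
  incidences-complete tb A2 (inj₂ A1) t = here (refl , t)
  incidences-complete tb A2 (inj₂ A2) ()
  incidences-complete tb A2 (inj₂ A3) ()
  incidences-complete tb A2 (inj₂ A4) ()
  incidences-complete tb A2 (inj₂ A5) ()
  incidences-complete tb A2 (inj₂ A6) t = there (here (refl , t))
  incidences-complete tb A3 (inj₁ (x , px)) (ex , t) = there (there (here (injEq (sym ex) , t)))
  incidences-complete tb A3 (inj₂ A1) ()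
  incidences-complete tb A3 (inj₂ A2) ()
  incidences-complete tb A3 (inj₂ A3) ()
  incidences-complete tb A3 (inj₂ A4) ()
  incidences-complete tb A3 (inj₂ A5) t = here (refl , t)
  incidences-complete tb A3 (inj₂ A6) t = there (here (refl , t))
  incidences-complete tb A4 (inj₁ (x , px)) (ex , t) = there (there (here (injEq (sym ex) , t)))
  incidences-complete tb A4 (inj₂ A1) ()
  incidences-complete tb A4 (inj₂ A2) ()
  incidences-complete tb A4 (inj₂ A3) ()
  incidences-complete tb A4 (inj₂ A4) ()
  incidences-complete tb A4 (inj₂ A5) t = here (refl , t)
  incidences-complete tb A4 (inj₂ A6) t = there (here (refl , t))
  incidences-complete tb A5 (inj₁ (x , px)) ()
  incidences-complete tb A5 (inj₂ A1) t = here (refl , t)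
  incidences-complete tb A5 (inj₂ A2) ()
  incidences-complete tb A5 (inj₂ A3) t = there (here (refl , t))
  incidences-complete tb A5 (inj₂ A4) t = there (there (here (refl , t)))
  incidences-complete tb A5 (inj₂ A5) ()
  incidences-complete tb A5 (inj₂ A6) ()
  incidences-complete tb A6 (inj₁ (x , px)) ()
  incidences-complete tb A6 (inj₂ A1) ()
  incidences-complete tb A6 (inj₂ A2) t = here (refl , t)
  incidences-complete tb A6 (inj₂ A3) t = there (here (refl , t))
  incidences-complete tb A6 (inj₂ A4) t = there (there (here (refl , t)))
  incidences-complete tb A6 (inj₂ A5) ()
  incidences-complete tb A6 (inj₂ A6) ()

  incidences-sound : (tb : Selection) {B : Adj (Fin n)} (j : Fin 6) {v : HVert} → Any (SelectedAt tb v) (incidences j) → liftRel B tb (inj₂ j) v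
  incidences-sound tb A1 (here (refl , t)) = t
  incidences-sound tb A1 (there (here (refl , t))) = t
  incidences-sound tb A1 (there (there (here (refl , t)))) = refl , t
  incidences-sound tb A1 (there (there (there ())))
  incidences-sound tb A2 (here (refl , t)) = t
  incidences-sound tb A2 (there (here (refl , t))) = t
  incidences-sound tb A2 (there (there (here (refl , t)))) = refl , t
  incidences-sound tb A2 (there (there (there ())))
  incidences-sound tb A3 (here (refl , t)) = t
  incidences-sound tb A3 (there (here (refl , t))) = t
  incidences-sound tb A3 (there (there (here (refl , t)))) = refl , t
  incidences-sound tb A3 (there (there (there ())))
  incidences-sound tb A4 (here (refl , t)) = t
  incidences-sound tb A4 (there (here (refl , t))) = t
  incidences-sound tb A4 (there (there (here (refl , t)))) = refl , t
  incidences-sound tb A4 (there (there (there ())))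
  incidences-sound tb A5 (here (refl , t)) = t
  incidences-sound tb A5 (there (here (refl , t))) = t
  incidences-sound tb A5 (there (there (here (refl , t)))) = t
  incidences-sound tb A5 (there (there (there ())))
  incidences-sound tb A6 (here (refl , t)) = t
  incidences-sound tb A6 (there (here (refl , t))) = t
  incidences-sound tb A6 (there (there (here (refl , t)))) = t
  incidences-sound tb A6 (there (there (there ())))

  incidences-unique : (j : Fin 6) → Unique (map proj₂ (incidences j))
  incidences-unique A1 = ((λ ()) ∷ (λ ()) ∷ []) ∷ ((λ ()) ∷ []) ∷ [] ∷ []
  incidences-unique A2 = ((λ ()) ∷ (λ ()) ∷ []) ∷ ((λ ()) ∷ []) ∷ [] ∷ []
  incidences-unique A3 = ((λ ()) ∷ (λ ()) ∷ []) ∷ ((λ ()) ∷ []) ∷ [] ∷ []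
  incidences-unique A4 = ((λ ()) ∷ (λ ()) ∷ []) ∷ ((λ ()) ∷ []) ∷ [] ∷ []
  incidences-unique A5 = ((λ ()) ∷ (λ ()) ∷ []) ∷ ((λ ()) ∷ []) ∷ [] ∷ []
  incidences-unique A6 = ((λ ()) ∷ (λ ()) ∷ []) ∷ ((λ ()) ∷ []) ∷ [] ∷ []

  gadgetDegree : (B : Adj (Fin n)) (tb : Selection) (j : Fin 6) → Degree (liftRel B tb) (inj₂ j) (length (selectNbrs tb (incidences j)))
  gadgetDegree B tb j = selectNbrs tb (incidences j) , refl , selectNbrs-unique tb (incidences j) (incidences-unique j) ,
    (λ v → (λ r → selectNbrs⁺ tb (incidences j) (incidences-complete tb {B} j v r)) , (λ m → incidences-sound tb {B} j (selectNbrs⁻ tb (incidences j) m)))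

  outNbr : {x : Fin n} → Out x → (i : Fin 4) → E (u i) x → x ≡ w i
  outNbr {x} px i e with nbr-complete i e
  ... | pW , eq = helper i eq
    where
    helper : (i : Fin 4) → x ≡ nbr i pW → x ≡ w i
    helper I0 eq = eq
    helper I1 eq = eq
    helper I2 eq = eq
    helper I3 eq = eq
  ... | pA , eq = ⊥-elim (helperA i eq)
    where
    helperA : (i : Fin 4) → x ≡ nbr i pA → ⊥
    helperA I0 eq = outNot px I1 eq
    helperA I1 eq = outNot px I0 eq
    helperA I2 eq = outNot px I3 eq
    helperA I3 eq = outNot px I1 eq
  ... | pB , eq = ⊥-elim (helperB i eq)
    where
    helperB : (i : Fin 4) → x ≡ nbr i pB → ⊥
    helperB I0 eq = outNot px I2 eq
    helperB I1 eq = outNot px I3 eq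
    helperB I2 eq = outNot px I0 eq
    helperB I3 eq = outNot px I2 eq

  liftNbr : Selection → (y : Fin n) → Location y → List HVert
  liftNbr tb y (outside p) = inj₁ (y , p) ∷ []
  liftNbr tb y (onCycle i _) = if tb (pendant i) then inj₂ (aOf i) ∷ [] else []

  liftNbrs : Selection → List (Fin n) → List HVert
  liftNbrs tb [] = []
  liftNbrs tb (y ∷ ys) = liftNbr tb y (locate y) ++ liftNbrs tb ys

  LiftedNbr : Selection → List (Fin n) → HVert → Set
  LiftedNbr tb L v = (Σ (Fin n) λ y → Σ (Out y) λ py → v ≡ inj₁ (y , py) × y ∈ L) ⊎
                    (Σ (Fin 4) λ i → v ≡ inj₂ (aOf i) × u i ∈ L × T (tb (pendant i)))

  liftNbrs⁻ : (tb : Selection) (L : List (Fin n)) {v : HVert} → v ∈ liftNbrs tb L → LiftedNbr tb L v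
  liftNbrs⁻ tb (y ∷ ys) {v} m with locate y | ∈-++⁻ (liftNbr tb y (locate y)) m
  ... | c | inj₂ m2 with liftNbrs⁻ tb ys m2
  ...   | inj₁ (z , pz , e , mz) = inj₁ (z , pz , e , there mz)
  ...   | inj₂ (i , e , mi , t) = inj₂ (i , e , there mi , t)
  liftNbrs⁻ tb (y ∷ ys) {v} m | outside p | inj₁ (here e) = inj₁ (y , p , e , here refl)
  liftNbrs⁻ tb (y ∷ ys) {v} m | onCycle i eq | inj₁ m1 with tb (pendant i) in tq
  liftNbrs⁻ tb (y ∷ ys) {v} m | onCycle i eq | inj₁ (here e) | true = inj₂ (i , e , here (sym eq) , subst T (sym tq) tt)

  liftNbrs⁺-outside : (tb : Selection) (L : List (Fin n)) {y : Fin n} (py : Out y) → y ∈ L → inj₁ (y , py) ∈ liftNbrs tb L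
  liftNbrs⁺-outside tb (y ∷ ys) py (here refl) with locate y
  ... | outside p = here (injEq refl)
  ... | onCycle i e = ⊥-elim (outNot py i e)
  liftNbrs⁺-outside tb (z ∷ ys) py (there m) = ∈-++⁺ʳ (liftNbr tb z (locate z)) (liftNbrs⁺-outside tb ys py m)

  liftNbrs⁺-gadget : (tb : Selection) (L : List (Fin n)) (i : Fin 4) → T (tb (pendant i)) → u i ∈ L → inj₂ (aOf i) ∈ liftNbrs tb L
  liftNbrs⁺-gadget tb (y ∷ ys) i t (here refl) with locate (u i)
  ... | outside p = ⊥-elim (outNot p i refl)
  ... | onCycle j e with u-injective i j e
  ...   | refl with tb (pendant i)
  ...     | true = here refl
  liftNbrs⁺-gadget tb (z ∷ ys) i t (there m) = ∈-++⁺ʳ (liftNbr tb z (locate z)) (liftNbrs⁺-gadget tb ys i t m)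

  liftNbr-unique : (tb : Selection) (y : Fin n) (c : Location y) → Unique (liftNbr tb y c)
  liftNbr-unique tb y (outside p) = [] ∷ []
  liftNbr-unique tb y (onCycle i _) with tb (pendant i)
  ... | true = [] ∷ []
  ... | false = []

  liftNbrs-unique : (tb : Selection) (L : List (Fin n)) → Unique L → Unique (liftNbrs tb L)
  liftNbrs-unique tb [] [] = []
  liftNbrs-unique tb (y ∷ ys) (ny ∷ u) =
    ++⁺ (liftNbr-unique tb y (locate y)) (liftNbrs-unique tb ys u) disj
    where
    disj : ∀ {v} → ¬ (v ∈ liftNbr tb y (locate y) × v ∈ liftNbrs tb ys)
    disj {v} (m1 , m2) with locate y | liftNbrs⁻ tb ys m2
    disj {v} (here refl , m2) | outside p | inj₁ (z , pz , e , mz) with e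
    ... | refl = All¬⇒¬Any ny mz
    disj {v} (here refl , m2) | outside p | inj₂ (i , () , _)
    disj {v} (m1 , m2) | onCycle i eq | c2 with tb (pendant i)
    disj {v} (here refl , m2) | onCycle i eq | inj₁ (z , pz , () , _) | true
    disj {v} (here refl , m2) | onCycle i eq | inj₂ (i1 , e , mi , _) | true
      with aOf-injective i i1 (inj₂-injective e)
    ... | refl = All¬⇒¬Any ny (subst (_∈ ys) (sym eq) mi)

  liftNbrs-length : (tb : Selection) (L : List (Fin n)) → length (liftNbrs tb L) ≤ length L
  liftNbrs-length tb [] = z≤n
  liftNbrs-length tb (y ∷ ys) with locate y
  ... | outside p = s≤s (liftNbrs-length tb ys)
  ... | onCycle i _ with tb (pendant i)
  ...   | true = s≤s (liftNbrs-length tb ys)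
  ...   | false = m≤n⇒m≤1+n (liftNbrs-length tb ys)

  liftNbrs-length-≡ : (tb : Selection) (L : List (Fin n)) → (∀ i → u i ∈ L → T (tb (pendant i))) → length (liftNbrs tb L) ≡ length L
  liftNbrs-length-≡ tb [] k = refl
  liftNbrs-length-≡ tb (y ∷ ys) k with locate y
  ... | outside p = cong suc (liftNbrs-length-≡ tb ys (λ i m → k i (there m)))
  ... | onCycle i e with tb (pendant i) in tq
  ...   | true = cong suc (liftNbrs-length-≡ tb ys (λ i m → k i (there m)))
  ...   | false with subst T tq (k i (here (sym e)))
  ...     | ()

  outsideDegree : (B : Adj (Fin n)) (subB : ∀ {a b} → B a b → E a b) (symB : Symmetric B) (tb : Selection) (x : Fin n) (px : Out x) {k : ℕ} →
    Degree B x k → (∀ i → x ≡ w i → T (tb (pendant i)) → B x (u i)) →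
    Σ ℕ λ k1 → Degree (liftRel B tb) (inj₁ (x , px)) k1 × k1 ≤ k × ((∀ i → B x (u i) → T (tb (pendant i))) → k1 ≡ k)
  outsideDegree B subB symB tb x px (L , len , uq , ch) cB =
    length (liftNbrs tb L) , (liftNbrs tb L , refl , liftNbrs-unique tb L uq , (λ v → fwd v , bwd v)) ,
    subst (length (liftNbrs tb L) ≤_) len (liftNbrs-length tb L) ,
    (λ keep → trans (liftNbrs-length-≡ tb L (λ i m → keep i (proj₂ (ch (u i)) m))) len)
    where
    fwd : ∀ v → liftRel B tb (inj₁ (x , px)) v → v ∈ liftNbrs tb L
    fwd (inj₁ (y , py)) r = liftNbrs⁺-outside tb L py (proj₁ (ch y) r)
    fwd (inj₂ j) r with pendantIndex j in pe
    fwd (inj₂ j) () | nothing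
    fwd (inj₂ j) (ex , t) | just i with pendantIndex-aOf⁻ j pe
    ... | refl = liftNbrs⁺-gadget tb L i t (proj₁ (ch (u i)) (cB i ex t))
    bwd : ∀ v → v ∈ liftNbrs tb L → liftRel B tb (inj₁ (x , px)) v
    bwd v m with liftNbrs⁻ tb L m
    ... | inj₁ (y , py , refl , my) = proj₂ (ch y) my
    ... | inj₂ (i , refl , mi , t) = subst (PendantIn tb x) (sym (pendantIndex-aOf i))
            (outNbr px i (symE (subB (proj₂ (ch (u i)) mi))) , t)

  -- The cycle edges u₁u₂, u₂u₄, u₄u₃, u₃u₁, in this order.
  cyclePart : Fin 4 → Part
  cyclePart I0 = partAt I0 pA
  cyclePart I1 = partAt I1 pB
  cyclePart I2 = partAt I3 pB
  cyclePart I3 = partAt I2 pB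

  pendantPart : Fin 4 → Part
  pendantPart i = partAt i pW

  nbrIndex : Fin 4 → Pos → Fin 4
  nbrIndex I0 pA = I1
  nbrIndex I0 pB = I2
  nbrIndex I1 pA = I0
  nbrIndex I1 pB = I3
  nbrIndex I2 pA = I3
  nbrIndex I2 pB = I0
  nbrIndex I3 pA = I1
  nbrIndex I3 pB = I2
  nbrIndex i pW = I0

  cycleEdgeIndex : Fin 4 → Pos → Fin 4
  cycleEdgeIndex I0 pA = I0
  cycleEdgeIndex I0 pB = I3
  cycleEdgeIndex I1 pA = I0
  cycleEdgeIndex I1 pB = I1
  cycleEdgeIndex I2 pA = I2
  cycleEdgeIndex I2 pB = I3
  cycleEdgeIndex I3 pA = I1
  cycleEdgeIndex I3 pB = I2
  cycleEdgeIndex i pW = I0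

  cycleEdgeInT : (Fin 4 → Part) → Fin 4 → Fin 4 → Bool
  cycleEdgeInT q I0 I1 = isTB (q I0)
  cycleEdgeInT q I1 I0 = isTB (q I0)
  cycleEdgeInT q I1 I3 = isTB (q I1)
  cycleEdgeInT q I3 I1 = isTB (q I1)
  cycleEdgeInT q I3 I2 = isTB (q I2)
  cycleEdgeInT q I2 I3 = isTB (q I2)
  cycleEdgeInT q I2 I0 = isTB (q I3)
  cycleEdgeInT q I0 I2 = isTB (q I3)
  cycleEdgeInT q _ _ = false

  isTB⁻ : {t : Part} → T (isTB t) → t ≡ inT
  isTB⁻ {inT} _ = refl
  isCB⁻ : {t : Part} → T (isCB t) → t ≡ inC
  isCB⁻ {inC} _ = refl
  isMB⁻ : {t : Part} → T (isMB t) → t ≡ inM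
  isMB⁻ {inM} _ = refl
  isTB⁺ : {t : Part} → t ≡ inT → T (isTB t)
  isTB⁺ refl = tt
  isCB⁺ : {t : Part} → t ≡ inC → T (isCB t)
  isCB⁺ refl = tt

  cycleEdgeInT-sound : (i j : Fin 4) → T (cycleEdgeInT cyclePart i j) → Tr (u i) (u j)
  cycleEdgeInT-sound I0 I1 t = introT I0 pA (isTB⁻ t)
  cycleEdgeInT-sound I1 I0 t = symT (introT I0 pA (isTB⁻ t))
  cycleEdgeInT-sound I1 I3 t = introT I1 pB (isTB⁻ t)
  cycleEdgeInT-sound I3 I1 t = symT (introT I1 pB (isTB⁻ t))
  cycleEdgeInT-sound I3 I2 t = introT I3 pB (isTB⁻ t)
  cycleEdgeInT-sound I2 I3 t = symT (introT I3 pB (isTB⁻ t))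
  cycleEdgeInT-sound I2 I0 t = introT I2 pB (isTB⁻ t)
  cycleEdgeInT-sound I0 I2 t = symT (introT I2 pB (isTB⁻ t))
  cycleEdgeInT-sound I0 I0 ()
  cycleEdgeInT-sound I0 I3 ()
  cycleEdgeInT-sound I1 I1 ()
  cycleEdgeInT-sound I1 I2 ()
  cycleEdgeInT-sound I2 I1 ()
  cycleEdgeInT-sound I2 I2 ()
  cycleEdgeInT-sound I3 I0 ()
  cycleEdgeInT-sound I3 I3 ()

  nbrIndex-correct : (i : Fin 4) (p : Pos) → p ≢ pW → nbr i p ≡ u (nbrIndex i p)
  nbrIndex-correct I0 pA _ = refl
  nbrIndex-correct I0 pB _ = refl
  nbrIndex-correct I1 pA _ = refl
  nbrIndex-correct I1 pB _ = refl
  nbrIndex-correct I2 pA _ = refl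
  nbrIndex-correct I2 pB _ = refl
  nbrIndex-correct I3 pA _ = refl
  nbrIndex-correct I3 pB _ = refl
  nbrIndex-correct i pW ne = ⊥-elim (ne refl)

  partAt-cyclePart : (i : Fin 4) (p : Pos) → p ≢ pW → partAt i p ≡ cyclePart (cycleEdgeIndex i p)
  partAt-cyclePart I0 pA _ = refl
  partAt-cyclePart I0 pB _ = partOf-flip (nbr-edge I0 pB) (nbr-edge I2 pB) (inj₂ (refl , refl))
  partAt-cyclePart I1 pA _ = partOf-flip (nbr-edge I1 pA) (nbr-edge I0 pA) (inj₂ (refl , refl))
  partAt-cyclePart I1 pB _ = refl
  partAt-cyclePart I2 pA _ = partOf-flip (nbr-edge I2 pA) (nbr-edge I3 pB) (inj₂ (refl , refl))
  partAt-cyclePart I2 pB _ = refl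
  partAt-cyclePart I3 pA _ = partOf-flip (nbr-edge I3 pA) (nbr-edge I1 pB) (inj₂ (refl , refl))
  partAt-cyclePart I3 pB _ = refl
  partAt-cyclePart i pW ne = ⊥-elim (ne refl)

  cycleEdgeInT-nbrIndex : (i : Fin 4) (p : Pos) → p ≢ pW → cycleEdgeInT cyclePart i (nbrIndex i p) ≡ isTB (cyclePart (cycleEdgeIndex i p))
  cycleEdgeInT-nbrIndex I0 pA _ = refl
  cycleEdgeInT-nbrIndex I0 pB _ = refl
  cycleEdgeInT-nbrIndex I1 pA _ = refl
  cycleEdgeInT-nbrIndex I1 pB _ = refl
  cycleEdgeInT-nbrIndex I2 pA _ = refl
  cycleEdgeInT-nbrIndex I2 pB _ = refl
  cycleEdgeInT-nbrIndex I3 pA _ = refl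
  cycleEdgeInT-nbrIndex I3 pB _ = refl
  cycleEdgeInT-nbrIndex i pW ne = ⊥-elim (ne refl)

  nbr-pW : (i : Fin 4) → nbr i pW ≡ w i
  nbr-pW I0 = refl
  nbr-pW I1 = refl
  nbr-pW I2 = refl
  nbr-pW I3 = refl

  cycleEdgeInT-complete : (i j : Fin 4) → Tr (u i) (u j) → T (cycleEdgeInT cyclePart i j)
  cycleEdgeInT-complete i j r with classT i r
  ... | pW , e , _ = ⊥-elim (offNot (off i) j (sym (trans e (nbr-pW i))))
  ... | pA , e , ty≡ with u-injective j (nbrIndex i pA) (trans e (nbrIndex-correct i pA (λ ())))
  ...   | refl = subst T (sym (cycleEdgeInT-nbrIndex i pA (λ ()))) (isTB⁺ (trans (sym (partAt-cyclePart i pA (λ ()))) ty≡))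
  cycleEdgeInT-complete i j r | pB , e , ty≡ with u-injective j (nbrIndex i pB) (trans e (nbrIndex-correct i pB (λ ())))
  ...   | refl = subst T (sym (cycleEdgeInT-nbrIndex i pB (λ ()))) (isTB⁺ (trans (sym (partAt-cyclePart i pB (λ ()))) ty≡))

  pendantPart-T⁻ : (i : Fin 4) → pendantPart i ≡ inT → Tr (u i) (w i)
  pendantPart-T⁻ i e = subst (Tr (u i)) (nbr-pW i) (introT i pW e)
  pendantPart-C⁻ : (i : Fin 4) → pendantPart i ≡ inC → C (u i) (w i)
  pendantPart-C⁻ i e = subst (C (u i)) (nbr-pW i) (introC i pW e)
  pendantPart-M⁻ : (i : Fin 4) → pendantPart i ≡ inM → M (u i) (w i)
  pendantPart-M⁻ i e = subst (M (u i)) (nbr-pW i) (introM i pW e)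
  pendantPart-T : (i : Fin 4) → Tr (u i) (w i) → pendantPart i ≡ inT
  pendantPart-T i r = partOf-T (exact _ _ (nbr-edge i pW)) (subst (Tr (u i)) (sym (nbr-pW i)) r)
  pendantPart-C : (i : Fin 4) → C (u i) (w i) → pendantPart i ≡ inC
  pendantPart-C i r = partOf-C (exact _ _ (nbr-edge i pW)) (subst (C (u i)) (sym (nbr-pW i)) r)

  is0or2 : ℕ → Bool
  is0or2 0 = true
  is0or2 2 = true
  is0or2 _ = false

  is0or1 : ℕ → Bool
  is0or1 0 = true
  is0or1 1 = true
  is0or1 _ = false

  degree0or2 : (B : Adj HVert) (v : HVert) (k : ℕ) → T (is0or2 k) → Degree B v k → Degree B v 0 ⊎ Degree B v 2
  degree0or2 B v 0 _ d = inj₁ d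
  degree0or2 B v 2 _ d = inj₂ d
  degree0or2 B v 1 ()
  degree0or2 B v (suc (suc (suc k))) ()

  degree0or1 : (B : Adj HVert) (v : HVert) (k : ℕ) → T (is0or1 k) → Degree B v k → Degree B v 0 ⊎ Degree B v 1
  degree0or1 B v 0 _ d = inj₁ d
  degree0or1 B v 1 _ d = inj₂ d
  degree0or1 B v (suc (suc k)) ()

  GadgetDegreesOK : (GEdge → Part) → Set
  GadgetDegreesOK typ = ∀ j → T (is0or2 (length (selectNbrs (selectC typ) (incidences j)))) × T (is0or1 (length (selectNbrs (selectM typ) (incidences j))))

  assemble : (typ : GEdge → Part) →
    (∀ i → typ (pendant i) ≡ inC → pendantPart i ≡ inC) → (∀ i → pendantPart i ≡ inC → typ (pendant i) ≡ inC) →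
    (∀ i → typ (pendant i) ≡ inM → pendantPart i ≡ inM) → GadgetDegreesOK typ →
    SpanningTree HAdj (liftRel Tr (selectT typ)) → HasThreeDecomposition HAdj
  assemble typ cC1 cC2 cM lok st =
    liftRel Tr (selectT typ) , liftRel C (selectC typ) , liftRel M (selectM typ) ,
    st , (((λ {a} {b} r → liftRel-sub {B = C} {tb = selectC typ} (proj₁ subC) {a} {b} r) ,
      (λ {a} {b} r → liftRel-sym {B = C} {tb = selectC typ} symC {a} {b} r)) , degCH) ,
    (((λ {a} {b} r → liftRel-sub {B = M} {tb = selectM typ} (proj₁ subM) {a} {b} r) ,
      (λ {a} {b} r → liftRel-sym {B = M} {tb = selectM typ} symM {a} {b} r)) , degMH) , exact-lift typ
    where
    toC : ∀ {x} i → x ≡ w i → T (selectC typ (pendant i)) → C x (u i)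
    toC i refl t = symC (pendantPart-C⁻ i (cC1 i (isCB⁻ t)))
    fromC : ∀ {x} (px : Out x) i → C x (u i) → T (selectC typ (pendant i))
    fromC px i r with outNbr px i (symE (proj₁ subC r))
    ... | refl = isCB⁺ (cC2 i (pendantPart-C i (symC r)))
    toM : ∀ {x} i → x ≡ w i → T (selectM typ (pendant i)) → M x (u i)
    toM i refl t = symM (pendantPart-M⁻ i (cM i (isMB⁻ t)))
    liftedC : ∀ {x} (px : Out x) {k} → Degree C x k → Degree (liftRel C (selectC typ)) (inj₁ (x , px)) k
    liftedC {x} px d with outsideDegree C (proj₁ subC) symC (selectC typ) x px d toC
    ... | _ , dd , _ , keq = subst (Degree (liftRel C (selectC typ)) (inj₁ (x , px))) (keq (fromC px)) dd
    degCH : ∀ v → Degree (liftRel C (selectC typ)) v 0 ⊎ Degree (liftRel C (selectC typ)) v 2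
    degCH (inj₂ j) = degree0or2 (liftRel C (selectC typ)) (inj₂ j) _ (proj₁ (lok j)) (gadgetDegree C (selectC typ) j)
    degCH (inj₁ (x , px)) with degC x
    ... | inj₁ d = inj₁ (liftedC px d)
    ... | inj₂ d = inj₂ (liftedC px d)
    degMH : ∀ v → Degree (liftRel M (selectM typ)) v 0 ⊎ Degree (liftRel M (selectM typ)) v 1
    degMH (inj₂ j) = degree0or1 (liftRel M (selectM typ)) (inj₂ j) _ (proj₂ (lok j)) (gadgetDegree M (selectM typ) j)
    degMH (inj₁ (x , px)) with degM x
    ... | inj₁ d with outsideDegree M (proj₁ subM) symM (selectM typ) x px d toM
    ...   | 0 , dd , _ , _ = inj₁ dd
    ...   | suc _ , _ , () , _
    degMH (inj₁ (x , px)) | inj₂ d with outsideDegree M (proj₁ subM) symM (selectM typ) x px d toM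
    ...   | 0 , dd , _ , _ = inj₁ dd
    ...   | 1 , dd , _ , _ = inj₂ dd
    ...   | suc (suc _) , _ , s≤s () , _

  houseSelectedM : Selection → Maybe HEdge → Bool
  houseSelectedM tb nothing = false
  houseSelectedM tb (just e) = tb (house e)

  houseSelected : Selection → Fin 6 → Fin 6 → Bool
  houseSelected tb i j = houseSelectedM tb (houseEdge i j)

  HouseRel : Selection → Fin 6 → Fin 6 → Set
  HouseRel tb i j = HouseIn tb (houseEdge i j)

  houseSelectedM⁺ : (tb : Selection) (m : Maybe HEdge) → HouseIn tb m → T (houseSelectedM tb m)
  houseSelectedM⁺ tb (just e) h = h
  houseSelectedM⁻ : (tb : Selection) (m : Maybe HEdge) → T (houseSelectedM tb m) → HouseIn tb m
  houseSelectedM⁻ tb (just e) h = h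

  houseRel? : (tb : Selection) (i j : Fin 6) → Dec (HouseRel tb i j)
  houseRel? tb i j with houseSelected tb i j in eq
  ... | true = yes (houseSelectedM⁻ tb (houseEdge i j) (subst T (sym eq) tt))
  ... | false = no (λ h → subst T eq (houseSelectedM⁺ tb (houseEdge i j) h))

  -- Spanning trees of H by contraction

  mutual
    searchPath : (tb : Selection) → ℕ → (a b : Fin 6) → Maybe (Star (HouseRel tb) a b)
    searchPath tb k a b with a ≟ b
    ... | yes refl = just ε
    searchPath tb zero a b | no _ = nothing
    searchPath tb (suc k) a b | no _ = searchVia tb k a b fins6

    searchVia : (tb : Selection) → ℕ → (a b : Fin 6) → List (Fin 6) → Maybe (Star (HouseRel tb) a b)
    searchVia tb k a b [] = nothing
    searchVia tb k a b (c ∷ cs) with houseRel? tb a c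
    ... | no _ = searchVia tb k a b cs
    ... | yes h with searchPath tb k c b
    ...   | just p = just (h ◅ p)
    ...   | nothing = searchVia tb k a b cs

  fromJust : {A : Set} (m : Maybe A) → T (is-just m) → A
  fromJust (just a) _ = a

  -- A path in the six-vertex house needs at most five edges.
  houseConnected : Selection → Fin 6 → Fin 6 → Bool
  houseConnected tb a b = is-just (searchPath tb 5 a b)

  houseConnected-sound : (tb : Selection) (a b : Fin 6) → T (houseConnected tb a b) → Star (HouseRel tb) a b
  houseConnected-sound tb a b t = fromJust (searchPath tb 5 a b) t

  contractIndex : Fin 4 → Fin 4 → Fin 6 → Fin 4
  contractIndex a b A1 = I0
  contractIndex a b A2 = I1
  contractIndex a b A3 = I2
  contractIndex a b A4 = I3
  contractIndex a b A5 = a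
  contractIndex a b A6 = b

  contractIndex-aOf : (a b : Fin 4) (i : Fin 4) → contractIndex a b (aOf i) ≡ i
  contractIndex-aOf a b I0 = refl
  contractIndex-aOf a b I1 = refl
  contractIndex-aOf a b I2 = refl
  contractIndex-aOf a b I3 = refl

  orientedEnds : HEdge → Bool → Fin 6 × Fin 6
  orientedEnds e true = houseEnds e
  orientedEnds e false = proj₂ (houseEnds e) , proj₁ (houseEnds e)

  collapsedSel : Selection → Fin 4 → Fin 4 → Selection
  collapsedSel tb a b (house e) = tb (house e) ∧ eq4 (contractIndex a b (proj₁ (houseEnds e))) (contractIndex a b (proj₂ (houseEnds e)))
  collapsedSel tb a b (pendant _) = false

  collapsedDegree : Selection → Fin 4 → Fin 4 → Fin 6 → ℕ
  collapsedDegree tb a b j = length (selectNbrs (collapsedSel tb a b) (incidences j))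

  atLeast2 : ℕ → Bool
  atLeast2 (suc (suc _)) = true
  atLeast2 _ = false

  pendantOK : Selection → (Fin 4 → Part) → Fin 4 → Bool
  pendantOK tb f i = (tb (pendant i) ∧ isTB (f i)) ∨ (not (tb (pendant i)) ∧ not (isTB (f i)))

  pendantsOK : Selection → (Fin 4 → Part) → Bool
  pendantsOK tb f = all4 (pendantOK tb f)

  edgeMapsAt : Selection → Fin 4 → Fin 4 → (Fin 4 → Part) → Fin 6 → Fin 6 → Bool
  edgeMapsAt tb a b q i j = not (houseSelected tb i j) ∨
    (eq4 (contractIndex a b i) (contractIndex a b j) ∨ cycleEdgeInT q (contractIndex a b i) (contractIndex a b j))

  edgesMapOK : Selection → Fin 4 → Fin 4 → (Fin 4 → Part) → Bool
  edgesMapOK tb a b q = all6 λ i → all6 (edgeMapsAt tb a b q i)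

  injectiveAt : Selection → Fin 4 → Fin 4 → Fin 6 × Fin 6 → Fin 6 × Fin 6 → Bool
  injectiveAt tb a b (i , j) (i1 , j1) =
    not (eq4 (contractIndex a b i) (contractIndex a b i1) ∧ eq4 (contractIndex a b j) (contractIndex a b j1)) ∨
    eq4 (contractIndex a b i) (contractIndex a b j) ∨ (eq6 i i1 ∧ eq6 j j1)

  edgesInjectiveAt : Selection → Fin 4 → Fin 4 → HEdge → Bool → HEdge → Bool → Bool
  edgesInjectiveAt tb a b e o e1 o1 = not (tb (house e) ∧ tb (house e1)) ∨ injectiveAt tb a b (orientedEnds e o) (orientedEnds e1 o1)

  edgesInjectiveAt₃ : Selection → Fin 4 → Fin 4 → HEdge → Bool → HEdge → Bool
  edgesInjectiveAt₃ tb a b e o e1 = allL bools (edgesInjectiveAt tb a b e o e1)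

  edgesInjectiveAt₂ : Selection → Fin 4 → Fin 4 → HEdge → Bool → Bool
  edgesInjectiveAt₂ tb a b e o = allL hedges (edgesInjectiveAt₃ tb a b e o)

  edgesInjectiveAt₁ : Selection → Fin 4 → Fin 4 → HEdge → Bool
  edgesInjectiveAt₁ tb a b e = allL bools (edgesInjectiveAt₂ tb a b e)

  edgesInjectiveOK : Selection → Fin 4 → Fin 4 → Bool
  edgesInjectiveOK tb a b = allL hedges (edgesInjectiveAt₁ tb a b)

  collapsedDistinct : Selection → Fin 4 → Fin 4 → Fin 6 → Fin 6 → Bool
  collapsedDistinct tb a b j j1 = not (atLeast2 (collapsedDegree tb a b j) ∧ atLeast2 (collapsedDegree tb a b j1)) ∨ eq6 j j1

  collapsedDistinctFrom : Selection → Fin 4 → Fin 4 → Fin 6 → Bool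
  collapsedDistinctFrom tb a b j = all6 (collapsedDistinct tb a b j)

  oneTwoCollapsedOK : Selection → Fin 4 → Fin 4 → Bool
  oneTwoCollapsedOK tb a b = all6 (collapsedDistinctFrom tb a b)

  cycleEdgeConnected : Selection → (Fin 4 → Part) → Fin 4 → Fin 4 → Bool
  cycleEdgeConnected tb q i j = not (cycleEdgeInT q i j) ∨ houseConnected tb (aOf i) (aOf j)

  connectsOK : Selection → (Fin 4 → Part) → Bool
  connectsOK tb q = (all4 λ i → all4 (cycleEdgeConnected tb q i)) ∧
    anyL fins4 (λ i → houseConnected tb A5 (aOf i)) ∧ anyL fins4 (λ i → houseConnected tb A6 (aOf i))

  contractionOK : Selection → Fin 4 → Fin 4 → (Fin 4 → Part) → (Fin 4 → Part) → Bool
  contractionOK tb a b q f = pendantsOK tb f ∧ (edgesMapOK tb a b q ∧ (edgesInjectiveOK tb a b ∧ (oneTwoCollapsedOK tb a b ∧ connectsOK tb q)))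

  qText : {q : Fin 4 → Part} → (∀ k → cyclePart k ≡ q k) → ∀ i j → cycleEdgeInT cyclePart i j ≡ cycleEdgeInT q i j
  qText e I0 I0 = refl
  qText e I0 I1 = cong isTB (e I0)
  qText e I0 I2 = cong isTB (e I3)
  qText e I0 I3 = refl
  qText e I1 I0 = cong isTB (e I0)
  qText e I1 I1 = refl
  qText e I1 I2 = refl
  qText e I1 I3 = cong isTB (e I1)
  qText e I2 I0 = cong isTB (e I3)
  qText e I2 I1 = refl
  qText e I2 I2 = refl
  qText e I2 I3 = cong isTB (e I2)
  qText e I3 I0 = refl
  qText e I3 I1 = cong isTB (e I1)
  qText e I3 I2 = cong isTB (e I2)
  qText e I3 I3 = refl

  pendInfo : {tb : Selection} {x : Fin n} {j : Fin 6} → PendantIn tb x (pendantIndex j) → Σ (Fin 4) λ i → j ≡ aOf i × x ≡ w i × T (tb (pendant i))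
  pendInfo {tb} {x} {j} pr with pendantIndex j in pe
  pendInfo {tb} {x} {j} () | nothing
  pendInfo {tb} {x} {j} (ex , t) | just i = i , pendantIndex-aOf⁻ j pe , ex , t

  hbOr : (tb : Selection) (i j : Fin 6) → HouseRel tb i j → Σ HEdge λ e → Σ Bool λ o → orientedEnds e o ≡ (i , j) × T (tb (house e))
  hbOr tb i j h with houseEdge i j in eq
  hbOr tb i j () | nothing
  hbOr tb i j h | just e with houseEdge-ends i j eq
  ... | inj₁ (e1 , e2) = e , true , cong₂ _,_ (sym e1) (sym e2) , h
  ... | inj₂ (e1 , e2) = e , false , cong₂ _,_ (sym e1) (sym e2) , h

  φ0 : (x : Fin n) → Location x → HVert
  φ0 x (outside p) = inj₁ (x , p)
  φ0 x (onCycle i _) = inj₂ (aOf i)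

  φ : Fin n → HVert
  φ x = φ0 x (locate x)

  φOut : (x : Fin n) (px : Out x) → φ x ≡ inj₁ (x , px)
  φOut x px with locate x
  ... | outside p = injEq refl
  ... | onCycle i e = ⊥-elim (outNot px i e)

  φU : (i : Fin 4) → φ (u i) ≡ inj₂ (aOf i)
  φU i with locate (u i)
  ... | outside p = ⊥-elim (outNot p i refl)
  ... | onCycle j e with u-injective i j e
  ...   | refl = refl

  twoMem : {A : Set} {p q : A} (l : List A) → p ∈ l → q ∈ l → p ≢ q → 2 ≤ length l
  twoMem (x ∷ []) (here refl) (here refl) ne = ⊥-elim (ne refl)
  twoMem (x ∷ y ∷ l) _ _ _ = s≤s (s≤s z≤n)

  kLift : (tb : Selection) (a b : Fin 4) (j k : Fin 6) → HouseRel tb j k → contractIndex a b j ≡ contractIndex a b k → HouseRel (collapsedSel tb a b) j k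
  kLift tb a b j k h e with houseEdge j k in eq
  kLift tb a b j k () e | nothing
  kLift tb a b j k h e | just f with houseEdge-ends j k eq
  ... | inj₁ (refl , refl) = andT h (eq4C e)
  ... | inj₂ (refl , refl) = andT h (eq4C (sym e))

  module ContractedTree (tb : Selection) (a b : Fin 4)
    (pendantT : ∀ i → T (tb (pendant i)) → pendantPart i ≡ inT)
    (pendantT⁻ : ∀ i → pendantPart i ≡ inT → T (tb (pendant i)))
    (maps : ∀ i j → HouseRel tb i j → contractIndex a b i ≢ contractIndex a b j → Tr (u (contractIndex a b i)) (u (contractIndex a b j)))
    (injective : ∀ {i j i1 j1} → HouseRel tb i j → HouseRel tb i1 j1 → contractIndex a b i ≢ contractIndex a b j →
           contractIndex a b i ≡ contractIndex a b i1 → contractIndex a b j ≡ contractIndex a b j1 → i ≡ i1 × j ≡ j1)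
    (oneTwoCollapsed : ∀ j j1 → 2 ≤ collapsedDegree tb a b j → 2 ≤ collapsedDegree tb a b j1 → j ≡ j1)
    (connects : ∀ i j → Tr (u i) (u j) → Star (HouseRel tb) (aOf i) (aOf j))
    (reaches-a5 : Σ (Fin 4) λ i → Star (HouseRel tb) A5 (aOf i))
    (reaches-a6 : Σ (Fin 4) λ i → Star (HouseRel tb) A6 (aOf i)) where

    R : Adj HVert
    R = liftRel Tr tb

    ψ : HVert → Fin n
    ψ (inj₁ (x , _)) = x
    ψ (inj₂ j) = u (contractIndex a b j)

    pendT : ∀ i → T (tb (pendant i)) → Tr (w i) (u i)
    pendT i t = symT (pendantPart-T⁻ i (pendantT i t))

    h1 : ∀ {p r} → R p r → ψ p ≢ ψ r → Tr (ψ p) (ψ r)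
    h1 {inj₁ _} {inj₁ _} x _ = x
    h1 {inj₁ (x , _)} {inj₂ j} pr _ with pendInfo {tb} {x} {j} pr
    ... | i , refl , refl , t = subst (λ z → Tr (w i) (u z)) (sym (contractIndex-aOf a b i)) (pendT i t)
    h1 {inj₂ j} {inj₁ (x , _)} pr _ with pendInfo {tb} {x} {j} pr
    ... | i , refl , refl , t = subst (λ z → Tr (u z) (w i)) (sym (contractIndex-aOf a b i)) (symT (pendT i t))
    h1 {inj₂ i} {inj₂ j} h ne = maps i j h (λ e → ne (cong u e))

    h2 : ∀ {p r p1 r1} → R p r → R p1 r1 → ψ p ≢ ψ r → ψ p ≡ ψ p1 → ψ r ≡ ψ r1 → p ≡ p1 × r ≡ r1
    h2 {inj₁ (x , px)} {_} {inj₂ j1} _ _ _ ep _ = ⊥-elim (outNot px _ ep)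
    h2 {inj₂ j} {_} {inj₁ (x1 , px1)} _ _ _ ep _ = ⊥-elim (outNot px1 _ (sym ep))
    h2 {inj₁ (x , px)} {inj₁ (y , py)} {inj₁ (x1 , px1)} {inj₁ (y1 , py1)} _ _ _ ep er = injEq ep , injEq er
    h2 {inj₁ (x , px)} {inj₁ (y , py)} {inj₁ (x1 , px1)} {inj₂ j1} _ _ _ ep er = ⊥-elim (outNot py _ er)
    h2 {inj₁ (x , px)} {inj₂ j} {inj₁ (x1 , px1)} {inj₁ (y1 , py1)} _ _ _ ep er = ⊥-elim (outNot py1 _ (sym er))
    h2 {inj₁ (x , px)} {inj₂ j} {inj₁ (x1 , px1)} {inj₂ j1} r r1 _ ep er with pendInfo {tb} {x} {j} r | pendInfo {tb} {x1} {j1} r1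
    ... | i , refl , _ | i1 , refl , _ =
          injEq ep , cong (λ z → inj₂ (aOf z)) (trans (sym (contractIndex-aOf a b i)) (trans (u-injective _ _ er) (contractIndex-aOf a b i1)))
    h2 {inj₂ j} {inj₁ (y , py)} {inj₂ j1} {inj₂ k1} _ _ _ ep er = ⊥-elim (outNot py _ er)
    h2 {inj₂ j} {inj₂ k} {inj₂ j1} {inj₁ (y1 , py1)} _ _ _ ep er = ⊥-elim (outNot py1 _ (sym er))
    h2 {inj₂ j} {inj₁ (y , py)} {inj₂ j1} {inj₁ (y1 , py1)} r r1 _ ep er with pendInfo {tb} {y} {j} r | pendInfo {tb} {y1} {j1} r1
    ... | i , refl , _ | i1 , refl , _ =
          cong (λ z → inj₂ (aOf z)) (trans (sym (contractIndex-aOf a b i)) (trans (u-injective _ _ ep) (contractIndex-aOf a b i1))) , injEq er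
    h2 {inj₂ j} {inj₂ k} {inj₂ j1} {inj₂ k1} r r1 ne ep er
      with injective {j} {k} {j1} {k1} r r1 (λ e → ne (cong u e)) (u-injective _ _ ep) (u-injective _ _ er)
    ... | refl , refl = refl , refl

    kmem : (j : Fin 6) (p : HVert) → R (inj₂ j) p → u (contractIndex a b j) ≡ ψ p → p ∈ selectNbrs (collapsedSel tb a b) (incidences j)
    kmem j (inj₁ (y , py)) r e = ⊥-elim (outNot py _ (sym e))
    kmem j (inj₂ k) r e = selectNbrs⁺ (collapsedSel tb a b) (incidences j)
      (incidences-complete (collapsedSel tb a b) {Tr} j (inj₂ k) (kLift tb a b j k r (u-injective _ _ e)))

    deg2len : (j : Fin 6) → TwoCollapsed R ψ (inj₂ j) → 2 ≤ collapsedDegree tb a b j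
    deg2len j (p , q , npq , (rp , ep) , (rq , eq)) = twoMem _ (kmem j p rp ep) (kmem j q rq eq) npq

    noDeg2out : (x : Fin n) (px : Out x) → TwoCollapsed R ψ (inj₁ (x , px)) → ⊥
    noDeg2out x px (inj₁ (y , py) , _ , _ , (rp , refl) , _) = IsSimple.irrefl simple (proj₁ subT rp)
    noDeg2out x px (inj₂ k , _ , _ , (rp , ep) , _) = outNot px _ ep

    h3 : ∀ {v v1} → TwoCollapsed R ψ v → TwoCollapsed R ψ v1 → v ≡ v1
    h3 {inj₁ (x , px)} d _ = ⊥-elim (noDeg2out x px d)
    h3 {inj₂ j} {inj₁ (x , px)} _ d = ⊥-elim (noDeg2out x px d)
    h3 {inj₂ j} {inj₂ j1} d d1 = cong inj₂ (oneTwoCollapsed j j1 (deg2len j d) (deg2len j1 d1))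

    symR : Symmetric R
    symR {x} {y} r = liftRel-sym {B = Tr} {tb = tb} symT {x} {y} r

    liftH : ∀ {i j} → Star (HouseRel tb) i j → Star R (inj₂ i) (inj₂ j)
    liftH = gmap inj₂ (λ h → h)

    pendStep : (i : Fin 4) (y : Fin n) (py : Out y) → Tr y (u i) → R (inj₁ (y , py)) (inj₂ (aOf i))
    pendStep i y py r with outNbr py i (symE (proj₁ subT r))
    ... | refl = subst (PendantIn tb (w i)) (sym (pendantIndex-aOf i)) (refl , pendantT⁻ i (pendantPart-T i (symT r)))

    c1 : ∀ {x y} → Tr x y → Star R (φ x) (φ y)
    c1 {x} {y} r with locate x | locate y
    ... | outside px | outside py = r ◅ ε
    ... | outside px | onCycle j refl = pendStep j x px r ◅ ε
    ... | onCycle i refl | outside py = symR {inj₁ (y , py)} {inj₂ (aOf i)} (pendStep i y py (symT r)) ◅ ε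
    ... | onCycle i refl | onCycle j refl = liftH (connects i j r)

    c2 : ∀ v → Σ (Fin n) λ x → Star R v (φ x)
    c2 (inj₁ (x , px)) = x , subst (Star R (inj₁ (x , px))) (sym (φOut x px)) ε
    c2 (inj₂ A1) = u I0 , subst (Star R (inj₂ A1)) (sym (φU I0)) ε
    c2 (inj₂ A2) = u I1 , subst (Star R (inj₂ A2)) (sym (φU I1)) ε
    c2 (inj₂ A3) = u I2 , subst (Star R (inj₂ A3)) (sym (φU I2)) ε
    c2 (inj₂ A4) = u I3 , subst (Star R (inj₂ A4)) (sym (φU I3)) ε
    c2 (inj₂ A5) = u (proj₁ reaches-a5) , subst (Star R (inj₂ A5)) (sym (φU (proj₁ reaches-a5))) (liftH (proj₂ reaches-a5))
    c2 (inj₂ A6) = u (proj₁ reaches-a6) , subst (Star R (inj₂ A6)) (sym (φU (proj₁ reaches-a6))) (liftH (proj₂ reaches-a6))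

    module C = Contraction (_≟_ {n}) {R = R} {S = Tr} (λ {x} {y} r → symR {x} {y} r) ψ
      (λ {p} {r} x ne → h1 {p} {r} x ne) (λ {p} {r} {p1} {r1} → h2 {p} {r} {p1} {r1}) (λ {v} {v1} → h3 {v} {v1})

    tree : SpanningTree HAdj R
    tree = ((λ {x} {y} r → liftRel-sub {B = Tr} {tb = tb} (proj₁ subT) {x} {y} r) , (λ {x} {y} r → symR {x} {y} r)) ,
           C.connected φ c1 c2 connT , C.acyclic acycT

  pendantsOK-T : (tb : Selection) (f : Fin 4 → Part) → T (pendantsOK tb f) → (∀ i → pendantPart i ≡ f i) → ∀ i → T (tb (pendant i)) → pendantPart i ≡ inT
  pendantsOK-T tb f okF eqf i t with ∨S {tb (pendant i) ∧ isTB (f i)} (all4S {pendantOK tb f} okF i)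
  ... | inj₁ x = trans (eqf i) (isTB⁻ (∧S2 {tb (pendant i)} x))
  ... | inj₂ y = ⊥-elim (notS (∧S1 y) t)

  pendantsOK-T⁻ : (tb : Selection) (f : Fin 4 → Part) → T (pendantsOK tb f) → (∀ i → pendantPart i ≡ f i) → ∀ i → pendantPart i ≡ inT → T (tb (pendant i))
  pendantsOK-T⁻ tb f okF eqf i e with ∨S {tb (pendant i) ∧ isTB (f i)} (all4S {pendantOK tb f} okF i)
  ... | inj₁ x = ∧S1 x
  ... | inj₂ y = ⊥-elim (notS (∧S2 {not (tb (pendant i))} y) (isTB⁺ (trans (sym (eqf i)) e)))

  edgesMapOK-sound : (tb : Selection) (a b : Fin 4) (q : Fin 4 → Part) → T (edgesMapOK tb a b q) → (∀ k → cyclePart k ≡ q k) →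
    ∀ i j → HouseRel tb i j → contractIndex a b i ≢ contractIndex a b j → Tr (u (contractIndex a b i)) (u (contractIndex a b j))
  edgesMapOK-sound tb a b q okH1 eqq i j h ne with ∨S {not (houseSelected tb i j)} (all6S {edgeMapsAt tb a b q i} (all6S {λ i → all6 (edgeMapsAt tb a b q i)} okH1 i) j)
  ... | inj₁ x = ⊥-elim (notS x (houseSelectedM⁺ tb (houseEdge i j) h))
  ... | inj₂ y with ∨S {eq4 (contractIndex a b i) (contractIndex a b j)} y
  ...   | inj₁ z = ⊥-elim (ne (eq4S z))
  ...   | inj₂ z = cycleEdgeInT-sound _ _ (subst T (sym (qText eqq (contractIndex a b i) (contractIndex a b j))) z)

  edgesInjectiveOK-sound : (tb : Selection) (a b : Fin 4) → T (edgesInjectiveOK tb a b) →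
    ∀ {i j i1 j1} → HouseRel tb i j → HouseRel tb i1 j1 → contractIndex a b i ≢ contractIndex a b j →
      contractIndex a b i ≡ contractIndex a b i1 → contractIndex a b j ≡ contractIndex a b j1 → i ≡ i1 × j ≡ j1
  edgesInjectiveOK-sound tb a b okH2 {i} {j} {i1} {j1} h h1 ne e1 e2 with hbOr tb i j h | hbOr tb i1 j1 h1
  ... | e , o , eo , t | f1 , o1 , eo1 , t1 =
    fin (subst₂ (λ z z1 → T (injectiveAt tb a b z z1)) eo eo1 inst)
    where
    inst0 : T (edgesInjectiveAt tb a b e o f1 o1)
    inst0 = allLS bools {edgesInjectiveAt tb a b e o f1} (allLS hedges {edgesInjectiveAt₃ tb a b e o} (allLS bools {edgesInjectiveAt₂ tb a b e}
              (allLS hedges {edgesInjectiveAt₁ tb a b} okH2 (hedge∈ e)) (bool∈ o)) (hedge∈ f1)) (bool∈ o1)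
    inst : T (injectiveAt tb a b (orientedEnds e o) (orientedEnds f1 o1))
    inst with ∨S {not (tb (house e) ∧ tb (house f1))} inst0
    ... | inj₁ x = ⊥-elim (notS x (andT t t1))
    ... | inj₂ y = y
    fin : T (injectiveAt tb a b (i , j) (i1 , j1)) → i ≡ i1 × j ≡ j1
    fin t2 with ∨S {not (eq4 (contractIndex a b i) (contractIndex a b i1) ∧ eq4 (contractIndex a b j) (contractIndex a b j1))} t2
    ... | inj₁ x = ⊥-elim (notS x (andT (eq4C e1) (eq4C e2)))
    ... | inj₂ y with ∨S {eq4 (contractIndex a b i) (contractIndex a b j)} y
    ...   | inj₁ z = ⊥-elim (ne (eq4S z))
    ...   | inj₂ z = eq6S (∧S1 z) , eq6S (∧S2 {eq6 i i1} z)

  atLeast2-complete : {k : ℕ} → 2 ≤ k → T (atLeast2 k)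
  atLeast2-complete (s≤s (s≤s _)) = tt

  oneTwoCollapsedOK-sound : (tb : Selection) (a b : Fin 4) → T (oneTwoCollapsedOK tb a b) →
    ∀ j j1 → 2 ≤ collapsedDegree tb a b j → 2 ≤ collapsedDegree tb a b j1 → j ≡ j1
  oneTwoCollapsedOK-sound tb a b okH3 j j1 l1 l2 with ∨S {not (atLeast2 (collapsedDegree tb a b j) ∧ atLeast2 (collapsedDegree tb a b j1))}
                                     (all6S {collapsedDistinct tb a b j} (all6S {collapsedDistinctFrom tb a b} okH3 j) j1)
  ... | inj₁ x = ⊥-elim (notS x (andT (atLeast2-complete l1) (atLeast2-complete l2)))
  ... | inj₂ y = eq6S y

  connectsOK-cycle : (tb : Selection) (q : Fin 4 → Part) → T (connectsOK tb q) → (∀ k → cyclePart k ≡ q k) →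
    ∀ i j → Tr (u i) (u j) → Star (HouseRel tb) (aOf i) (aOf j)
  connectsOK-cycle tb q okC eqq i j r with ∨S {not (cycleEdgeInT q i j)} (all4S {cycleEdgeConnected tb q i} (all4S {λ i → all4 (cycleEdgeConnected tb q i)} (∧S1 okC) i) j)
  ... | inj₁ x = ⊥-elim (notS x (subst T (qText eqq i j) (cycleEdgeInT-complete i j r)))
  ... | inj₂ y = houseConnected-sound tb (aOf i) (aOf j) y

  connectsOK-a5 : (tb : Selection) (q : Fin 4 → Part) → T (connectsOK tb q) → Σ (Fin 4) λ i → Star (HouseRel tb) A5 (aOf i)
  connectsOK-a5 tb q okC with anyLS fins4 {λ i → houseConnected tb A5 (aOf i)} (∧S1 (∧S2 {all4 λ i → all4 (cycleEdgeConnected tb q i)} okC))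
  ... | i , t = i , houseConnected-sound tb A5 (aOf i) t

  connectsOK-a6 : (tb : Selection) (q : Fin 4 → Part) → T (connectsOK tb q) → Σ (Fin 4) λ i → Star (HouseRel tb) A6 (aOf i)
  connectsOK-a6 tb q okC with anyLS fins4 {λ i → houseConnected tb A6 (aOf i)}
                            (∧S2 {anyL fins4 (λ i → houseConnected tb A5 (aOf i))} (∧S2 {all4 λ i → all4 (cycleEdgeConnected tb q i)} okC))
  ... | i , t = i , houseConnected-sound tb A6 (aOf i) t

  contractedTree : (tb : Selection) (a b : Fin 4) (q f : Fin 4 → Part) → (∀ k → cyclePart k ≡ q k) → (∀ k → pendantPart k ≡ f k) →
    T (contractionOK tb a b q f) → SpanningTree HAdj (liftRel Tr tb)
  contractedTree tb a b q f eqq eqf ok =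
    ContractedTree.tree tb a b (pendantsOK-T tb f okF eqf) (pendantsOK-T⁻ tb f okF eqf) (edgesMapOK-sound tb a b q okH1 eqq)
      (λ {i} {j} {i1} {j1} → edgesInjectiveOK-sound tb a b okH2 {i} {j} {i1} {j1}) (oneTwoCollapsedOK-sound tb a b okH3)
      (connectsOK-cycle tb q okC eqq) (connectsOK-a5 tb q okC) (connectsOK-a6 tb q okC)
    where
    okF : T (pendantsOK tb f)
    okF = ∧S1 ok
    r1 = ∧S2 {pendantsOK tb f} ok
    okH1 : T (edgesMapOK tb a b q)
    okH1 = ∧S1 r1
    r2 = ∧S2 {edgesMapOK tb a b q} r1
    okH2 : T (edgesInjectiveOK tb a b)
    okH2 = ∧S1 r2
    r3 = ∧S2 {edgesInjectiveOK tb a b} r2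
    okH3 : T (oneTwoCollapsedOK tb a b)
    okH3 = ∧S1 r3
    okC : T (connectsOK tb q)
    okC = ∧S2 {oneTwoCollapsedOK tb a b} r3

  gadgetEnds : GEdge → HVert × HVert
  gadgetEnds (house e) = inj₂ (proj₁ (houseEnds e)) , inj₂ (proj₂ (houseEnds e))
  gadgetEnds (pendant i) = inj₂ (aOf i) , W i

  EdgeAtK : GEdge → HVert → HVert → Set
  EdgeAtK K a b = SameEdge (proj₁ (gadgetEnds K)) (proj₂ (gadgetEnds K)) a b

  liftRel-mono : {B : Adj (Fin n)} {tb tb1 : Selection} → (∀ k → T (tb k) → T (tb1 k)) → ∀ {a b} → liftRel B tb a b → liftRel B tb1 a b
  liftRel-mono m {inj₁ _} {inj₁ _} r = r
  liftRel-mono {tb = tb} {tb1} m {inj₁ (x , _)} {inj₂ j} r with pendantIndex j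
  ... | just i = proj₁ r , m (pendant i) (proj₂ r)
  liftRel-mono {tb = tb} {tb1} m {inj₂ j} {inj₁ (x , _)} r with pendantIndex j
  ... | just i = proj₁ r , m (pendant i) (proj₂ r)
  liftRel-mono {tb = tb} {tb1} m {inj₂ i} {inj₂ j} r with houseEdge i j
  ... | just e = m (house e) r

  liftRel-diff : {B : Adj (Fin n)} {tb tb1 : Selection} {K : GEdge} → (∀ k → T (tb k) → T (tb1 k) ⊎ k ≡ K) →
    ∀ {a b} → liftRel B tb a b → liftRel B tb1 a b ⊎ EdgeAtK K a b
  liftRel-diff d {inj₁ _} {inj₁ _} r = inj₁ r
  liftRel-diff {tb = tb} {tb1} d {inj₁ (x , px)} {inj₂ j} r with pendantIndex j in pe
  liftRel-diff {tb = tb} {tb1} d {inj₁ (x , px)} {inj₂ j} () | nothing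
  liftRel-diff {tb = tb} {tb1} d {inj₁ (x , px)} {inj₂ j} (ex , t) | just i with d (pendant i) t
  ... | inj₁ t1 = inj₁ (ex , t1)
  ... | inj₂ refl = inj₂ (inj₂ (injEq ex , cong inj₂ (pendantIndex-aOf⁻ j pe)))
  liftRel-diff {tb = tb} {tb1} d {inj₂ j} {inj₁ (x , px)} r with pendantIndex j in pe
  liftRel-diff {tb = tb} {tb1} d {inj₂ j} {inj₁ (x , px)} () | nothing
  liftRel-diff {tb = tb} {tb1} d {inj₂ j} {inj₁ (x , px)} (ex , t) | just i with d (pendant i) t
  ... | inj₁ t1 = inj₁ (ex , t1)
  ... | inj₂ refl = inj₂ (inj₁ (cong inj₂ (pendantIndex-aOf⁻ j pe) , injEq ex))
  liftRel-diff {tb = tb} {tb1} d {inj₂ i} {inj₂ j} r with houseEdge i j in he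
  liftRel-diff {tb = tb} {tb1} d {inj₂ i} {inj₂ j} () | nothing
  liftRel-diff {tb = tb} {tb1} d {inj₂ i} {inj₂ j} r | just e with d (house e) r
  ... | inj₁ t1 = inj₁ t1
  ... | inj₂ refl with houseEdge-ends i j he
  ...   | inj₁ (e1 , e2) = inj₂ (inj₁ (cong inj₂ e1 , cong inj₂ e2))
  ...   | inj₂ (e1 , e2) = inj₂ (inj₂ (cong inj₂ e1 , cong inj₂ e2))

  liftRel-at : {B : Adj (Fin n)} {tb : Selection} (K : GEdge) → ∀ {a b} → liftRel B tb a b → EdgeAtK K a b → T (tb K)
  liftRel-at {tb = tb} (house e) r (inj₁ (refl , refl)) = subst (HouseIn tb) (houseEdge-houseEnds e) r
  liftRel-at {tb = tb} (house e) r (inj₂ (refl , refl)) = subst (HouseIn tb) (houseEdge-houseEnds′ e) r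
  liftRel-at {tb = tb} (pendant i) r (inj₁ (refl , refl)) = proj₂ (subst (PendantIn tb (w i)) (pendantIndex-aOf i) r)
  liftRel-at {tb = tb} (pendant i) r (inj₂ (refl , refl)) = proj₂ (subst (PendantIn tb (w i)) (pendantIndex-aOf i) r)

  liftRel-edge : {B : Adj (Fin n)} {tb : Selection} (K : GEdge) → T (tb K) → liftRel B tb (proj₁ (gadgetEnds K)) (proj₂ (gadgetEnds K))
  liftRel-edge {tb = tb} (house e) t = subst (HouseIn tb) (sym (houseEdge-houseEnds e)) t
  liftRel-edge {tb = tb} (pendant i) t = subst (PendantIn tb (w i)) (sym (pendantIndex-aOf i)) (refl , t)

  gadgetEnds-distinct : (K : GEdge) → proj₁ (gadgetEnds K) ≢ proj₂ (gadgetEnds K)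
  gadgetEnds-distinct (house e) eq = houseEnds-distinct e (inj₂-injective eq)
  gadgetEnds-distinct (pendant i) ()

  allGEdges : List GEdge
  allGEdges = house h12 ∷ house h15 ∷ house h26 ∷ house h53 ∷ house h54 ∷ house h63 ∷ house h64 ∷ pendant I0 ∷ pendant I1 ∷ pendant I2 ∷ pendant I3 ∷ []

  allGEdges-complete : (k : GEdge) → k ∈ allGEdges
  allGEdges-complete (house h12) = here refl
  allGEdges-complete (house h15) = there (here refl)
  allGEdges-complete (house h26) = there (there (here refl))
  allGEdges-complete (house h53) = there (there (there (here refl)))
  allGEdges-complete (house h54) = there (there (there (there (here refl))))
  allGEdges-complete (house h63) = there (there (there (there (there (here refl)))))
  allGEdges-complete (house h64) = there (there (there (there (there (there (here refl))))))
  allGEdges-complete (pendant I0) = there (there (there (there (there (there (there (here refl)))))))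
  allGEdges-complete (pendant I1) = there (there (there (there (there (there (there (there (here refl))))))))
  allGEdges-complete (pendant I2) = there (there (there (there (there (there (there (there (there (here refl)))))))))
  allGEdges-complete (pendant I3) = there (there (there (there (there (there (there (there (there (there (here refl))))))))))

  sameGEdge : GEdge → GEdge → Bool
  sameGEdge (house e) (house f) = ⌊ e ≟ʰ f ⌋
  sameGEdge (pendant i) (pendant j) = eq4 i j
  sameGEdge _ _ = false

  sameGEdge-sound : {k K : GEdge} → T (sameGEdge k K) → k ≡ K
  sameGEdge-sound {house e} {house f} t = cong house (toWitness t)
  sameGEdge-sound {pendant i} {pendant j} t = cong pendant (eq4S t)

  imp : Bool → Bool → Bool
  imp a b = not a ∨ b

  impS : {a b : Bool} → T (imp a b) → T a → T b
  impS {true} t _ = t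

  removeT : Selection → GEdge → Selection
  removeT tb K k = tb k ∧ not (sameGEdge k K)

  exchangeOK : Selection → Selection → Selection → GEdge → GEdge → Bool
  exchangeOK tb0 tb1 tb2 K F =
    allL allGEdges (λ k → imp (tb1 k) (tb0 k)) ∧ (not (tb1 K) ∧ (allL allGEdges (λ k → imp (tb0 k) (tb1 k ∨ sameGEdge k K)) ∧
    (allL allGEdges (λ k → imp (tb1 k) (tb2 k)) ∧ (tb2 F ∧ (allL allGEdges (λ k → imp (tb2 k) (tb1 k ∨ sameGEdge k F)) ∧ tb0 K)))))

  liftH : (tb : Selection) → ∀ {i j} → Star (HouseRel tb) i j → Star (liftRel Tr tb) (inj₂ i) (inj₂ j)
  liftH tb = gmap inj₂ (λ h → h)

  -- The T-edges at a cycle vertex in S all lead into S, so T cannot join u_{i₀} ∈ S to w_{i₀}.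
  closedAtOK : (Fin 4 → Part) → (Fin 4 → Part) → (Fin 4 → Bool) → Fin 4 → Bool
  closedAtOK q f S i = imp (S i) (not (isTB (f i)) ∧ (imp (isTB (q (cycleEdgeIndex i pA))) (S (nbrIndex i pA)) ∧ imp (isTB (q (cycleEdgeIndex i pB))) (S (nbrIndex i pB))))

  closedOK : (Fin 4 → Part) → (Fin 4 → Part) → (Fin 4 → Bool) → Bool
  closedOK q f S = all4 (closedAtOK q f S)

  closed-step : (q f : Fin 4 → Part) (S : Fin 4 → Bool) → (∀ k → cyclePart k ≡ q k) → (∀ k → pendantPart k ≡ f k) → T (closedOK q f S) →
    (i : Fin 4) → T (S i) → {y : Fin n} → Tr (u i) y → Σ (Fin 4) λ j → y ≡ u j × T (S j)
  closed-step q f S eqq eqf ok i si r with impS (all4S {closedAtOK q f S} ok i) si | classT i r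
  ... | c | pW , _ , e = ⊥-elim (notS (∧S1 c) (isTB⁺ (trans (sym (eqf i)) e)))
  ... | c | pA , refl , e = nbrIndex i pA , nbrIndex-correct i pA (λ ()) ,
          impS (∧S1 (∧S2 {not (isTB (f i))} c)) (isTB⁺ (trans (sym (eqq (cycleEdgeIndex i pA))) (trans (sym (partAt-cyclePart i pA (λ ()))) e)))
  ... | c | pB , refl , e = nbrIndex i pB , nbrIndex-correct i pB (λ ()) ,
          impS (∧S2 {imp (isTB (q (cycleEdgeIndex i pA))) (S (nbrIndex i pA))} (∧S2 {not (isTB (f i))} c))
            (isTB⁺ (trans (sym (eqq (cycleEdgeIndex i pB))) (trans (sym (partAt-cyclePart i pB (λ ()))) e)))

  closed-impossible : (q f : Fin 4 → Part) (S : Fin 4 → Bool) (i0 : Fin 4) → (∀ k → cyclePart k ≡ q k) → (∀ k → pendantPart k ≡ f k) →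
    T (S i0) → T (closedOK q f S) → ⊥
  closed-impossible q f S i0 eqq eqf s0 ok with walk (connT (u i0) (w i0)) (i0 , refl , s0)
    where
    walk : ∀ {x y} → Star Tr x y → Σ (Fin 4) (λ i → x ≡ u i × T (S i)) → Σ (Fin 4) λ j → y ≡ u j × T (S j)
    walk ε h = h
    walk (r ◅ rs) (i , refl , si) = walk rs (closed-step q f S eqq eqf ok i si r)
  ... | j , e , _ = offNot (off i0) j e

  validConfiguration : (Fin 4 → Part) → (Fin 4 → Part) → Bool
  validConfiguration q f = all4 λ i → allowedTriple (q (cycleEdgeIndex i pA)) (q (cycleEdgeIndex i pB)) (f i)

  okvT : {a b c : Part} → allowedTriple a b c ≡ true → T (allowedTriple a b c)
  okvT e = subst T (sym e) tt

  configurationValid : (q f : Fin 4 → Part) → (∀ k → cyclePart k ≡ q k) → (∀ k → pendantPart k ≡ f k) → T (validConfiguration q f)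
  configurationValid q f eqq eqf = andAll
    where
    v : (i : Fin 4) → T (allowedTriple (q (cycleEdgeIndex i pA)) (q (cycleEdgeIndex i pB)) (f i))
    v i = subst T (cong₂ (λ x y → allowedTriple x y (f i))
            (trans (partAt-cyclePart i pA (λ ())) (eqq (cycleEdgeIndex i pA))) (trans (partAt-cyclePart i pB (λ ())) (eqq (cycleEdgeIndex i pB))))
            (subst (λ z → T (allowedTriple (partAt i pA) (partAt i pB) z)) (eqf i) (okvT (allowedAt i)))
    andAll : T (validConfiguration q f)
    andAll = andT (v I0) (andT (v I1) (andT (v I2) (andT (v I3) tt)))

  degreesOK : (GEdge → Part) → Bool
  degreesOK typ = all6 λ j → is0or2 (length (selectNbrs (selectC typ) (incidences j))) ∧ is0or1 (length (selectNbrs (selectM typ) (incidences j)))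

  degreesOK-sound : (typ : GEdge → Part) → T (degreesOK typ) → GadgetDegreesOK typ
  degreesOK-sound typ ok j = ∧S1 c , ∧S2 {is0or2 (length (selectNbrs (selectC typ) (incidences j)))} c
    where
    c = all6S {λ j → is0or2 (length (selectNbrs (selectC typ) (incidences j))) ∧ is0or1 (length (selectNbrs (selectM typ) (incidences j)))} ok j

  samePart-sound : {x y : Part} → T (samePart x y) → x ≡ y
  samePart-sound {inT} {inT} _ = refl
  samePart-sound {inC} {inC} _ = refl
  samePart-sound {inM} {inM} _ = refl

  pendantsAgree : (GEdge → Part) → (Fin 4 → Part) → Bool
  pendantsAgree typ f = all4 λ i → samePart (typ (pendant i)) (f i)

  assemble′ : (typ : GEdge → Part) (f : Fin 4 → Part) → (∀ k → pendantPart k ≡ f k) → T (pendantsAgree typ f) → T (degreesOK typ) →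
    SpanningTree HAdj (liftRel Tr (selectT typ)) → HasThreeDecomposition HAdj
  assemble′ typ f eqf pe lc st = assemble typ (λ i e → trans (eq i) e) (λ i e → trans (sym (eq i)) e)
    (λ i e → trans (eq i) e) (degreesOK-sound typ lc) st
    where
    eq : ∀ i → pendantPart i ≡ typ (pendant i)
    eq i = trans (eqf i) (sym (samePart-sound (all4S {λ i → samePart (typ (pendant i)) (f i)} pe i)))

  OrEq : HVert → HVert → HVert × HVert → Set
  OrEq p q k = (p ≡ proj₁ k × q ≡ proj₂ k) ⊎ (p ≡ proj₂ k × q ≡ proj₁ k)

  eeTo : {p q : HVert} {k : HVert × HVert} → OrEq p q k → ∀ {a b} → SameEdge p q a b → SameEdge (proj₁ k) (proj₂ k) a b
  eeTo (inj₁ (refl , refl)) e = e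
  eeTo (inj₂ (refl , refl)) (inj₁ (a , b)) = inj₂ (a , b)
  eeTo (inj₂ (refl , refl)) (inj₂ (a , b)) = inj₁ (a , b)

  eeFrom : {p q : HVert} {k : HVert × HVert} → OrEq p q k → ∀ {a b} → SameEdge (proj₁ k) (proj₂ k) a b → SameEdge p q a b
  eeFrom (inj₁ (refl , refl)) e = e
  eeFrom (inj₂ (refl , refl)) (inj₁ (a , b)) = inj₂ (a , b)
  eeFrom (inj₂ (refl , refl)) (inj₂ (a , b)) = inj₁ (a , b)

  orR : {R : Adj HVert} → Symmetric R → {p q : HVert} {k : HVert × HVert} → OrEq p q k → R (proj₁ k) (proj₂ k) → R p q
  orR s (inj₁ (refl , refl)) r = r
  orR s (inj₂ (refl , refl)) r = s r

  orNe : {p q : HVert} {k : HVert × HVert} → OrEq p q k → proj₁ k ≢ proj₂ k → p ≢ q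
  orNe (inj₁ (refl , refl)) ne = ne
  orNe (inj₂ (refl , refl)) ne e = ne (sym e)

  record ValidExchange (tb0 tb1 tb2 : Selection) (K F : GEdge) : Set where
    field
      had-K   : T (tb0 K)
      lost-K  : ¬ T (tb1 K)
      shrink  : ∀ k → T (tb1 k) → T (tb0 k)
      only-K  : ∀ k → T (tb0 k) → T (tb1 k) ⊎ k ≡ K
      grow    : ∀ k → T (tb1 k) → T (tb2 k)
      has-F   : T (tb2 F)
      only-F  : ∀ k → T (tb2 k) → T (tb1 k) ⊎ k ≡ F

  exchangeOK-sound : {tb0 tb1 tb2 : Selection} {K F : GEdge} → T (exchangeOK tb0 tb1 tb2 K F) →
    ValidExchange tb0 tb1 tb2 K F
  exchangeOK-sound {tb0} {tb1} {tb2} {K} {F} ok = record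
    { had-K = c7 ; lost-K = notS c2
    ; shrink = λ k → impS (allLS allGEdges {λ k → imp (tb1 k) (tb0 k)} c1 (allGEdges-complete k))
    ; only-K = λ k t → orr (impS (allLS allGEdges {λ k → imp (tb0 k) (tb1 k ∨ sameGEdge k K)} c3 (allGEdges-complete k)) t)
    ; grow = λ k → impS (allLS allGEdges {λ k → imp (tb1 k) (tb2 k)} c4 (allGEdges-complete k))
    ; has-F = c5
    ; only-F = λ k t → orr (impS (allLS allGEdges {λ k → imp (tb2 k) (tb1 k ∨ sameGEdge k F)} c6 (allGEdges-complete k)) t)
    }
    where
    c1 = ∧S1 ok
    r1 = ∧S2 {allL allGEdges (λ k → imp (tb1 k) (tb0 k))} ok
    c2 = ∧S1 r1
    r2 = ∧S2 {not (tb1 K)} r1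
    c3 = ∧S1 r2
    r3 = ∧S2 {allL allGEdges (λ k → imp (tb0 k) (tb1 k ∨ sameGEdge k K))} r2
    c4 = ∧S1 r3
    r4 = ∧S2 {allL allGEdges (λ k → imp (tb1 k) (tb2 k))} r3
    c5 = ∧S1 r4
    r5 = ∧S2 {tb2 F} r4
    c6 = ∧S1 r5
    c7 = ∧S2 {allL allGEdges (λ k → imp (tb2 k) (tb1 k ∨ sameGEdge k F))} r5
    orr : {a : Bool} {k L : GEdge} → T (a ∨ sameGEdge k L) → T a ⊎ k ≡ L
    orr {a} t with ∨S {a} t
    ... | inj₁ z = inj₁ z
    ... | inj₂ z = inj₂ (sameGEdge-sound z)

  exchangeGadgetEdges : (tb0 tb1 tb2 : Selection) (K F : GEdge) (p q x y : HVert) → OrEq p q (gadgetEnds K) → OrEq x y (gadgetEnds F) →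
    T (exchangeOK tb0 tb1 tb2 K F) → Star (liftRel Tr tb1) x p → Star (liftRel Tr tb1) y q →
    SpanningTree HAdj (liftRel Tr tb0) → SpanningTree HAdj (liftRel Tr tb2)
  exchangeGadgetEdges tb0 tb1 tb2 K F p q x y KE FE ok px py (_ , c0 , a0) =
    ((λ {a} {b} r → liftRel-sub {B = Tr} {tb = tb2} (proj₁ subT) {a} {b} r) , (λ {a} {b} r → s2 {a} {b} r)) ,
    Exchange.connected c0 , Exchange.acyclic a0
    where
    open ValidExchange (exchangeOK-sound {tb0} {tb1} {tb2} {K} {F} ok)
    s0 : Symmetric (liftRel Tr tb0)
    s0 {a} {b} r = liftRel-sym {B = Tr} {tb = tb0} symT {a} {b} r
    s1 : Symmetric (liftRel Tr tb1)
    s1 {a} {b} r = liftRel-sym {B = Tr} {tb = tb1} symT {a} {b} r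
    s2 : Symmetric (liftRel Tr tb2)
    s2 {a} {b} r = liftRel-sym {B = Tr} {tb = tb2} symT {a} {b} r
    eitherD : ∀ {a b} → liftRel Tr tb0 a b → liftRel Tr tb1 a b ⊎ SameEdge p q a b
    eitherD {a} {b} r with liftRel-diff {B = Tr} {tb = tb0} {tb1 = tb1} {K = K} only-K {a} {b} r
    ... | inj₁ z = inj₁ z
    ... | inj₂ z = inj₂ (eeFrom KE z)
    eitherF : ∀ {a b} → liftRel Tr tb2 a b → liftRel Tr tb1 a b ⊎ SameEdge x y a b
    eitherF {a} {b} r with liftRel-diff {B = Tr} {tb = tb2} {tb1 = tb1} {K = F} only-F {a} {b} r
    ... | inj₁ z = inj₁ z
    ... | inj₂ z = inj₂ (eeFrom FE z)
    module Exchange = EdgeExchange decHV {R0 = liftRel Tr tb0} {R1 = liftRel Tr tb1} {R2 = liftRel Tr tb2}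
      (λ {a} {b} → s1 {a} {b}) (λ {a} {b} → s2 {a} {b}) {p = p} {q = q} {x = x} {y = y}
      (λ {a} {b} r → liftRel-mono {B = Tr} {tb = tb1} {tb1 = tb0} shrink {a} {b} r)
      (λ {a} {b} r e → lost-K (liftRel-at {B = Tr} {tb = tb1} K {a} {b} r (eeTo KE e)))
      (λ {a} {b} r → eitherD {a} {b} r)
      (λ {a} {b} r → liftRel-mono {B = Tr} {tb = tb1} {tb1 = tb2} grow {a} {b} r)
      (orR (λ {a} {b} → s2 {a} {b}) FE (liftRel-edge {B = Tr} {tb = tb2} F has-F))
      (λ {a} {b} r → eitherF {a} {b} r)
      (orR (λ {a} {b} → s0 {a} {b}) KE (liftRel-edge {B = Tr} {tb = tb0} K had-K))
      (orNe KE (gadgetEnds-distinct K)) px py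

  outDec : (x : Fin n) → Dec (Out x)
  outDec x = T? (notCyc u1 u2 u3 u4 x)

  mapOut : (tb : Selection) {R : Adj (Fin n)} → (∀ {a b} → R a b → Tr a b) → ∀ {x y} (px : Out x) (py : Out y) →
    Star (Restrict R Out) x y → Star (liftRel Tr tb) (inj₁ (x , px)) (inj₁ (y , py))
  mapOut tb sub px py ε = subst (Star (liftRel Tr tb) (inj₁ (_ , px))) (injEq refl) ε
  mapOut tb sub px py ((r , ox , oz) ◅ rs) = sub r ◅ mapOut tb sub oz py rs

  exitGadget : {R : Adj (Fin n)} → (∀ {a b} → R a b → Tr a b) → {x y : Fin n} → Out x → ¬ Out y → Star R x y →
    Σ (Fin 4) λ k → R (w k) (u k) × Star (Restrict R Out) x (w k)
  exitGadget {R} sub ox ny path with firstExit Out outDec ox ny path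
  ... | a , b , rab , oa , nb , p with locate b
  ...   | outside ob = ⊥-elim (nb ob)
  ...   | onCycle k refl with outNbr oa k (symE (proj₁ subT (sub rab)))
  ...     | refl = k , rab , p

  restrictSym : {R : Adj (Fin n)} {S : Fin n → Set} → Symmetric R → Symmetric (Restrict R S)
  restrictSym s (r , a , b) = s r , b , a

  pstep : (tb : Selection) (i : Fin 4) → T (tb (pendant i)) → liftRel Tr tb (inj₂ (aOf i)) (W i)
  pstep tb i t = subst (PendantIn tb (w i)) (sym (pendantIndex-aOf i)) (refl , t)

  pstepR : (tb : Selection) (i : Fin 4) → T (tb (pendant i)) → liftRel Tr tb (W i) (inj₂ (aOf i))
  pstepR tb i t = subst (PendantIn tb (w i)) (sym (pendantIndex-aOf i)) (refl , t)

  quad : Part → Part → Part → Part → Fin 4 → Part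
  quad a b c d I0 = a
  quad a b c d I1 = b
  quad a b c d I2 = c
  quad a b c d I3 = d

  typing : Part → Part → Part → Part → Part → Part → Part → Part → Part → Part → Part → GEdge → Part
  typing t1 t2 t3 t4 t5 t6 t7 g0 g1 g2 g3 (house h12) = t1
  typing t1 t2 t3 t4 t5 t6 t7 g0 g1 g2 g3 (house h15) = t2
  typing t1 t2 t3 t4 t5 t6 t7 g0 g1 g2 g3 (house h26) = t3
  typing t1 t2 t3 t4 t5 t6 t7 g0 g1 g2 g3 (house h53) = t4
  typing t1 t2 t3 t4 t5 t6 t7 g0 g1 g2 g3 (house h54) = t5
  typing t1 t2 t3 t4 t5 t6 t7 g0 g1 g2 g3 (house h63) = t6
  typing t1 t2 t3 t4 t5 t6 t7 g0 g1 g2 g3 (house h64) = t7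
  typing t1 t2 t3 t4 t5 t6 t7 g0 g1 g2 g3 (pendant I0) = g0
  typing t1 t2 t3 t4 t5 t6 t7 g0 g1 g2 g3 (pendant I1) = g1
  typing t1 t2 t3 t4 t5 t6 t7 g0 g1 g2 g3 (pendant I2) = g2
  typing t1 t2 t3 t4 t5 t6 t7 g0 g1 g2 g3 (pendant I3) = g3

  selection : Bool → Bool → Bool → Bool → Bool → Bool → Bool → Bool → Bool → Bool → Bool → Selection
  selection t1 t2 t3 t4 t5 t6 t7 g0 g1 g2 g3 (house h12) = t1
  selection t1 t2 t3 t4 t5 t6 t7 g0 g1 g2 g3 (house h15) = t2
  selection t1 t2 t3 t4 t5 t6 t7 g0 g1 g2 g3 (house h26) = t3
  selection t1 t2 t3 t4 t5 t6 t7 g0 g1 g2 g3 (house h53) = t4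
  selection t1 t2 t3 t4 t5 t6 t7 g0 g1 g2 g3 (house h54) = t5
  selection t1 t2 t3 t4 t5 t6 t7 g0 g1 g2 g3 (house h63) = t6
  selection t1 t2 t3 t4 t5 t6 t7 g0 g1 g2 g3 (house h64) = t7
  selection t1 t2 t3 t4 t5 t6 t7 g0 g1 g2 g3 (pendant I0) = g0
  selection t1 t2 t3 t4 t5 t6 t7 g0 g1 g2 g3 (pendant I1) = g1
  selection t1 t2 t3 t4 t5 t6 t7 g0 g1 g2 g3 (pendant I2) = g2
  selection t1 t2 t3 t4 t5 t6 t7 g0 g1 g2 g3 (pendant I3) = g3

  Av : Fin 4 → Fin 4 → Fin n → Set
  Av i j x = x ≢ u i × x ≢ u j

  avDec : (i j : Fin 4) (x : Fin n) → Dec (Av i j x)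
  avDec i j x with x ≟ u i | x ≟ u j
  ... | yes e | _ = no (λ z → proj₁ z e)
  ... | no _ | yes e = no (λ z → proj₂ z e)
  ... | no n1 | no n2 = yes (n1 , n2)

  avNot : (i j : Fin 4) {x : Fin n} → ¬ Av i j x → x ≡ u i ⊎ x ≡ u j
  avNot i j {x} na with x ≟ u i | x ≟ u j
  ... | yes e | _ = inj₁ e
  ... | no _ | yes e = inj₂ e
  ... | no n1 | no n2 = ⊥-elim (na (n1 , n2))

  samePart-refl : {x y : Part} → x ≡ y → samePart x y ≡ false → ⊥
  samePart-refl {inT} refl ()
  samePart-refl {inC} refl ()
  samePart-refl {inM} refl ()

  configPart : (q f : Fin 4 → Part) → Fin 4 → Pos → Part
  configPart q f i pW = f i
  configPart q f i pA = q (cycleEdgeIndex i pA)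
  configPart q f i pB = q (cycleEdgeIndex i pB)

  configPart-≡ : (q f : Fin 4 → Part) (eqq : ∀ k → cyclePart k ≡ q k) (eqf : ∀ k → pendantPart k ≡ f k) (i : Fin 4) (p : Pos) →
    partAt i p ≡ configPart q f i p
  configPart-≡ q f eqq eqf i pW = eqf i
  configPart-≡ q f eqq eqf i pA = trans (partAt-cyclePart i pA (λ ())) (eqq (cycleEdgeIndex i pA))
  configPart-≡ q f eqq eqf i pB = trans (partAt-cyclePart i pB (λ ())) (eqq (cycleEdgeIndex i pB))

  exitPair : (s1 s2 : Fin 4) {x : Fin n} → Av s1 s2 x → Star Tr x (u s1) →
    Σ (Fin 4) λ s → (s ≡ s1 ⊎ s ≡ s2) × Σ Pos λ p → partAt s p ≡ inT × Av s1 s2 (nbr s p) ×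
      Star (Restrict Tr (Av s1 s2)) x (nbr s p)
  exitPair s1 s2 ax path with firstExit (Av s1 s2) (avDec s1 s2) ax (λ z → proj₁ z refl) path
  ... | a , b , rab , aa , nb1 , p with avNot s1 s2 nb1
  ...   | inj₁ refl with classT s1 (symT rab)
  ...     | q , refl , e = s1 , inj₁ refl , q , e , aa , p
  exitPair s1 s2 ax path | a , b , rab , aa , nb1 , p | inj₂ refl with classT s2 (symT rab)
  ...     | q , refl , e = s2 , inj₂ refl , q , e , aa , p

  exitToOutside : (s1 s2 : Fin 4) {x : Fin n} → Out x → (i0 : Fin 4) → Star (Restrict Tr (Av s1 s2)) x (u i0) →
    Σ (Fin 4) λ k → Tr (w k) (u k) × Av s1 s2 (u k) × Star (Restrict (Restrict Tr (Av s1 s2)) Out) x (w k)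
  exitToOutside s1 s2 ox i0 path with exitGadget {R = Restrict Tr (Av s1 s2)} proj₁ ox (λ o → outNot o i0 refl) path
  ... | k , (r , _ , ak) , p = k , r , ak , p

  -- The three special configurations

  sR1 : (tb : Selection) → Symmetric (liftRel Tr tb)
  sR1 tb {a} {b} r = liftRel-sym {B = Tr} {tb = tb} symT {a} {b} r

  hop : (tb : Selection) (a b : HVert) {c : HVert} → liftRel Tr tb a b → Star (liftRel Tr tb) b c → Star (liftRel Tr tb) a c
  hop tb a b r rest = r ◅ rest

  revP : (tb : Selection) {a b : HVert} → Star (liftRel Tr tb) a b → Star (liftRel Tr tb) b a
  revP tb = Star.reverse (λ {a} {b} → sR1 tb {a} {b})

  qC fC : Fin 4 → Part
  qC = quad inM inT inC inT
  fC = quad inT inT inC inC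

  tbC0 tbC1 : Selection
  tbC0 = selection false true true true false false true true true false false
  tbC1 = selection false true true true false false false true true false false

  typC : GEdge → Part
  typC = typing inM inT inT inT inT inC inC inT inT inC inC

  specialC : (∀ k → cyclePart k ≡ qC k) → (∀ k → pendantPart k ≡ fC k) → HasThreeDecomposition HAdj
  specialC eqq eqf = assemble′ typC fC eqf tt tt st2
    where
    st0 : SpanningTree HAdj (liftRel Tr tbC0)
    st0 = contractedTree tbC0 I0 I1 qC fC eqq eqf tt
    bad : {x : Part} {i : Fin 4} {p : Pos} → partAt i p ≡ inT → configPart qC fC i p ≡ x → samePart x inT ≡ false → ⊥
    bad {i = i} {p} e e2 ne = samePart-refl (trans (sym e2) (trans (sym (configPart-≡ qC fC eqq eqf i p)) e)) ne
    w2path : Star (Restrict Tr (Av I1 I3)) (u I0) (w I1)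
    w2path with exitPair I1 I3 {u I0} ((λ e → d12 e) , (λ e → d14 e)) (connT (u I0) (u I1))
    ... | .I1 , inj₁ refl , pA , e , av , p = ⊥-elim (bad {i = I1} {p = pA} e refl refl)
    ... | .I1 , inj₁ refl , pB , e , av , p = ⊥-elim (proj₂ av refl)
    ... | .I1 , inj₁ refl , pW , e , av , p = p
    ... | .I3 , inj₂ refl , pA , e , av , p = ⊥-elim (proj₁ av refl)
    ... | .I3 , inj₂ refl , pB , e , av , p = ⊥-elim (bad {i = I3} {p = pB} e refl refl)
    ... | .I3 , inj₂ refl , pW , e , av , p = ⊥-elim (bad {i = I3} {p = pW} e refl refl)
    outP : Star (Restrict (Restrict Tr (Av I1 I3)) Out) (w I1) (w I0)
    outP with exitToOutside I1 I3 (wOut I1) I0 (Star.reverse (λ {a} {b} → restrictSym {R = Tr} {S = Av I1 I3} symT {a} {b}) w2path)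
    ... | I0 , r , av , p = p
    ... | I1 , r , av , p = ⊥-elim (proj₁ av refl)
    ... | I2 , r , av , p = ⊥-elim (bad {i = I2} {p = pW} (pendantPart-T I2 (symT r)) refl refl)
    ... | I3 , r , av , p = ⊥-elim (proj₂ av refl)
    outH : Star (liftRel Tr tbC1) (W I1) (W I0)
    outH = mapOut tbC1 {R = Restrict Tr (Av I1 I3)} proj₁ (wOut I1) (wOut I0) outP
    pathX : Star (liftRel Tr tbC1) (inj₂ A5) (inj₂ A6)
    pathX = hop tbC1 (inj₂ A5) (inj₂ A1) tt (hop tbC1 (inj₂ A1) (W I0) (pstep tbC1 I0 tt)
              (revP tbC1 outH ◅◅ hop tbC1 (W I1) (inj₂ A2) (pstepR tbC1 I1 tt) (hop tbC1 (inj₂ A2) (inj₂ A6) tt ε)))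
    st2 : SpanningTree HAdj (liftRel Tr (selectT typC))
    st2 = exchangeGadgetEdges tbC0 tbC1 (selectT typC) (house h64) (house h54) (inj₂ A6) (inj₂ A4) (inj₂ A5) (inj₂ A4)
            (inj₁ (refl , refl)) (inj₁ (refl , refl)) tt pathX ε st0

  qA fA : Fin 4 → Part
  qA = quad inT inM inT inM
  fA = quad inT inT inT inT

  typAD typBC : GEdge → Part
  typAD = typing inM inT inT inM inT inT inM inT inT inT inT
  typBC = typing inM inT inT inT inM inM inT inT inT inT inT

  tA0 tA1 tA2 tA3 tA3b tA2c tA3c tA2d tA3d : Selection
  tA0 = selection true true false false false true true true true true true
  tA1 = selection false true false false false true true true true true true
  tA2 = selection false true true false false true true true true true true
  tA3 = selection false true true false false true false true true true true
  tA3b = selection false true true false false false true true true true true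
  tA2c = selection false true false true false true true true true true true
  tA3c = selection false true false true false false true true true true true
  tA2d = selection false true false false true true true true true true true
  tA3d = selection false true false false true true false true true true true

  specialA-exit : (∀ k → cyclePart k ≡ qA k) → (∀ k → pendantPart k ≡ fA k) →
    Σ (Fin 4) λ j → Σ (Fin 4) λ k → (j ≡ I2 ⊎ j ≡ I3) × (k ≡ I0 ⊎ k ≡ I1) ×
      ((tb : Selection) → Star (liftRel Tr tb) (W j) (W k))
  specialA-exit eqq eqf = j , proj₁ ext2 , proj₁ (proj₂ ext1) , proj₁ (proj₂ ext2) , outH
    where
    bad : {x : Part} {i : Fin 4} {p : Pos} → partAt i p ≡ inT → configPart qA fA i p ≡ x → samePart x inT ≡ false → ⊥
    bad {i = i} {p} e e2 ne = samePart-refl (trans (sym e2) (trans (sym (configPart-≡ qA fA eqq eqf i p)) e)) ne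
    ext1 : Σ (Fin 4) λ j → (j ≡ I2 ⊎ j ≡ I3) × Star (Restrict Tr (Av I2 I3)) (u I0) (w j)
    ext1 with exitPair I2 I3 {u I0} ((λ e → d13 e) , (λ e → d14 e)) (connT (u I0) (u I2))
    ... | .I2 , inj₁ refl , pA , e , av , p = ⊥-elim (proj₂ av refl)
    ... | .I2 , inj₁ refl , pB , e , av , p = ⊥-elim (bad {i = I2} {p = pB} e refl refl)
    ... | .I2 , inj₁ refl , pW , e , av , p = I2 , inj₁ refl , p
    ... | .I3 , inj₂ refl , pA , e , av , p = ⊥-elim (bad {i = I3} {p = pA} e refl refl)
    ... | .I3 , inj₂ refl , pB , e , av , p = ⊥-elim (proj₁ av refl)
    ... | .I3 , inj₂ refl , pW , e , av , p = I3 , inj₂ refl , p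
    j = proj₁ ext1
    ext2 : Σ (Fin 4) λ k → (k ≡ I0 ⊎ k ≡ I1) × Star (Restrict (Restrict Tr (Av I2 I3)) Out) (w j) (w k)
    ext2 with exitToOutside I2 I3 (wOut j) I0 (Star.reverse (λ {a} {b} → restrictSym {R = Tr} {S = Av I2 I3} symT {a} {b}) (proj₂ (proj₂ ext1)))
    ... | I0 , r , av , p = I0 , inj₁ refl , p
    ... | I1 , r , av , p = I1 , inj₂ refl , p
    ... | I2 , r , av , p = ⊥-elim (proj₁ av refl)
    ... | I3 , r , av , p = ⊥-elim (proj₂ av refl)
    outH : (tb : Selection) → Star (liftRel Tr tb) (W j) (W (proj₁ ext2))
    outH tb = mapOut tb {R = Restrict Tr (Av I2 I3)} proj₁ (wOut j) (wOut (proj₁ ext2)) (proj₂ (proj₂ ext2))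

  specialA-exchange : (∀ k → pendantPart k ≡ fA k) → SpanningTree HAdj (liftRel Tr tA0) →
    (Σ (Fin 4) λ j → Σ (Fin 4) λ k → (j ≡ I2 ⊎ j ≡ I3) × (k ≡ I0 ⊎ k ≡ I1) ×
      ((tb : Selection) → Star (liftRel Tr tb) (W j) (W k))) →
    HasThreeDecomposition HAdj
  specialA-exchange eqf st0 (.I2 , .I0 , inj₁ refl , inj₁ refl , o) = assemble′ typAD fA eqf tt tt st4
    where
    st2 : SpanningTree HAdj (liftRel Tr tA2)
    st2 = exchangeGadgetEdges tA0 tA1 tA2 (house h12) (house h26) (inj₂ A1) (inj₂ A2) (inj₂ A6) (inj₂ A2)
            (inj₁ (refl , refl)) (inj₂ (refl , refl)) tt
            (hop tA1 (inj₂ A6) (inj₂ A3) tt (hop tA1 (inj₂ A3) (W I2) (pstep tA1 I2 tt)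
               (o tA1 ◅◅ hop tA1 (W I0) (inj₂ A1) (pstepR tA1 I0 tt) ε))) ε st0
    st4 : SpanningTree HAdj (liftRel Tr (selectT typAD))
    st4 = exchangeGadgetEdges tA2 tA3 (selectT typAD) (house h64) (house h54) (inj₂ A6) (inj₂ A4) (inj₂ A5) (inj₂ A4)
            (inj₁ (refl , refl)) (inj₁ (refl , refl)) tt
            (hop tA3 (inj₂ A5) (inj₂ A1) tt (hop tA3 (inj₂ A1) (W I0) (pstep tA3 I0 tt)
               (revP tA3 (o tA3) ◅◅ hop tA3 (W I2) (inj₂ A3) (pstepR tA3 I2 tt) (hop tA3 (inj₂ A3) (inj₂ A6) tt ε)))) ε st2
  specialA-exchange eqf st0 (.I3 , .I0 , inj₂ refl , inj₁ refl , o) = assemble′ typBC fA eqf tt tt st4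
    where
    st2 : SpanningTree HAdj (liftRel Tr tA2)
    st2 = exchangeGadgetEdges tA0 tA1 tA2 (house h12) (house h26) (inj₂ A1) (inj₂ A2) (inj₂ A6) (inj₂ A2)
            (inj₁ (refl , refl)) (inj₂ (refl , refl)) tt
            (hop tA1 (inj₂ A6) (inj₂ A4) tt (hop tA1 (inj₂ A4) (W I3) (pstep tA1 I3 tt)
               (o tA1 ◅◅ hop tA1 (W I0) (inj₂ A1) (pstepR tA1 I0 tt) ε))) ε st0
    st4 : SpanningTree HAdj (liftRel Tr (selectT typBC))
    st4 = exchangeGadgetEdges tA2 tA3b (selectT typBC) (house h63) (house h53) (inj₂ A6) (inj₂ A3) (inj₂ A5) (inj₂ A3)
            (inj₁ (refl , refl)) (inj₁ (refl , refl)) tt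
            (hop tA3b (inj₂ A5) (inj₂ A1) tt (hop tA3b (inj₂ A1) (W I0) (pstep tA3b I0 tt)
               (revP tA3b (o tA3b) ◅◅ hop tA3b (W I3) (inj₂ A4) (pstepR tA3b I3 tt) (hop tA3b (inj₂ A4) (inj₂ A6) tt ε)))) ε st2
  specialA-exchange eqf st0 (.I2 , .I1 , inj₁ refl , inj₂ refl , o) = assemble′ typBC fA eqf tt tt st4
    where
    st2 : SpanningTree HAdj (liftRel Tr tA2c)
    st2 = exchangeGadgetEdges tA0 tA1 tA2c (house h12) (house h53) (inj₂ A1) (inj₂ A2) (inj₂ A5) (inj₂ A3)
            (inj₁ (refl , refl)) (inj₁ (refl , refl)) tt
            (hop tA1 (inj₂ A5) (inj₂ A1) tt ε)
            (hop tA1 (inj₂ A3) (W I2) (pstep tA1 I2 tt) (o tA1 ◅◅ hop tA1 (W I1) (inj₂ A2) (pstepR tA1 I1 tt) ε)) st0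
    st4 : SpanningTree HAdj (liftRel Tr (selectT typBC))
    st4 = exchangeGadgetEdges tA2c tA3c (selectT typBC) (house h63) (house h26) (inj₂ A6) (inj₂ A3) (inj₂ A6) (inj₂ A2)
            (inj₁ (refl , refl)) (inj₂ (refl , refl)) tt ε
            (hop tA3c (inj₂ A2) (W I1) (pstep tA3c I1 tt) (revP tA3c (o tA3c) ◅◅ hop tA3c (W I2) (inj₂ A3) (pstepR tA3c I2 tt) ε)) st2
  specialA-exchange eqf st0 (.I3 , .I1 , inj₂ refl , inj₂ refl , o) = assemble′ typAD fA eqf tt tt st4
    where
    st2 : SpanningTree HAdj (liftRel Tr tA2d)
    st2 = exchangeGadgetEdges tA0 tA1 tA2d (house h12) (house h54) (inj₂ A1) (inj₂ A2) (inj₂ A5) (inj₂ A4)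
            (inj₁ (refl , refl)) (inj₁ (refl , refl)) tt
            (hop tA1 (inj₂ A5) (inj₂ A1) tt ε)
            (hop tA1 (inj₂ A4) (W I3) (pstep tA1 I3 tt) (o tA1 ◅◅ hop tA1 (W I1) (inj₂ A2) (pstepR tA1 I1 tt) ε)) st0
    st4 : SpanningTree HAdj (liftRel Tr (selectT typAD))
    st4 = exchangeGadgetEdges tA2d tA3d (selectT typAD) (house h64) (house h26) (inj₂ A6) (inj₂ A4) (inj₂ A6) (inj₂ A2)
            (inj₁ (refl , refl)) (inj₂ (refl , refl)) tt ε
            (hop tA3d (inj₂ A2) (W I1) (pstep tA3d I1 tt) (revP tA3d (o tA3d) ◅◅ hop tA3d (W I3) (inj₂ A4) (pstepR tA3d I3 tt) ε)) st2

  specialA : (∀ k → cyclePart k ≡ qA k) → (∀ k → pendantPart k ≡ fA k) → HasThreeDecomposition HAdj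
  specialA eqq eqf = specialA-exchange eqf (contractedTree tA0 I0 I2 qA fA eqq eqf tt) (specialA-exit eqq eqf)

  qB fB : Fin 4 → Part
  qB = quad inM inT inT inT
  fB = quad inT inT inM inM

  typB : GEdge → Part
  typB = typing inT inT inT inC inC inC inC inT inT inT inT

  tB0 tB1 tB2 tB3 tB4 tB5 : Selection
  tB0 = selection false true true true false true true true true false false
  tB1 = selection false true true false false true true true true false false
  tB2 = selection true true true false false true true true true false false
  tB3 = selection true true true false false false true true true false false
  tB4 = selection true true true false false false true true true true false
  tB5 = selection true true true false false false false true true true false

  specialB : (∀ k → cyclePart k ≡ qB k) → (∀ k → pendantPart k ≡ fB k) → HasThreeDecomposition HAdj
  specialB eqq eqf = assemble typB cC1 cC2 cM (degreesOK-sound typB tt) st6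
    where
    cC1 : ∀ i → typB (pendant i) ≡ inC → pendantPart i ≡ inC
    cC1 I0 ()
    cC1 I1 ()
    cC1 I2 ()
    cC1 I3 ()
    cC2 : ∀ i → pendantPart i ≡ inC → typB (pendant i) ≡ inC
    cC2 I0 e = ⊥-elim (samePart-refl (trans (sym (eqf I0)) e) refl)
    cC2 I1 e = ⊥-elim (samePart-refl (trans (sym (eqf I1)) e) refl)
    cC2 I2 e = ⊥-elim (samePart-refl (trans (sym (eqf I2)) e) refl)
    cC2 I3 e = ⊥-elim (samePart-refl (trans (sym (eqf I3)) e) refl)
    cM : ∀ i → typB (pendant i) ≡ inM → pendantPart i ≡ inM
    cM I0 ()
    cM I1 ()
    cM I2 ()
    cM I3 ()
    st0 : SpanningTree HAdj (liftRel Tr tB0)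
    st0 = contractedTree tB0 I0 I3 qB fB eqq eqf tt
    ext : (i : Fin 4) → Σ (Fin 4) λ k → (k ≡ I0 ⊎ k ≡ I1) × Star (Restrict Tr Out) (w i) (w k)
    ext i with exitGadget {R = Tr} (λ r → r) (wOut i) (λ o → outNot o I0 refl) (connT (w i) (u I0))
    ... | I0 , r , p = I0 , inj₁ refl , p
    ... | I1 , r , p = I1 , inj₂ refl , p
    ... | I2 , r , p = ⊥-elim (samePart-refl (trans (sym (eqf I2)) (pendantPart-T I2 (symT r))) refl)
    ... | I3 , r , p = ⊥-elim (samePart-refl (trans (sym (eqf I3)) (pendantPart-T I3 (symT r))) refl)
    toA6 : (tb : Selection) (c : Fin 4) → (c ≡ I0 ⊎ c ≡ I1) → T (tb (house h26)) → T (tb (house h12)) →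
      T (tb (pendant I0)) → T (tb (pendant I1)) → Star (liftRel Tr tb) (W c) (inj₂ A6)
    toA6 tb .I0 (inj₁ refl) t26 t12 p0 p1 =
      hop tb (W I0) (inj₂ A1) (pstepR tb I0 p0) (hop tb (inj₂ A1) (inj₂ A2) t12 (hop tb (inj₂ A2) (inj₂ A6) t26 ε))
    toA6 tb .I1 (inj₂ refl) t26 t12 p0 p1 =
      hop tb (W I1) (inj₂ A2) (pstepR tb I1 p1) (hop tb (inj₂ A2) (inj₂ A6) t26 ε)
    outB : (tb : Selection) (i : Fin 4) → Star (liftRel Tr tb) (W i) (W (proj₁ (ext i)))
    outB tb i = mapOut tb {R = Tr} (λ r → r) (wOut i) (wOut (proj₁ (ext i))) (proj₂ (proj₂ (ext i)))
    st2 : SpanningTree HAdj (liftRel Tr tB2)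
    st2 = exchangeGadgetEdges tB0 tB1 tB2 (house h53) (house h12) (inj₂ A3) (inj₂ A5) (inj₂ A2) (inj₂ A1)
            (inj₂ (refl , refl)) (inj₂ (refl , refl)) tt
            (hop tB1 (inj₂ A2) (inj₂ A6) tt (hop tB1 (inj₂ A6) (inj₂ A3) tt ε))
            (hop tB1 (inj₂ A1) (inj₂ A5) tt ε) st0
    st4 : SpanningTree HAdj (liftRel Tr tB4)
    st4 = exchangeGadgetEdges tB2 tB3 tB4 (house h63) (pendant I2) (inj₂ A3) (inj₂ A6) (inj₂ A3) (W I2)
            (inj₂ (refl , refl)) (inj₁ (refl , refl)) tt ε
            (outB tB3 I2 ◅◅ toA6 tB3 (proj₁ (ext I2)) (proj₁ (proj₂ (ext I2))) tt tt tt tt) st2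
    st6 : SpanningTree HAdj (liftRel Tr (selectT typB))
    st6 = exchangeGadgetEdges tB4 tB5 (selectT typB) (house h64) (pendant I3) (inj₂ A4) (inj₂ A6) (inj₂ A4) (W I3)
            (inj₂ (refl , refl)) (inj₁ (refl , refl)) tt ε
            (outB tB5 I3 ◅◅ toA6 tB5 (proj₁ (ext I3)) (proj₁ (proj₂ (ext I3))) tt tt tt tt) st4

  -- The case distinction

  -- contractSwap: a contracted tree followed by the exchange of a₅a₃ for a₆a₃.
  data Plan : Set where
    contract : (GEdge → Part) → Fin 4 → Fin 4 → Plan
    contractSwap : Selection → Fin 4 → Fin 4 → (GEdge → Part) → Plan
    trapped : (Fin 4 → Bool) → Fin 4 → Plan
    special : SIdx → Plan
    cycleInT : Plan
    invalid : Plan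

  quadB : Bool → Bool → Bool → Bool → Fin 4 → Bool
  quadB a b c d I0 = a
  quadB a b c d I1 = b
  quadB a b c d I2 = c
  quadB a b c d I3 = d

  -- The parts of u₁u₂, u₂u₄, u₄u₃, u₃u₁ and of u₁w₁, …, u₄w₄; a typing lists the parts of
  -- a₁a₂, a₁a₅, a₂a₆, a₅a₃, a₅a₄, a₆a₃, a₆a₄ and of a₁w₁, …, a₄w₄.
  plan : Part → Part → Part → Part → Part → Part → Part → Part → Plan
  plan inT inT inT inC inC inT inC inT = contract (typing inT inC inT inC inT inT inT inC inT inC inT) I3 I3
  plan inT inT inT inC inC inT inC inM = contract (typing inT inC inT inC inT inT inT inC inT inC inM) I3 I3
  plan inT inT inT inC inC inM inC inT = contract (typing inT inC inT inC inT inT inT inC inM inC inT) I3 I3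
  plan inT inT inT inC inC inM inC inM = contract (typing inT inC inT inC inT inT inT inC inM inC inM) I3 I3
  plan inT inT inT inM inT inT inT inT = contract (typing inT inM inT inT inT inM inT inT inT inT inT) I2 I1
  plan inT inT inT inM inT inT inT inM = contract (typing inT inM inT inT inT inM inT inT inT inT inM) I2 I1
  plan inT inT inT inM inT inM inT inT = contract (typing inT inM inT inT inT inM inT inT inM inT inT) I2 I1
  plan inT inT inT inM inT inM inT inM = contract (typing inT inM inT inT inT inM inT inT inM inT inM) I2 I1
  plan inT inT inC inT inT inT inC inC = contractSwap (selection true true true true false false true true true false false) I0 I1 (typing inT inT inT inC inC inT inT inT inT inC inC)
  plan inT inT inC inT inT inM inC inC = contractSwap (selection true true true true false false true true false false false) I0 I1 (typing inT inT inT inC inC inT inT inT inM inC inC)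
  plan inT inT inC inT inM inT inC inC = contractSwap (selection true true true true false false true false true false false) I0 I1 (typing inT inT inT inC inC inT inT inM inT inC inC)
  plan inT inT inC inT inM inM inC inC = contractSwap (selection true true true true false false true false false false false) I0 I1 (typing inT inT inT inC inC inT inT inM inM inC inC)
  plan inT inT inC inC inC inT inT inC = contract (typing inT inC inT inT inC inM inT inC inT inT inC) I2 I1
  plan inT inT inC inC inC inM inT inC = contract (typing inT inC inT inT inC inM inT inC inM inT inC) I2 I1
  plan inT inT inM inT inT inT inT inT = contract (typing inT inT inT inT inM inM inT inT inT inT inT) I0 I1
  plan inT inT inM inT inT inM inT inT = contract (typing inT inT inT inT inM inM inT inT inM inT inT) I0 I1
  plan inT inT inM inT inM inT inT inT = contract (typing inT inT inT inT inM inM inT inM inT inT inT) I0 I1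
  plan inT inT inM inT inM inM inT inT = contract (typing inT inT inT inT inM inM inT inM inM inT inT) I0 I1
  plan inT inC inT inT inT inC inT inC = contract (typing inT inT inC inT inT inT inC inT inC inT inC) I2 I2
  plan inT inC inT inT inT inC inM inC = contract (typing inT inT inC inT inT inT inC inT inC inM inC) I2 I2
  plan inT inC inT inT inM inC inT inC = contract (typing inT inT inC inT inT inT inC inM inC inT inC) I2 I2
  plan inT inC inT inT inM inC inM inC = contract (typing inT inT inC inT inT inT inC inM inC inM inC) I2 I2
  plan inT inC inT inC inC inC inC inC = trapped (quadB true true false false) I0
  plan inT inC inT inM inT inC inT inC = contract (typing inT inM inC inT inT inT inC inT inC inT inC) I2 I2
  plan inT inC inC inT inT inC inC inT = contract (typing inT inT inC inT inM inC inT inT inC inC inT) I0 I3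
  plan inT inC inC inT inM inC inC inT = contract (typing inT inT inC inT inM inC inT inM inC inC inT) I0 I3
  plan inT inC inC inC inC inC inT inT = contract (typing inT inC inC inC inT inC inT inC inC inT inT) I3 I3
  plan inT inM inT inT inT inT inT inT = contract (typing inT inT inM inT inM inT inT inT inT inT inT) I0 I2
  plan inT inM inT inT inT inT inM inT = contract (typing inT inT inM inT inM inT inT inT inT inM inT) I0 I2
  plan inT inM inT inT inM inT inT inT = contract (typing inT inT inM inT inM inT inT inM inT inT inT) I0 I2
  plan inT inM inT inT inM inT inM inT = contract (typing inT inT inM inT inM inT inT inM inT inM inT) I0 I2
  plan inT inM inT inC inC inT inC inT = contract (typing inT inC inM inC inT inT inT inC inT inC inT) I3 I2
  plan inT inM inT inM inT inT inT inT = special S0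
  plan inC inT inT inT inC inC inT inT = contract (typing inC inT inT inT inM inT inT inC inC inT inT) I0 I3
  plan inC inT inT inT inC inC inT inM = contract (typing inC inT inT inT inT inM inT inC inC inT inM) I2 I1
  plan inC inT inT inT inC inC inM inT = contract (typing inC inT inT inT inM inT inT inC inC inM inT) I0 I3
  plan inC inT inT inT inC inC inM inM = trapped (quadB true true true true) I0
  plan inC inT inT inC inT inC inC inT = contract (typing inC inC inT inC inT inT inT inT inC inC inT) I3 I3
  plan inC inT inT inC inT inC inC inM = contract (typing inC inC inT inC inT inT inT inT inC inC inM) I3 I3
  plan inC inT inC inT inC inC inC inC = trapped (quadB true false true false) I0
  plan inC inT inC inC inT inC inT inC = contract (typing inC inC inT inT inC inM inT inT inC inT inC) I2 I1
  plan inC inT inM inT inC inC inT inT = contract (typing inC inT inT inT inM inM inT inC inC inT inT) I0 I1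
  plan inC inC inT inT inC inT inT inC = contract (typing inC inT inC inT inT inT inC inC inT inT inC) I2 I2
  plan inC inC inT inT inC inT inM inC = contract (typing inC inT inC inT inT inT inC inC inT inM inC) I2 I2
  plan inC inC inT inC inT inT inC inC = trapped (quadB false false true true) I2
  plan inC inC inC inT inC inT inC inT = contract (typing inC inT inC inT inM inC inT inC inT inC inT) I0 I3
  plan inC inC inC inC inT inT inT inT = contract (typing inC inC inC inC inT inC inT inT inT inT inT) I3 I3
  plan inM inT inT inT inT inT inT inT = contract (typing inM inT inT inT inM inT inT inT inT inT inT) I0 I3
  plan inM inT inT inT inT inT inT inM = contract (typing inM inT inT inT inT inM inT inT inT inT inM) I2 I1
  plan inM inT inT inT inT inT inM inT = contract (typing inM inT inT inT inM inT inT inT inT inM inT) I0 I3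
  plan inM inT inT inT inT inT inM inM = special S1
  plan inM inT inC inT inT inT inC inC = special S2
  plan inM inT inM inT inT inT inT inT = contract (typing inM inT inT inT inM inM inT inT inT inT inT) I0 I1
  plan inT inT inT inT _ _ _ _ = cycleInT
  plan _ _ _ _ _ _ _ _ = invalid

  specQ specF : SIdx → Fin 4 → Part
  specQ S0 = qA
  specQ S1 = qB
  specQ S2 = qC
  specF S0 = fA
  specF S1 = fB
  specF S2 = fC

  eqAll : (Fin 4 → Part) → (Fin 4 → Part) → Bool
  eqAll q r = all4 λ i → samePart (q i) (r i)

  eqAllS : (q r : Fin 4 → Part) → T (eqAll q r) → ∀ i → q i ≡ r i
  eqAllS q r t i = samePart-sound (all4S {λ i → samePart (q i) (r i)} t i)

  dropA5A3 : Selection → Selection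
  dropA5A3 tb0 = removeT tb0 (house h53)

  planOK : (Fin 4 → Part) → (Fin 4 → Part) → Plan → Bool
  planOK q f (contract typ a b) = contractionOK (selectT typ) a b q f ∧ (degreesOK typ ∧ pendantsAgree typ f)
  planOK q f (contractSwap tb0 a b typ) = contractionOK tb0 a b q f ∧ (exchangeOK tb0 (dropA5A3 tb0) (selectT typ) (house h53) (house h63) ∧
    (houseConnected (dropA5A3 tb0) A6 A5 ∧ (degreesOK typ ∧ pendantsAgree typ f)))
  planOK q f (trapped S i0) = S i0 ∧ closedOK q f S
  planOK q f (special k) = eqAll q (specQ k) ∧ eqAll f (specF k)
  planOK q f cycleInT = eqAll q (quad inT inT inT inT)
  planOK q f invalid = false

  specEqs : (k : SIdx) (q f : Fin 4 → Part) → (∀ k → cyclePart k ≡ q k) → (∀ k → pendantPart k ≡ f k) → T (planOK q f (special k)) →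
    (∀ i → cyclePart i ≡ specQ k i) × (∀ i → pendantPart i ≡ specF k i)
  specEqs k q f eqq eqf ok = (λ i → trans (eqq i) (eqAllS q (specQ k) (∧S1 ok) i)) ,
    (λ i → trans (eqf i) (eqAllS f (specF k) (∧S2 {eqAll q (specQ k)} ok) i))

  solve : (pl : Plan) (q f : Fin 4 → Part) → (∀ k → cyclePart k ≡ q k) → (∀ k → pendantPart k ≡ f k) → T (planOK q f pl) → HasThreeDecomposition HAdj
  solve (contract typ a b) q f eqq eqf ok =
    assemble′ typ f eqf (∧S2 {degreesOK typ} r1) (∧S1 r1) (contractedTree (selectT typ) a b q f eqq eqf (∧S1 ok))
    where
    r1 = ∧S2 {contractionOK (selectT typ) a b q f} ok
  solve (contractSwap tb0 a b typ) q f eqq eqf ok = assemble′ typ f eqf (∧S2 {degreesOK typ} r3) (∧S1 r3) st2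
    where
    r1 = ∧S2 {contractionOK tb0 a b q f} ok
    r2 = ∧S2 {exchangeOK tb0 (dropA5A3 tb0) (selectT typ) (house h53) (house h63)} r1
    r3 = ∧S2 {houseConnected (dropA5A3 tb0) A6 A5} r2
    st0 : SpanningTree HAdj (liftRel Tr tb0)
    st0 = contractedTree tb0 a b q f eqq eqf (∧S1 ok)
    st2 : SpanningTree HAdj (liftRel Tr (selectT typ))
    st2 = exchangeGadgetEdges tb0 (dropA5A3 tb0) (selectT typ) (house h53) (house h63) (inj₂ A5) (inj₂ A3) (inj₂ A6) (inj₂ A3)
            (inj₁ (refl , refl)) (inj₁ (refl , refl)) (∧S1 r1)
            (liftH (dropA5A3 tb0) (houseConnected-sound (dropA5A3 tb0) A6 A5 (∧S1 r2))) ε st0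
  solve (trapped S i0) q f eqq eqf ok = ⊥-elim (closed-impossible q f S i0 eqq eqf (∧S1 ok) (∧S2 {S i0} ok))
  solve (special S0) q f eqq eqf ok = specialA (proj₁ (specEqs S0 q f eqq eqf ok)) (proj₂ (specEqs S0 q f eqq eqf ok))
  solve (special S1) q f eqq eqf ok = specialB (proj₁ (specEqs S1 q f eqq eqf ok)) (proj₂ (specEqs S1 q f eqq eqf ok))
  solve (special S2) q f eqq eqf ok = specialC (proj₁ (specEqs S2 q f eqq eqf ok)) (proj₂ (specEqs S2 q f eqq eqf ok))
  solve cycleInT q f eqq eqf ok = ⊥-elim (acycT (u1 , u2 ∷ u4 ∷ u3 ∷ [] , s≤s (s≤s z≤n) , uq , lk))
    where
    e : ∀ i → cyclePart i ≡ inT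
    e i = trans (eqq i) (trans (eqAllS q (quad inT inT inT inT) ok i) (allt i))
      where
      allt : ∀ i → quad inT inT inT inT i ≡ inT
      allt I0 = refl
      allt I1 = refl
      allt I2 = refl
      allt I3 = refl
    t : (i : Fin 4) (p : Pos) → p ≢ pW → Tr (u i) (nbr i p)
    t i p np = introT i p (trans (partAt-cyclePart i p np) (e (cycleEdgeIndex i p)))
    uq : Unique (u1 ∷ u2 ∷ u4 ∷ u3 ∷ [])
    uq = (d12 ∷ d14 ∷ d13 ∷ []) ∷ (d24 ∷ d23 ∷ []) ∷ ((λ z → d34 (sym z)) ∷ []) ∷ [] ∷ []
    lk : Linked Tr (u1 ∷ (u2 ∷ u4 ∷ u3 ∷ []) ++ u1 ∷ [])
    lk = t I0 pA (λ ()) ∷ t I1 pB (λ ()) ∷ t I3 pB (λ ()) ∷ t I2 pB (λ ()) ∷ [-]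
  solve invalid q f eqq eqf ()

  parts : List Part
  parts = inT ∷ inC ∷ inM ∷ []

  parts-complete : (t : Part) → t ∈ parts
  parts-complete inT = here refl
  parts-complete inC = there (here refl)
  parts-complete inM = there (there (here refl))

  planCorrect : Part → Part → Part → Part → Part → Part → Part → Part → Bool
  planCorrect a b c d e f g h = imp (validConfiguration (quad a b c d) (quad e f g h)) (planOK (quad a b c d) (quad e f g h) (plan a b c d e f g h))

  L7 : Part → Part → Part → Part → Part → Part → Part → Bool
  L7 a b c d e f g = allL parts (planCorrect a b c d e f g)
  L6 : Part → Part → Part → Part → Part → Part → Bool
  L6 a b c d e f = allL parts (L7 a b c d e f)
  L5 : Part → Part → Part → Part → Part → Bool
  L5 a b c d e = allL parts (L6 a b c d e)
  L4 : Part → Part → Part → Part → Bool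
  L4 a b c d = allL parts (L5 a b c d)
  L3 : Part → Part → Part → Bool
  L3 a b c = allL parts (L4 a b c)
  L2 : Part → Part → Bool
  L2 a b = allL parts (L3 a b)
  L1 : Part → Bool
  L1 a = allL parts (L2 a)
  L0 : Bool
  L0 = allL parts L1

  -- Evaluates planOK on all 3⁸ configurations.
  allPlansCorrect : T L0
  allPlansCorrect = tt

  planCorrect-all : ∀ a b c d e f g h → T (planCorrect a b c d e f g h)
  planCorrect-all a b c d e f g h =
    allLS parts {planCorrect a b c d e f g} (allLS parts {L7 a b c d e f} (allLS parts {L6 a b c d e} (allLS parts {L5 a b c d}
      (allLS parts {L4 a b c} (allLS parts {L3 a b} (allLS parts {L2 a} (allLS parts {L1} allPlansCorrect (parts-complete a)) (parts-complete b)) (parts-complete c)) (parts-complete d))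
      (parts-complete e)) (parts-complete f)) (parts-complete g)) (parts-complete h)

  qv fv : Fin 4 → Part
  qv = quad (cyclePart I0) (cyclePart I1) (cyclePart I2) (cyclePart I3)
  fv = quad (pendantPart I0) (pendantPart I1) (pendantPart I2) (pendantPart I3)

  eqqv : ∀ k → cyclePart k ≡ qv k
  eqqv I0 = refl
  eqqv I1 = refl
  eqqv I2 = refl
  eqqv I3 = refl

  eqfv : ∀ k → pendantPart k ≡ fv k
  eqfv I0 = refl
  eqfv I1 = refl
  eqfv I2 = refl
  eqfv I3 = refl

  decomposition : HasThreeDecomposition HAdj
  decomposition =
    solve (plan (cyclePart I0) (cyclePart I1) (cyclePart I2) (cyclePart I3)
                (pendantPart I0) (pendantPart I1) (pendantPart I2) (pendantPart I3)) qv fv eqqv eqfv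
    (impS (planCorrect-all (cyclePart I0) (cyclePart I1) (cyclePart I2) (cyclePart I3)
                           (pendantPart I0) (pendantPart I1) (pendantPart I2) (pendantPart I3))
          (configurationValid qv fv eqqv eqfv))

lemma19 : (n : ℕ) (E : Adj (Fin n)) → IsSimple E → Cubic E → HasThreeDecomposition E →
    (u1 u2 u3 u4 w1 w2 w3 w4 : Fin n) →
    InducedC4 E u1 u2 u3 u4 →
    E u1 w1 → E u2 w2 → E u3 w3 → E u4 w4 →
    OffCycle u1 u2 u3 u4 w1 → OffCycle u1 u2 u3 u4 w2 →
    OffCycle u1 u2 u3 u4 w3 → OffCycle u1 u2 u3 u4 w4 →
    HasThreeDecomposition (HE E u1 u2 u3 u4 w1 w2 w3 w4)
lemma19 n E s c (Tr , C , M , d) u1 u2 u3 u4 w1 w2 w3 w4 ic e1 e2 e3 e4 o1 o2 o3 o4 =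
  Reduction.decomposition n E s c Tr C M d u1 u2 u3 u4 w1 w2 w3 w4 ic e1 e2 e3 e4 o1 o2 o3 o4
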